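{- For every $n\ge0$, the polynomial $T_n(t)$ is divisible by $(1+t)^{\lfloor n/2\rfloor}$. Moreover, setting $U_n(t)=T_n(t)/(1+t)^{\lfloor n/2\rfloor}$, for every $n\ge 0$, \[ U_{2n}(-1)=-U_{2n+1}(-1)=\frac{(-1)^nE_{2n+1}}{2^n}. \]
   Context: For a permutation $w=w_1\cdots w_n$ of $\{1,\dots,n\}$, a subsequence $w_{i_1}\cdots w_{i_k}$ ($i_1<\cdots<i_k$) is alternating if $w_{i_1}>w_{i_2}<w_{i_3}>w_{i_4}<\cdots$ (starting with a descent; length-$1$ sequences are alternating). Let $\mathrm{as}(w)$ be the maximum length of an alternating subsequence of $w$ ($\mathrm{as}=0$ for the empty permutation). Let $a_k(n)$ be the number of permutations $w$ of $\{1,\dots,n\}$ with $\mathrm{as}(w)=k$, and $T_n(t)=\sum_{k=0}^n a_k(n)t^k$. The tangent numbers $E_{2n+1}$ are defined by $\tan x=\sum_{n\ge0}E_{2n+1}\frac{x^{2n+1}}{(2n+1)!}$ (equivalently, $E_{2n+1}$ is the number of permutations $w$ of $\{1,\dots,2n+1\}$ with $w_1>w_2<w_3>\cdots$). -}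

module Defs where

open import Data.Bool using (Bool; true; false; _∧_; not)
open import Data.Nat using (_/_; ℕ; zero; suc; _⊔_; _<ᵇ_; _≡ᵇ_; _+_; _*_)
open import Data.List using (List; []; _∷_; _++_; map; length; foldr; filterᵇ; upTo; concatMap)
open import Data.Bool.ListAction using (any)
open import Relation.Binary.PropositionalEquality using (_≡_)
open import Data.Integer using (ℤ; +_) renaming (_+_ to _+ℤ_; _*_ to _*ℤ_)

words : ℕ → ℕ → List (List ℕ)
words zero    n = [] ∷ []
words (suc m) n = concatMap (λ w → map (λ i → suc i ∷ w) (upTo n)) (words m n)

distinct : List ℕ → Bool
distinct []       = true
distinct (x ∷ xs) = not (any (λ y → x ≡ᵇ y) xs) ∧ distinct xs

-- a word of length n over {1..n} with distinct entries is exactly a permutation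
perms : ℕ → List (List ℕ)
perms n = filterᵇ distinct (words n n)

mutual
  altDown : List ℕ → Bool
  altDown []            = true
  altDown (x ∷ [])      = true
  altDown (x ∷ y ∷ r)   = (y <ᵇ x) ∧ altUp (y ∷ r)

  altUp : List ℕ → Bool
  altUp []              = true
  altUp (x ∷ [])        = true
  altUp (x ∷ y ∷ r)     = (x <ᵇ y) ∧ altDown (y ∷ r)

subseqs : List ℕ → List (List ℕ)
subseqs []       = [] ∷ []
subseqs (x ∷ xs) = map (x ∷_) (subseqs xs) ++ subseqs xs

maxList : List ℕ → ℕ
maxList = foldr _⊔_ 0

as : List ℕ → ℕ
as w = maxList (map length (filterᵇ altDown (subseqs w)))

count : {A : Set} → (A → Bool) → List A → ℕ
count p xs = length (filterᵇ p xs)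

a : ℕ → ℕ → ℕ
a k n = count (λ w → as w ≡ᵇ k) (perms n)

-- Integer polynomials as coefficient lists (index i = coefficient of tⁱ)

Poly : Set
Poly = List ℤ

coeff : Poly → ℕ → ℤ
coeff []       _       = + 0
coeff (c ∷ p)  zero    = c
coeff (c ∷ p)  (suc k) = coeff p k

_+ₚ_ : Poly → Poly → Poly
[]      +ₚ q       = q
(c ∷ p) +ₚ []      = c ∷ p
(c ∷ p) +ₚ (d ∷ q) = (c +ℤ d) ∷ (p +ₚ q)

_*ₚ_ : Poly → Poly → Poly
[]      *ₚ q = []
(c ∷ p) *ₚ q = map (c *ℤ_) q +ₚ (+ 0 ∷ (p *ₚ q))

_^ₚ_ : Poly → ℕ → Poly
p ^ₚ zero  = + 1 ∷ []
p ^ₚ suc m = p *ₚ (p ^ₚ m)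

eval : Poly → ℤ → ℤ
eval []      x = + 0
eval (c ∷ p) x = c +ℤ (x *ℤ eval p x)

_≈ₚ_ : Poly → Poly → Set
p ≈ₚ q = ∀ k → coeff p k ≡ coeff q k

onePlusT : Poly
onePlusT = + 1 ∷ + 1 ∷ []

Tpoly : ℕ → Poly
Tpoly n = map (λ k → + a k n) (upTo (suc n))

-- E_{2m+1}: number of permutations w of {1,…,2m+1} with w₁ > w₂ < w₃ > ⋯
tangent : ℕ → ℕ
tangent m = count altDown (perms (suc (2 * m)))

IsQuotient : ℕ → Poly → Set
IsQuotient n U = Tpoly n ≈ₚ ((onePlusT ^ₚ (n / 2)) *ₚ U)

module Submission where

open import Defs

-- A longest alternating subsequence can be chosen greedily, so as(w) is computed
-- by a left-to-right scan.  Inserting the letter n + 1 into a permutation w of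
-- {1,…,n} with as(w) = r gives r permutations with as = r, one with r + 1 and
-- n − r with r + 2; hence a_k(n+1) = k a_k(n) + a_{k−1}(n) + (n − k + 2) a_{k−2}(n),
-- i.e. T_{n+1} = (t − t³) T_n′ + (t + n t²) T_n.  This recurrence is solved by
-- T_n = Σ_j γ(n, j) tʲ (1 + t)ⁿ⁻ʲ, where Γ_n = Σ_j γ(n, j) tʲ satisfies
-- Γ_{n+1} = (n + 1) t Γ_n + (t − 2t²) Γ_n′.  As deg Γ_n = ⌈n/2⌉, the factor
-- (1 + t)^⌊n/2⌋ splits off and U_n(−1) = (−1)^c γ(n, c) with c = ⌈n/2⌉, while
-- γ(2m + 1, m + 1) = γ(2m, m).  Finally E_{2m+1} is the leading coefficient of
-- T_{2m+1}, which is Γ_{2m+1}(1).  The Γ_n satisfy the Riccati equation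
-- 2 Γ_{n+2} = Σ_i C(n+1, i) Γ_i Γ_{n+1−i}; at t = 1 it becomes tan′ = 1 + tan²,
-- and in the leading coefficients it is the same recurrence scaled by 2, which
-- gives Γ_{2m+1}(1) = 2^m γ(2m + 1, m + 1).

module AlternatingRuns where

  open import Data.Bool using (true; false; _∧_; if_then_else_; T)
  open import Relation.Nullary.Decidable using (T?)
  open import Data.Bool.Properties using (T-∧)
  open import Data.Empty using (⊥-elim)
  open import Data.Nat
  open import Data.Nat.Properties
  open import Data.List using (List; []; _∷_; map; length; filterᵇ)
  open import Data.List.Membership.Propositional using (_∈_)
  open import Data.List.Membership.Propositional.Properties
    using (∈-++⁺ˡ; ∈-++⁺ʳ; ∈-++⁻; ∈-map⁺; ∈-map⁻; ∈-filter⁺; ∈-filter⁻)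
  open import Data.List.Relation.Unary.Any using (here; there)
  open import Data.List.Relation.Unary.All as All using (All; []; _∷_)
  open import Data.List.Relation.Unary.Unique.Propositional using (Unique; _∷_)
  open import Data.List.Relation.Binary.Sublist.Propositional using (_⊆_; []; _∷_; _∷ʳ_)
  open import Data.List.Relation.Binary.Sublist.Propositional.Properties using (All-resp-⊆; ∷⁻)
  open import Data.Product using (∃-syntax; _×_; _,_; proj₂)
  open import Data.Sum using (inj₁; inj₂)
  open import Function using (_∘_)
  open import Function.Bundles using (Equivalence)
  open import Relation.Binary.PropositionalEquality
  open import Relation.Nullary.Reflects using (ofʸ; ofⁿ)
  open import Relation.Nullary using (¬_; yes; no)
  open import Relation.Binary.Definitions using (tri<; tri≈; tri>)
  open import Data.Bool.Properties using (T-≡)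

  T-∧⁻ : ∀ {x y} → T (x ∧ y) → T x × T y
  T-∧⁻ = Equivalence.to T-∧

  -- fromPeak p w is the length of a longest alternating continuation of w
  -- after a peak p (its first step goes down), computed greedily: while the
  -- next letter goes the wrong way it replaces p.
  mutual
    fromPeak : ℕ → List ℕ → ℕ
    fromPeak p []       = 0
    fromPeak p (x ∷ xs) = if p <ᵇ x then fromPeak x xs else suc (fromValley x xs)

    fromValley : ℕ → List ℕ → ℕ
    fromValley p []       = 0
    fromValley p (x ∷ xs) = if x <ᵇ p then fromValley x xs else suc (fromPeak x xs)

  mutual
    fromPeak≤1+fromValley : ∀ p q w → fromPeak p w ≤ suc (fromValley q w)
    fromPeak≤1+fromValley p q [] = z≤n
    fromPeak≤1+fromValley p q (x ∷ xs) with p <ᵇ x | x <ᵇ q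
    ... | true  | true  = fromPeak≤1+fromValley x x xs
    ... | true  | false = m≤n+m _ 2
    ... | false | true  = ≤-refl
    ... | false | false = s≤s (fromValley≤1+fromPeak x x xs)

    fromValley≤1+fromPeak : ∀ p q w → fromValley p w ≤ suc (fromPeak q w)
    fromValley≤1+fromPeak p q [] = z≤n
    fromValley≤1+fromPeak p q (x ∷ xs) with x <ᵇ p | q <ᵇ x
    ... | true  | true  = fromValley≤1+fromPeak x x xs
    ... | true  | false = m≤n+m _ 2
    ... | false | true  = ≤-refl
    ... | false | false = s≤s (fromPeak≤1+fromValley x x xs)

  mutual
    alternating≤fromPeak : ∀ {p q s w} → s ⊆ w → T (altDown (q ∷ s)) → q ≤ p →
                           length s ≤ fromPeak p w
    alternating≤fromPeak [] _ _ = z≤n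
    alternating≤fromPeak {p} {q} (_∷ʳ_ {ys = xs} x s⊆w) alt q≤p with p <ᵇ x | <ᵇ-reflects-< p x
    ... | true  | ofʸ p<x = alternating≤fromPeak s⊆w alt (≤-trans q≤p (<⇒≤ p<x))
    ... | false | ofⁿ _   =
      ≤-trans (alternating≤fromPeak s⊆w alt ≤-refl) (fromPeak≤1+fromValley q x xs)
    alternating≤fromPeak {p} {q} (_∷_ {x = x} refl s⊆w) alt q≤p
      with T-∧⁻ {x <ᵇ q} alt | p <ᵇ x | <ᵇ-reflects-< p x
    ... | x<q , _    | true  | ofʸ p<x = ⊥-elim (<-asym (<-≤-trans (<ᵇ⇒< x q x<q) q≤p) p<x)
    ... | _ , altUp | false | ofⁿ _   = s≤s (alternating≤fromValley s⊆w altUp ≤-refl)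

    alternating≤fromValley : ∀ {p q s w} → s ⊆ w → T (altUp (q ∷ s)) → p ≤ q →
                             length s ≤ fromValley p w
    alternating≤fromValley [] _ _ = z≤n
    alternating≤fromValley {p} {q} (_∷ʳ_ {ys = xs} x s⊆w) alt p≤q with x <ᵇ p | <ᵇ-reflects-< x p
    ... | true  | ofʸ x<p = alternating≤fromValley s⊆w alt (≤-trans (<⇒≤ x<p) p≤q)
    ... | false | ofⁿ _   =
      ≤-trans (alternating≤fromValley s⊆w alt ≤-refl) (fromValley≤1+fromPeak q x xs)
    alternating≤fromValley {p} {q} (_∷_ {x = x} refl s⊆w) alt p≤q
      with T-∧⁻ {q <ᵇ x} alt | x <ᵇ p | <ᵇ-reflects-< x p
    ... | q<x , _      | true  | ofʸ x<p = ⊥-elim (<-asym (<-≤-trans x<p p≤q) (<ᵇ⇒< q x q<x))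
    ... | _ , altDown | false | ofⁿ _   = s≤s (alternating≤fromPeak s⊆w altDown ≤-refl)

  mutual
    fromValley-witness : ∀ p w → Unique (p ∷ w) →
      ∃[ v ] ∃[ s ] v ∷ s ⊆ p ∷ w × v ≤ p × T (altUp (v ∷ s)) × length s ≡ fromValley p w
    fromValley-witness p [] _ = p , [] , refl ∷ [] , ≤-refl , _ , refl
    fromValley-witness p (x ∷ xs) ((p≢x ∷ _) ∷ u) with x <ᵇ p | <ᵇ-reflects-< x p
    ... | true | ofʸ x<p =
      let v , s , vs⊆xs , v≤x , alt , len = fromValley-witness x xs u
      in v , s , p ∷ʳ vs⊆xs , ≤-trans v≤x (<⇒≤ x<p) , alt , len
    ... | false | ofⁿ x≮p =
      let v , s , vs⊆xs , x≤v , alt , len = fromPeak-witness x xs u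
          p<v = <-≤-trans (≤∧≢⇒< (≮⇒≥ x≮p) p≢x) x≤v
      in p , v ∷ s , refl ∷ vs⊆xs , ≤-refl , Equivalence.from T-∧ (<⇒<ᵇ p<v , alt) , cong suc len

    fromPeak-witness : ∀ p w → Unique (p ∷ w) →
      ∃[ v ] ∃[ s ] v ∷ s ⊆ p ∷ w × p ≤ v × T (altDown (v ∷ s)) × length s ≡ fromPeak p w
    fromPeak-witness p [] _ = p , [] , refl ∷ [] , ≤-refl , _ , refl
    fromPeak-witness p (x ∷ xs) ((p≢x ∷ _) ∷ u) with p <ᵇ x | <ᵇ-reflects-< p x
    ... | true | ofʸ p<x =
      let v , s , vs⊆xs , x≤v , alt , len = fromPeak-witness x xs u
      in v , s , p ∷ʳ vs⊆xs , ≤-trans (<⇒≤ p<x) x≤v , alt , len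
    ... | false | ofⁿ p≮x =
      let v , s , vs⊆xs , v≤x , alt , len = fromValley-witness x xs u
          v<p = ≤-<-trans v≤x (≤∧≢⇒< (≮⇒≥ p≮x) (p≢x ∘ sym))
      in p , v ∷ s , refl ∷ vs⊆xs , ≤-refl , Equivalence.from T-∧ (<⇒<ᵇ v<p , alt) , cong suc len

  ⊆⇒∈-subseqs : ∀ {s w} → s ⊆ w → s ∈ subseqs w
  ⊆⇒∈-subseqs [] = here refl
  ⊆⇒∈-subseqs (_∷ʳ_ {ys = xs} x s⊆w) = ∈-++⁺ʳ (map (x ∷_) (subseqs xs)) (⊆⇒∈-subseqs s⊆w)
  ⊆⇒∈-subseqs (refl ∷ s⊆w) = ∈-++⁺ˡ (∈-map⁺ _ (⊆⇒∈-subseqs s⊆w))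

  ∈-subseqs⇒⊆ : ∀ {s} w → s ∈ subseqs w → s ⊆ w
  ∈-subseqs⇒⊆ [] (here refl) = []
  ∈-subseqs⇒⊆ (x ∷ xs) s∈ with ∈-++⁻ (map (x ∷_) (subseqs xs)) s∈
  ... | inj₂ s∈xs = x ∷ʳ ∈-subseqs⇒⊆ xs s∈xs
  ... | inj₁ s∈x∷ with ∈-map⁻ (x ∷_) s∈x∷
  ...   | s , s∈xs , refl = refl ∷ ∈-subseqs⇒⊆ xs s∈xs

  ∈⇒≤maxList : ∀ {x xs} → x ∈ xs → x ≤ maxList xs
  ∈⇒≤maxList {xs = y ∷ ys} (here refl) = m≤m⊔n y (maxList ys)
  ∈⇒≤maxList {xs = y ∷ ys} (there x∈) = ≤-trans (∈⇒≤maxList x∈) (m≤n⊔m y (maxList ys))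

  maxList≤ : ∀ {b} xs → (∀ {x} → x ∈ xs → x ≤ b) → maxList xs ≤ b
  maxList≤ []       _     = z≤n
  maxList≤ (y ∷ ys) bound = ⊔-lub (bound (here refl)) (maxList≤ ys (bound ∘ there))

  altUp-0∷⇒altDown : ∀ {s} → All (0 <_) s → T (altUp (0 ∷ s)) → T (altDown s)
  altUp-0∷⇒altDown [] _ = _
  altUp-0∷⇒altDown (_ ∷ _) alt = proj₂ (T-∧⁻ alt)

  altDown⇒altUp-0∷ : ∀ {s} → All (0 <_) s → T (altDown s) → T (altUp (0 ∷ s))
  altDown⇒altUp-0∷ [] _ = _
  altDown⇒altUp-0∷ (0<y ∷ _) alt = Equivalence.from T-∧ (<⇒<ᵇ 0<y , alt)

  Unique-0∷⇒positive : ∀ {w} → Unique (0 ∷ w) → All (0 <_) w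
  Unique-0∷⇒positive (0≢w ∷ _) = All.map (λ 0≢x → n≢0⇒n>0 (0≢x ∘ sym)) 0≢w

  -- 0 serves as a virtual valley in front of a word of positive letters.
  as≡fromValley0 : ∀ w → Unique (0 ∷ w) → as w ≡ fromValley 0 w
  as≡fromValley0 w u = ≤-antisym upper lower
    where
    positive : All (0 <_) w
    positive = Unique-0∷⇒positive u

    upper : as w ≤ fromValley 0 w
    upper = maxList≤ _ λ ℓ∈ →
      let s , s∈ , ℓ≡ = ∈-map⁻ length ℓ∈
          s∈subseqs , alt = ∈-filter⁻ (T? ∘ altDown) {xs = subseqs w} s∈
          s⊆w = ∈-subseqs⇒⊆ w s∈subseqs
      in subst (_≤ fromValley 0 w) (sym ℓ≡)
           (alternating≤fromValley s⊆w (altDown⇒altUp-0∷ (All-resp-⊆ s⊆w positive) alt) z≤n)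

    lower : fromValley 0 w ≤ as w
    lower with fromValley-witness 0 w u
    ... | v , s , vs⊆0w , v≤0 , alt , len = subst (_≤ as w) len (∈⇒≤maxList (∈-map⁺ length s∈))
      where
      s⊆w : s ⊆ w
      s⊆w = ∷⁻ vs⊆0w
      s∈ : s ∈ filterᵇ altDown (subseqs w)
      s∈ = ∈-filter⁺ (T? ∘ altDown) (⊆⇒∈-subseqs s⊆w)
             (altUp-0∷⇒altDown (All-resp-⊆ s⊆w positive)
                               (subst (λ v → T (altUp (v ∷ s))) (n≤0⇒n≡0 v≤0) alt))

  fromPeak-up : ∀ {p x} → p < x → ∀ v → fromPeak p (x ∷ v) ≡ fromPeak x v
  fromPeak-up {p} {x} p<x v with p <ᵇ x | <ᵇ-reflects-< p x
  ... | true  | _        = refl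
  ... | false | ofⁿ p≮x = ⊥-elim (p≮x p<x)

  fromPeak-down : ∀ {p x} → x ≤ p → ∀ v → fromPeak p (x ∷ v) ≡ suc (fromValley x v)
  fromPeak-down {p} {x} x≤p v with p <ᵇ x | <ᵇ-reflects-< p x
  ... | true  | ofʸ p<x = ⊥-elim (<⇒≱ p<x x≤p)
  ... | false | _        = refl

  fromValley-down : ∀ {p x} → x < p → ∀ v → fromValley p (x ∷ v) ≡ fromValley x v
  fromValley-down {p} {x} x<p v with x <ᵇ p | <ᵇ-reflects-< x p
  ... | true  | _        = refl
  ... | false | ofⁿ x≮p = ⊥-elim (x≮p x<p)

  fromValley-up : ∀ {p x} → p ≤ x → ∀ v → fromValley p (x ∷ v) ≡ suc (fromPeak x v)
  fromValley-up {p} {x} p≤x v with x <ᵇ p | <ᵇ-reflects-< x p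
  ... | true  | ofʸ x<p = ⊥-elim (<⇒≱ x<p p≤x)
  ... | false | _        = refl

  mutual
    fromPeak≤length : ∀ p w → fromPeak p w ≤ length w
    fromPeak≤length p []       = z≤n
    fromPeak≤length p (x ∷ xs) with p <? x
    ... | yes p<x rewrite fromPeak-up p<x xs = m≤n⇒m≤1+n (fromPeak≤length x xs)
    ... | no  p≮x rewrite fromPeak-down (≮⇒≥ p≮x) xs = s≤s (fromValley≤length x xs)

    fromValley≤length : ∀ p w → fromValley p w ≤ length w
    fromValley≤length p []       = z≤n
    fromValley≤length p (x ∷ xs) with x <? p
    ... | yes x<p rewrite fromValley-down x<p xs = m≤n⇒m≤1+n (fromValley≤length x xs)
    ... | no  x≮p rewrite fromValley-up (≮⇒≥ x≮p) xs = s≤s (fromPeak≤length x xs)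

  <ᵇ-true : ∀ {m n} → m < n → (m <ᵇ n) ≡ true
  <ᵇ-true m<n = Equivalence.to T-≡ (<⇒<ᵇ m<n)

  <ᵇ-false : ∀ {m n} → ¬ m < n → (m <ᵇ n) ≡ false
  <ᵇ-false {m} {n} m≮n with m <ᵇ n | <ᵇ-reflects-< m n
  ... | true  | ofʸ m<n = ⊥-elim (m≮n m<n)
  ... | false | _       = refl

  ≡ᵇ-false : ∀ {m n} → m ≢ n → (m ≡ᵇ n) ≡ false
  ≡ᵇ-false {m} {n} m≢n with m ≡ᵇ n in eq
  ... | true  = ⊥-elim (m≢n (≡ᵇ⇒≡ m n (subst T (sym eq) _)))
  ... | false = refl

  mutual
    fromValley≡ᵇlength : ∀ p w → Unique (p ∷ w) → (fromValley p w ≡ᵇ length w) ≡ altUp (p ∷ w)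
    fromValley≡ᵇlength p []       _                  = refl
    fromValley≡ᵇlength p (x ∷ xs) ((p≢x ∷ _) ∷ u) with <-cmp p x
    ... | tri< p<x _ _ rewrite fromValley-up (<⇒≤ p<x) xs | <ᵇ-true p<x = fromPeak≡ᵇlength x xs u
    ... | tri≈ _ p≡x _ = ⊥-elim (p≢x p≡x)
    ... | tri> _ _ x<p rewrite fromValley-down x<p xs | <ᵇ-false (<⇒≯ x<p) =
      ≡ᵇ-false (<⇒≢ (s≤s (fromValley≤length x xs)))

    fromPeak≡ᵇlength : ∀ p w → Unique (p ∷ w) → (fromPeak p w ≡ᵇ length w) ≡ altDown (p ∷ w)
    fromPeak≡ᵇlength p []       _                  = refl
    fromPeak≡ᵇlength p (x ∷ xs) ((p≢x ∷ _) ∷ u) with <-cmp p x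
    ... | tri< p<x _ _ rewrite fromPeak-up p<x xs | <ᵇ-false (<⇒≯ p<x) =
      ≡ᵇ-false (<⇒≢ (s≤s (fromPeak≤length x xs)))
    ... | tri≈ _ p≡x _ = ⊥-elim (p≢x p≡x)
    ... | tri> _ _ x<p rewrite fromPeak-down (<⇒≤ x<p) xs | <ᵇ-true x<p = fromValley≡ᵇlength x xs u

module Permutations where

  open import Data.Bool using (Bool; true; false; not; T)
  open import Data.Bool.Properties using (T-∧)
  open import Data.Bool.ListAction using (any)
  open import Data.Empty using (⊥-elim)
  open import Data.Nat
  open import Data.Nat.Properties
  open import Data.List using (List; []; _∷_; _++_; [_]; map; length; filterᵇ; upTo; concatMap)
  open import Data.List.Properties
    using (length-++; length-map; length-upTo; ∷-injectiveˡ; ∷-injectiveʳ; filter-all; filter-accept; filter-reject)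
  open import Data.List.Membership.Propositional using (_∈_; find; lose)
  open import Data.List.Membership.Propositional.Properties
    using (∈-++⁺ˡ; ∈-++⁺ʳ; ∈-++⁻; ∈-map⁺; ∈-map⁻; ∈-filter⁺; ∈-filter⁻;
           ∈-concatMap⁺; ∈-concatMap⁻; ∈-upTo⁺; ∈-upTo⁻; ∈-∃++)
  open import Data.List.Membership.DecPropositional _≟_ using (_∈?_)
  open import Data.List.Membership.Propositional.Properties.WithK using (unique∧set⇒bag)
  open import Data.List.Relation.Unary.Any using (here; there)
  open import Data.List.Relation.Unary.Any.Properties using (any⁺; any⁻)
  open import Data.List.Relation.Unary.All as All using (All; []; _∷_)
  open import Data.List.Relation.Unary.All.Properties using (All¬⇒¬Any)
  open import Data.List.Relation.Unary.Unique.Propositional using (Unique; []; _∷_)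
  import Data.List.Relation.Unary.Unique.Propositional.Properties as Unique
  open import Data.List.Relation.Binary.Permutation.Propositional
    using (_↭_; ↭-refl; ↭-sym; ↭-trans; ↭-prep; ↭-swap; ↭⇒↭ₛ)
  open import Data.List.Relation.Binary.Permutation.Propositional.Properties
    using (All-resp-↭; ↭-length; shift)
  import Data.List.Relation.Binary.Permutation.Setoid.Properties as ↭ₛ
  open import Data.List.Relation.Binary.BagAndSetEquality using (∼bag⇒↭)
  open import Data.Product using (∃-syntax; _×_; _,_)
  open import Data.Sum using (inj₁; inj₂)
  open import Function using (_∘_)
  open import Function.Bundles using (Equivalence; mk⇔)
  open import Relation.Binary.PropositionalEquality hiding ([_])
  open import Relation.Nullary using (¬_; yes; no)
  open import Relation.Nullary.Decidable using (T?)

  InRange : ℕ → ℕ → Set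
  InRange n x = 0 < x × x ≤ n

  IsPerm : ℕ → List ℕ → Set
  IsPerm n w = length w ≡ n × All (InRange n) w × Unique w

  ∈-words⁻ : ∀ m n {v} → v ∈ words m n → length v ≡ m × All (InRange n) v
  ∈-words⁻ zero    n (here refl) = refl , []
  ∈-words⁻ (suc m) n v∈ with find (∈-concatMap⁻ _ {xs = words m n} v∈)
  ... | w , w∈ , v∈w with ∈-map⁻ (λ i → suc i ∷ w) v∈w
  ...   | i , i∈ , refl =
    let len , inRange = ∈-words⁻ m n w∈ in cong suc len , (z<s , ∈-upTo⁻ i∈) ∷ inRange

  ∈-words⁺ : ∀ m n {v} → length v ≡ m → All (InRange n) v → v ∈ words m n
  ∈-words⁺ zero    n {[]}        refl [] = here refl
  ∈-words⁺ (suc m) n {suc i ∷ w} len  ((_ , i<n) ∷ inRange) =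
    ∈-concatMap⁺ _ {xs = words m n}
      (lose (∈-words⁺ m n (suc-injective len) inRange) (∈-map⁺ (λ i → suc i ∷ w) (∈-upTo⁺ i<n)))

  T-not⁺ : ∀ {b} → ¬ T b → T (not b)
  T-not⁺ {false} _  = _
  T-not⁺ {true}  ¬t = ¬t _

  T-not⁻ : ∀ {b} → T (not b) → ¬ T b
  T-not⁻ {false} _ ()

  distinct⇒Unique : ∀ v → T (distinct v) → Unique v
  distinct⇒Unique []       _ = []
  distinct⇒Unique (x ∷ xs) d with Equivalence.to T-∧ d
  ... | fresh , rest = All.tabulate x≢ ∷ distinct⇒Unique xs rest
    where
    x≢ : ∀ {y} → y ∈ xs → x ≢ y
    x≢ y∈ refl = T-not⁻ fresh (any⁺ _ (lose y∈ (≡⇒≡ᵇ x x refl)))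

  Unique⇒distinct : ∀ v → Unique v → T (distinct v)
  Unique⇒distinct []       _          = _
  Unique⇒distinct (x ∷ xs) (x≢ ∷ u) = Equivalence.from T-∧ (fresh , Unique⇒distinct xs u)
    where
    fresh : T (not (any (λ y → x ≡ᵇ y) xs))
    fresh = T-not⁺ (All¬⇒¬Any (All.map (λ x≢y t → x≢y (≡ᵇ⇒≡ x _ t)) x≢) ∘ any⁻ _ xs)

  ∈-perms⁻ : ∀ n {w} → w ∈ perms n → IsPerm n w
  ∈-perms⁻ n {w} w∈ =
    let w∈words , d = ∈-filter⁻ (T? ∘ distinct) {xs = words n n} w∈
        len , inRange = ∈-words⁻ n n w∈words
    in len , inRange , distinct⇒Unique w d

  ∈-perms⁺ : ∀ n {w} → IsPerm n w → w ∈ perms n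
  ∈-perms⁺ n {w} (len , inRange , u) =
    ∈-filter⁺ (T? ∘ distinct) (∈-words⁺ n n len inRange) (Unique⇒distinct w u)

  IsPerm⇒Unique-0∷ : ∀ {n w} → IsPerm n w → Unique (0 ∷ w)
  IsPerm⇒Unique-0∷ (_ , inRange , u) = All.map (λ (0<x , _) → <⇒≢ 0<x) inRange ∷ u

  inserts : ℕ → List ℕ → List (List ℕ)
  inserts M []       = [ M ∷ [] ]
  inserts M (x ∷ xs) = (M ∷ x ∷ xs) ∷ map (x ∷_) (inserts M xs)

  ∈-inserts⇒↭ : ∀ M w {v} → v ∈ inserts M w → v ↭ M ∷ w
  ∈-inserts⇒↭ M []       (here refl) = ↭-refl
  ∈-inserts⇒↭ M (x ∷ xs) (here refl) = ↭-refl
  ∈-inserts⇒↭ M (x ∷ xs) (there v∈) with ∈-map⁻ (x ∷_) v∈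
  ... | v , v∈xs , refl = ↭-trans (↭-prep x (∈-inserts⇒↭ M xs v∈xs)) (↭-swap x M ↭-refl)

  ++-∈-inserts : ∀ M pre post → pre ++ M ∷ post ∈ inserts M (pre ++ post)
  ++-∈-inserts M []        []       = here refl
  ++-∈-inserts M []        (_ ∷ _)  = here refl
  ++-∈-inserts M (y ∷ pre) post     = there (∈-map⁺ (y ∷_) (++-∈-inserts M pre post))

  Unique-resp-↭ : ∀ {xs ys : List ℕ} → xs ↭ ys → Unique xs → Unique ys
  Unique-resp-↭ xs↭ys = ↭ₛ.Unique-resp-↭ (setoid ℕ) (↭⇒↭ₛ xs↭ys)

  Unique⇒length≤ : ∀ {xs ys : List ℕ} → Unique xs → (∀ {x} → x ∈ xs → x ∈ ys) →
                   length xs ≤ length ys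
  Unique⇒length≤ {[]}     _          _  = z≤n
  Unique⇒length≤ {x ∷ xs} (x∉ ∷ u) xs⊆ys with ∈-∃++ (xs⊆ys (here refl))
  ... | pre , post , refl = begin
    suc (length xs)          ≤⟨ s≤s (Unique⇒length≤ u xs⊆pre++post) ⟩
    suc (length (pre ++ post)) ≡⟨ cong suc (length-++ pre) ⟩
    suc (length pre + length post) ≡⟨ sym (+-suc (length pre) (length post)) ⟩
    length pre + length (x ∷ post) ≡⟨ sym (length-++ pre) ⟩
    length (pre ++ x ∷ post) ∎
    where
    open ≤-Reasoning
    xs⊆pre++post : ∀ {y} → y ∈ xs → y ∈ pre ++ post
    xs⊆pre++post y∈ with ∈-++⁻ pre (xs⊆ys (there y∈))
    ... | inj₁ y∈pre          = ∈-++⁺ˡ y∈pre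
    ... | inj₂ (here refl)    = ⊥-elim (All.lookup x∉ y∈ refl)
    ... | inj₂ (there y∈post) = ∈-++⁺ʳ pre y∈post

  IsPerm⇒max∉ : ∀ {n w} → IsPerm n w → All (suc n ≢_) w
  IsPerm⇒max∉ (_ , inRange , _) = All.map (λ (_ , x≤n) → >⇒≢ (s≤s x≤n)) inRange

  IsPerm-insert : ∀ {n w v} → IsPerm n w → v ∈ inserts (suc n) w → IsPerm (suc n) v
  IsPerm-insert {n} {w} {v} pw@(len , inRange , u) v∈ =
    trans (↭-length v↭) (cong suc len) ,
    All-resp-↭ (↭-sym v↭) ((z<s , ≤-refl) ∷ All.map (λ (0<x , x≤n) → 0<x , m≤n⇒m≤1+n x≤n) inRange) ,
    Unique-resp-↭ (↭-sym v↭) (IsPerm⇒max∉ pw ∷ u)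
    where
    v↭ : v ↭ suc n ∷ w
    v↭ = ∈-inserts⇒↭ (suc n) w v∈

  IsPerm⇒max∈ : ∀ {n v} → IsPerm (suc n) v → suc n ∈ v
  IsPerm⇒max∈ {n} {v} (len , inRange , u) with suc n ∈? v
  ... | yes max∈ = max∈
  ... | no  max∉ = ⊥-elim (<-irrefl refl (begin-strict
    n                           <⟨ n<1+n n ⟩
    suc n                       ≡⟨ sym len ⟩
    length v                    ≤⟨ Unique⇒length≤ u v⊆range ⟩
    length (map suc (upTo n))   ≡⟨ trans (length-map suc (upTo n)) (length-upTo n) ⟩
    n                           ∎))
    where
    open ≤-Reasoning
    v⊆range : ∀ {x} → x ∈ v → x ∈ map suc (upTo n)
    v⊆range {zero}  x∈ with () ← All.lookup inRange x∈
    v⊆range {suc i} x∈ with All.lookup inRange x∈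
    ... | _ , x≤1+n = ∈-map⁺ suc (∈-upTo⁺ (s≤s⁻¹ (≤∧≢⇒< x≤1+n (λ { refl → max∉ x∈ }))))

  IsPerm-remove : ∀ {n v} → IsPerm (suc n) v → ∃[ w ] IsPerm n w × v ∈ inserts (suc n) w
  IsPerm-remove {n} pv@(len , inRange , u) with ∈-∃++ (IsPerm⇒max∈ pv)
  ... | pre , post , refl
    with v↭ ← shift (suc n) pre post
    with Unique-resp-↭ v↭ u | All-resp-↭ v↭ inRange
  ...   | max∉ ∷ u′ | _ ∷ inRange′ =
    pre ++ post ,
    (suc-injective (trans (sym (↭-length v↭)) len) ,
     All.zipWith (λ ((0<x , x≤1+n) , max≢x) → 0<x , s≤s⁻¹ (≤∧≢⇒< x≤1+n (max≢x ∘ sym)))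
       (inRange′ , max∉) ,
     u′) ,
    ++-∈-inserts (suc n) pre post

  Unique-concatMap : ∀ {A B : Set} (f : A → List B) {xs} → Unique xs →
    (∀ {x} → x ∈ xs → Unique (f x)) →
    (∀ {x y v} → x ∈ xs → y ∈ xs → v ∈ f x → v ∈ f y → x ≡ y) →
    Unique (concatMap f xs)
  Unique-concatMap f {[]}     _          _      _          = []
  Unique-concatMap f {x ∷ xs} (x∉ ∷ u) unique determined =
    Unique.++⁺ (unique (here refl))
      (Unique-concatMap f u (unique ∘ there) (λ x∈ y∈ → determined (there x∈) (there y∈)))
      disjoint
    where
    disjoint : ∀ {v} → ¬ (v ∈ f x × v ∈ concatMap f xs)
    disjoint (v∈fx , v∈rest) with find (∈-concatMap⁻ f {xs = xs} v∈rest)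
    ... | y , y∈ , v∈fy = All.lookup x∉ y∈ (determined (here refl) (there y∈) v∈fx v∈fy)

  Unique-words : ∀ m n → Unique (words m n)
  Unique-words zero    n = [] ∷ []
  Unique-words (suc m) n = Unique-concatMap _ (Unique-words m n)
    (λ _ → Unique.map⁺ (suc-injective ∘ ∷-injectiveˡ) (Unique.upTo⁺ n))
    (λ {x} {y} _ _ v∈x v∈y → tail≡ (∈-map⁻ (λ i → suc i ∷ x) v∈x)
                                   (∈-map⁻ (λ i → suc i ∷ y) v∈y))
    where
    tail≡ : ∀ {v x y} → ∃[ i ] i ∈ upTo n × v ≡ suc i ∷ x →
                        ∃[ j ] j ∈ upTo n × v ≡ suc j ∷ y → x ≡ y
    tail≡ (_ , _ , v≡x) (_ , _ , v≡y) = ∷-injectiveʳ (trans (sym v≡x) v≡y)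

  Unique-perms : ∀ n → Unique (perms n)
  Unique-perms n = Unique.filter⁺ (T? ∘ distinct) (Unique-words n n)

  isNot : ℕ → ℕ → Bool
  isNot M x = not (x ≡ᵇ M)

  remove : ℕ → List ℕ → List ℕ
  remove M = filterᵇ (isNot M)

  remove-fresh : ∀ M {w} → All (M ≢_) w → remove M w ≡ w
  remove-fresh M M∉ =
    filter-all (T? ∘ isNot M) (All.map (λ M≢x → T-not⁺ (M≢x ∘ sym ∘ ≡ᵇ⇒≡ _ M)) M∉)

  remove-∷ : ∀ M w → remove M (M ∷ w) ≡ remove M w
  remove-∷ M w = filter-reject (T? ∘ isNot M) {M} {w} (λ t → T-not⁻ t (≡⇒≡ᵇ M M refl))

  remove-inserts : ∀ M w {v} → All (M ≢_) w → v ∈ inserts M w → remove M v ≡ w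
  remove-inserts M []       _ (here refl) = remove-∷ M []
  remove-inserts M (x ∷ xs) M∉ (here refl) = trans (remove-∷ M (x ∷ xs)) (remove-fresh M M∉)
  remove-inserts M (x ∷ xs) (M≢x ∷ M∉) (there v∈) with ∈-map⁻ (x ∷_) v∈
  ... | v , v∈xs , refl = trans (filter-accept (T? ∘ isNot M) (T-not⁺ (M≢x ∘ sym ∘ ≡ᵇ⇒≡ x M)))
                                (cong (x ∷_) (remove-inserts M xs M∉ v∈xs))

  Unique-inserts : ∀ M w → All (M ≢_) w → Unique (inserts M w)
  Unique-inserts M []       _           = [] ∷ []
  Unique-inserts M (x ∷ xs) (M≢x ∷ M∉) =
    All.tabulate head≢ ∷ Unique.map⁺ ∷-injectiveʳ (Unique-inserts M xs M∉)
    where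
    head≢ : ∀ {v} → v ∈ map (x ∷_) (inserts M xs) → M ∷ x ∷ xs ≢ v
    head≢ v∈ eq with ∈-map⁻ (x ∷_) v∈
    ... | _ , _ , refl = M≢x (∷-injectiveˡ eq)

  perms-suc↭ : ∀ n → perms (suc n) ↭ concatMap (inserts (suc n)) (perms n)
  perms-suc↭ n = ∼bag⇒↭ (unique∧set⇒bag (Unique-perms (suc n)) unique (mk⇔ to from))
    where
    max∉ : ∀ {w} → w ∈ perms n → All (suc n ≢_) w
    max∉ = IsPerm⇒max∉ ∘ ∈-perms⁻ n
    unique : Unique (concatMap (inserts (suc n)) (perms n))
    unique = Unique-concatMap (inserts (suc n)) (Unique-perms n)
      (λ {w} w∈ → Unique-inserts (suc n) w (max∉ w∈))
      (λ {w} {w′} w∈ w′∈ v∈ v∈′ → trans (sym (remove-inserts (suc n) w (max∉ w∈) v∈))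
                                        (remove-inserts (suc n) w′ (max∉ w′∈) v∈′))
    to : ∀ {v} → v ∈ perms (suc n) → v ∈ concatMap (inserts (suc n)) (perms n)
    to v∈ with IsPerm-remove (∈-perms⁻ (suc n) v∈)
    ... | w , pw , v∈w = ∈-concatMap⁺ (inserts (suc n)) {xs = perms n} (lose (∈-perms⁺ n pw) v∈w)
    from : ∀ {v} → v ∈ concatMap (inserts (suc n)) (perms n) → v ∈ perms (suc n)
    from v∈ with find (∈-concatMap⁻ (inserts (suc n)) {xs = perms n} v∈)
    ... | w , w∈ , v∈w = ∈-perms⁺ (suc n) (IsPerm-insert (∈-perms⁻ n w∈) v∈w)

module Insertion where

  open AlternatingRuns
  open Permutations
  open import Data.Nat
  open import Data.Nat.Properties
  open import Data.List using (List; []; _∷_; _++_; map; length; replicate)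
  open import Data.List.Properties using (map-∘; map-cong; map-++; map-replicate)
  open import Data.List.Relation.Unary.All using (All; _∷_)
  open import Data.List.Relation.Unary.Unique.Propositional using (Unique; _∷_)
  open import Data.List.Relation.Binary.Permutation.Propositional
    using (_↭_; ↭-refl; ↭-prep; ↭-swap; module PermutationReasoning)
  open import Data.List.Relation.Binary.Permutation.Propositional.Properties
    using (shift; ++⁺ˡ)
  import Data.List.Relation.Binary.Permutation.Propositional.Properties as ↭
  open import Function using (_∘_)
  open import Relation.Binary.PropositionalEquality
  open import Relation.Nullary using (yes; no)

  profile : ℕ → ℕ → ℕ → List ℕ
  profile c r j = replicate c r ++ suc r ∷ replicate j (suc (suc r))

  ∷-profile : ∀ c r j → suc (suc r) ∷ profile c r j ↭ profile c r (suc j)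
  ∷-profile c r j = begin
    suc (suc r) ∷ replicate c r ++ suc r ∷ replicate j (suc (suc r))
      ↭⟨ shift (suc (suc r)) (replicate c r) _ ⟨
    replicate c r ++ suc (suc r) ∷ suc r ∷ replicate j (suc (suc r))
      ↭⟨ ++⁺ˡ (replicate c r) (↭-swap _ _ ↭-refl) ⟩
    replicate c r ++ suc r ∷ suc (suc r) ∷ replicate j (suc (suc r)) ∎
    where open PermutationReasoning

  map-suc-profile : ∀ c r j → map suc (profile c r j) ≡ profile c (suc r) j
  map-suc-profile c r j = begin
    map suc (profile c r j)
      ≡⟨ map-++ suc (replicate c r) _ ⟩
    map suc (replicate c r) ++ suc (suc r) ∷ map suc (replicate j (suc (suc r)))
      ≡⟨ cong₂ (λ as bs → as ++ suc (suc r) ∷ bs) (map-replicate suc c r) (map-replicate suc j _) ⟩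
    profile c (suc r) j ∎
    where open ≡-Reasoning

  map-∷ : ∀ {f g : List ℕ → ℕ} x → (∀ v → f (x ∷ v) ≡ g v) →
          ∀ vs → map f (map (x ∷_) vs) ≡ map g vs
  map-∷ x eq vs = trans (sym (map-∘ vs)) (map-cong eq vs)

  -- For the peak version, the extra entry fromValley p w + 1 completes the multiset to a profile.
  mutual
    fromValley-inserts : ∀ {M} p w → p < M → All (_< M) w → Unique (p ∷ w) →
      map (fromValley p) (inserts M w) ↭
        profile (fromValley p w) (fromValley p w) (length w ∸ fromValley p w)
    fromValley-inserts {M} p [] p<M _ _ rewrite fromValley-up (<⇒≤ p<M) [] = ↭-refl
    fromValley-inserts {M} p (x ∷ xs) p<M (x<M ∷ xs<M) (_ ∷ u)
      rewrite fromValley-up (<⇒≤ p<M) (x ∷ xs) | fromPeak-down (<⇒≤ x<M) xs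
      with x <? p
    ... | yes x<p rewrite fromValley-down x<p xs = begin
      suc (suc r) ∷ map (fromValley p) (map (x ∷_) (inserts M xs))
        ≡⟨ cong (suc (suc r) ∷_) (map-∷ x (fromValley-down x<p) (inserts M xs)) ⟩
      suc (suc r) ∷ map (fromValley x) (inserts M xs)
        ↭⟨ ↭-prep _ (fromValley-inserts x xs x<M xs<M u) ⟩
      suc (suc r) ∷ profile r r (length xs ∸ r)
        ↭⟨ ∷-profile r r (length xs ∸ r) ⟩
      profile r r (suc (length xs ∸ r))
        ≡⟨ cong (profile r r) (sym (+-∸-assoc 1 (fromValley≤length x xs))) ⟩
      profile r r (suc (length xs) ∸ r) ∎
      where
      open PermutationReasoning
      r : ℕ
      r = fromValley x xs
    ... | no x≮p rewrite fromValley-up (≮⇒≥ x≮p) xs = begin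
      suc (suc (fromValley x xs)) ∷ map (fromValley p) (map (x ∷_) (inserts M xs))
        ≡⟨ cong (_ ∷_) (trans (map-∷ x (fromValley-up (≮⇒≥ x≮p)) (inserts M xs))
                               (map-∘ (inserts M xs))) ⟩
      map suc (suc (fromValley x xs) ∷ map (fromPeak x) (inserts M xs))
        ↭⟨ ↭.map⁺ suc (fromPeak-inserts x xs x<M xs<M u) ⟩
      map suc (profile (suc s) s (length xs ∸ s))
        ≡⟨ map-suc-profile (suc s) s (length xs ∸ s) ⟩
      profile (suc s) (suc s) (length xs ∸ s) ∎
      where
      open PermutationReasoning
      s = fromPeak x xs

    fromPeak-inserts : ∀ {M} p w → p < M → All (_< M) w → Unique (p ∷ w) →
      suc (fromValley p w) ∷ map (fromPeak p) (inserts M w) ↭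
        profile (suc (fromPeak p w)) (fromPeak p w) (length w ∸ fromPeak p w)
    fromPeak-inserts {M} p [] p<M _ _ rewrite fromPeak-up p<M [] = ↭-swap 1 0 ↭-refl
    fromPeak-inserts {M} p (x ∷ xs) p<M (x<M ∷ xs<M) ((p≢x ∷ _) ∷ u)
      rewrite fromPeak-up p<M (x ∷ xs) | fromPeak-down (<⇒≤ x<M) xs
      with p <? x
    ... | yes p<x rewrite fromPeak-up p<x xs | fromValley-up (<⇒≤ p<x) xs = begin
      suc (suc s) ∷ suc (fromValley x xs) ∷ map (fromPeak p) (map (x ∷_) (inserts M xs))
        ≡⟨ cong (λ vs → suc (suc s) ∷ suc (fromValley x xs) ∷ vs)
                (map-∷ x (fromPeak-up p<x) (inserts M xs)) ⟩
      suc (suc s) ∷ suc (fromValley x xs) ∷ map (fromPeak x) (inserts M xs)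
        ↭⟨ ↭-prep _ (fromPeak-inserts x xs x<M xs<M u) ⟩
      suc (suc s) ∷ profile (suc s) s (length xs ∸ s)
        ↭⟨ ∷-profile (suc s) s (length xs ∸ s) ⟩
      profile (suc s) s (suc (length xs ∸ s))
        ≡⟨ cong (profile (suc s) s) (sym (+-∸-assoc 1 (fromPeak≤length x xs))) ⟩
      profile (suc s) s (suc (length xs) ∸ s) ∎
      where
      open PermutationReasoning
      s = fromPeak x xs
    ... | no p≮x
      rewrite fromPeak-down (≮⇒≥ p≮x) xs | fromValley-down (≤∧≢⇒< (≮⇒≥ p≮x) (p≢x ∘ sym)) xs
      = begin
      suc r ∷ suc r ∷ map (fromPeak p) (map (x ∷_) (inserts M xs))
        ≡⟨ cong (λ vs → suc r ∷ suc r ∷ vs)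
                (trans (map-∷ x (fromPeak-down (≮⇒≥ p≮x)) (inserts M xs)) (map-∘ (inserts M xs))) ⟩
      suc r ∷ suc r ∷ map suc (map (fromValley x) (inserts M xs))
        ↭⟨ ↭-prep _ (↭-prep _ (↭.map⁺ suc (fromValley-inserts x xs x<M xs<M u))) ⟩
      suc r ∷ suc r ∷ map suc (profile r r (length xs ∸ r))
        ≡⟨ cong (λ vs → suc r ∷ suc r ∷ vs) (map-suc-profile r r (length xs ∸ r)) ⟩
      profile (suc (suc r)) (suc r) (length xs ∸ r) ∎
      where
      open PermutationReasoning
      r : ℕ
      r = fromValley x xs

module Counting where

  open import Data.Bool using (Bool; true; false; if_then_else_)
  open import Data.Nat
  open import Data.Nat.Properties
  open import Algebra.Properties.CommutativeSemigroup +-commutativeSemigroup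
    using () renaming (interchange to +-interchange)
  open import Data.List using (List; []; _∷_; _++_; map; length; replicate; concatMap; filterᵇ)
  open import Data.Nat.ListAction using (sum)
  open import Data.List.Properties using (filter-++; length-++)
  open import Relation.Nullary.Decidable using (T?)
  open import Data.List.Relation.Unary.All using (All; []; _∷_)
  open import Data.List.Relation.Binary.Permutation.Propositional using (_↭_)
  import Data.List.Relation.Binary.Permutation.Propositional.Properties as ↭
  open import Function using (_∘_)
  open import Relation.Binary.PropositionalEquality

  count-∷ : ∀ {A : Set} (p : A → Bool) x xs →
            count p (x ∷ xs) ≡ (if p x then suc (count p xs) else count p xs)
  count-∷ p x xs with p x
  ... | true  = refl
  ... | false = refl

  count-↭ : ∀ {A : Set} (p : A → Bool) {xs ys} → xs ↭ ys → count p xs ≡ count p ys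
  count-↭ p xs↭ys = ↭.↭-length (↭.filter-↭ (T? ∘ p) xs↭ys)

  count-++ : ∀ {A : Set} (p : A → Bool) xs ys → count p (xs ++ ys) ≡ count p xs + count p ys
  count-++ p xs ys = trans (cong length (filter-++ (T? ∘ p) xs ys)) (length-++ (filterᵇ p xs))

  count-concatMap : ∀ {A B : Set} (p : B → Bool) (f : A → List B) xs →
                    count p (concatMap f xs) ≡ sum (map (count p ∘ f) xs)
  count-concatMap p f []       = refl
  count-concatMap p f (x ∷ xs) =
    trans (count-++ p (f x) (concatMap f xs)) (cong (count p (f x) +_) (count-concatMap p f xs))

  count-map : ∀ {A B : Set} (p : B → Bool) (f : A → B) xs → count p (map f xs) ≡ count (p ∘ f) xs
  count-map p f []       = refl
  count-map p f (x ∷ xs) rewrite count-∷ p (f x) (map f xs) | count-∷ (p ∘ f) x xs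
    with p (f x)
  ... | true  = cong suc (count-map p f xs)
  ... | false = count-map p f xs

  count-cong : ∀ {A : Set} {p q : A → Bool} {xs} → All (λ x → p x ≡ q x) xs → count p xs ≡ count q xs
  count-cong []                          = refl
  count-cong {p = p} {q} {x ∷ xs} (px≡qx ∷ rest)
    rewrite count-∷ p x xs | count-∷ q x xs | px≡qx | count-cong rest = refl

  count-replicate : ∀ (p : ℕ → Bool) m x → count p (replicate m x) ≡ (if p x then m else 0)
  count-replicate p zero    x with p x
  ... | true  = refl
  ... | false = refl
  count-replicate p (suc m) x rewrite count-∷ p x (replicate m x) | count-replicate p m x
    with p x
  ... | true  = refl
  ... | false = refl

  if-suc : ∀ b n → (if b then suc n else n) ≡ (if b then 1 else 0) + n
  if-suc true  n = refl
  if-suc false n = refl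

  sum-map-+ : ∀ {A : Set} (f g : A → ℕ) xs →
              sum (map (λ x → f x + g x) xs) ≡ sum (map f xs) + sum (map g xs)
  sum-map-+ f g []       = refl
  sum-map-+ f g (x ∷ xs) rewrite sum-map-+ f g xs =
    +-interchange (f x) (g x) (sum (map f xs)) (sum (map g xs))

  sum-if-≡ᵇ : ∀ {A : Set} (f : A → ℕ) (g : ℕ → ℕ) k xs →
    sum (map (λ x → if f x ≡ᵇ k then g (f x) else 0) xs) ≡ g k * count (λ x → f x ≡ᵇ k) xs
  sum-if-≡ᵇ f g k [] = sym (*-zeroʳ (g k))
  sum-if-≡ᵇ f g k (x ∷ xs) rewrite count-∷ (λ x → f x ≡ᵇ k) x xs
    with f x ≡ᵇ k | ≡ᵇ⇒≡ (f x) k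
  ... | true  | fx≡k = trans (cong₂ _+_ (cong g (fx≡k _)) (sum-if-≡ᵇ f g k xs)) (sym (*-suc (g k) _))
  ... | false | _    = sum-if-≡ᵇ f g k xs

  sum-map-0 : ∀ {A : Set} (xs : List A) → sum (map (λ _ → 0) xs) ≡ 0
  sum-map-0 []       = refl
  sum-map-0 (_ ∷ xs) = sum-map-0 xs

module Recurrence where

  open AlternatingRuns
  open Permutations
  open Insertion
  open Counting
  open import Data.Bool using (if_then_else_; T)
  open import Data.Nat
  open import Data.Nat.Properties
  open import Data.List using (List; _∷_; map; length; replicate; concatMap)
  open import Data.Nat.ListAction using (sum)
  open import Data.List.Properties using (map-cong; map-cong-local; filter-none)
  open import Data.List.Membership.Propositional using (_∈_)
  open import Relation.Nullary.Decidable using (T?)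
  open import Data.List.Relation.Unary.Unique.Propositional using (Unique)
  open import Data.List.Relation.Unary.All as All using (All; []; _∷_)
  open import Function using (_∘_)
  open import Data.Product using (_,_)
  open import Relation.Binary.PropositionalEquality
  open import Relation.Nullary using (¬_)

  count-profile : ∀ c r j k → count (_≡ᵇ k) (profile c r j) ≡
    (if r ≡ᵇ k then c else 0) + ((if suc r ≡ᵇ k then 1 else 0) + (if suc (suc r) ≡ᵇ k then j else 0))
  count-profile c r j k = begin
    count (_≡ᵇ k) (profile c r j)
      ≡⟨ count-++ (_≡ᵇ k) (replicate c r) _ ⟩
    count (_≡ᵇ k) (replicate c r) + count (_≡ᵇ k) (suc r ∷ replicate j (suc (suc r)))
      ≡⟨ cong₂ _+_ (count-replicate (_≡ᵇ k) c r) (count-∷ (_≡ᵇ k) (suc r) _) ⟩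
    (if r ≡ᵇ k then c else 0) + (if suc r ≡ᵇ k then suc tail else tail)
      ≡⟨ cong (_ +_) (trans (if-suc (suc r ≡ᵇ k) tail)
                            (cong (_ +_) (count-replicate (_≡ᵇ k) j (suc (suc r))))) ⟩
    (if r ≡ᵇ k then c else 0) + ((if suc r ≡ᵇ k then 1 else 0) + (if suc (suc r) ≡ᵇ k then j else 0)) ∎
    where
    open ≡-Reasoning
    tail : ℕ
    tail = count (_≡ᵇ k) (replicate j (suc (suc r)))

  a-suc : ∀ n k → a k (suc n) ≡
    sum (map (λ w → count (_≡ᵇ k) (profile (as w) (as w) (n ∸ as w))) (perms n))
  a-suc n k = begin
    count (λ v → as v ≡ᵇ k) (perms (suc n))
      ≡⟨ count-↭ _ (perms-suc↭ n) ⟩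
    count (λ v → as v ≡ᵇ k) (concatMap (inserts (suc n)) (perms n))
      ≡⟨ count-concatMap _ (inserts (suc n)) (perms n) ⟩
    sum (map (λ w → count (λ v → as v ≡ᵇ k) (inserts (suc n) w)) (perms n))
      ≡⟨ cong sum (map-cong-local (All.tabulate (insertions ∘ ∈-perms⁻ n))) ⟩
    sum (map (λ w → count (_≡ᵇ k) (profile (as w) (as w) (n ∸ as w))) (perms n)) ∎
    where
    open ≡-Reasoning
    insertions : ∀ {w} → IsPerm n w →
      count (λ v → as v ≡ᵇ k) (inserts (suc n) w) ≡ count (_≡ᵇ k) (profile (as w) (as w) (n ∸ as w))
    insertions {w} pw@(len , inRange , u) = begin
      count (λ v → as v ≡ᵇ k) (inserts (suc n) w)
        ≡⟨ count-cong (All.tabulate λ v∈ →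
             cong (_≡ᵇ k) (as≡fromValley0 _ (IsPerm⇒Unique-0∷ (IsPerm-insert pw v∈)))) ⟩
      count (λ v → fromValley 0 v ≡ᵇ k) (inserts (suc n) w)
        ≡⟨ count-map (_≡ᵇ k) (fromValley 0) (inserts (suc n) w) ⟨
      count (_≡ᵇ k) (map (fromValley 0) (inserts (suc n) w))
        ≡⟨ count-↭ (_≡ᵇ k) (fromValley-inserts 0 w z<s
             (All.map (λ (_ , x≤n) → s≤s x≤n) inRange) (IsPerm⇒Unique-0∷ pw)) ⟩
      count (_≡ᵇ k) (profile r r (length w ∸ r))
        ≡⟨ cong (λ r → count (_≡ᵇ k) (profile r r (length w ∸ r))) (sym as≡r) ⟩
      count (_≡ᵇ k) (profile (as w) (as w) (length w ∸ as w))
        ≡⟨ cong (λ m → count (_≡ᵇ k) (profile (as w) (as w) (m ∸ as w))) len ⟩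
      count (_≡ᵇ k) (profile (as w) (as w) (n ∸ as w)) ∎
      where
      r : ℕ
      r = fromValley 0 w
      as≡r : as w ≡ r
      as≡r = as≡fromValley0 w (IsPerm⇒Unique-0∷ pw)

  a-suc-split : ∀ n k → a k (suc n) ≡
    sum (map (λ w → if as w ≡ᵇ k then as w else 0) (perms n)) +
    (sum (map (λ w → if suc (as w) ≡ᵇ k then 1 else 0) (perms n)) +
     sum (map (λ w → if suc (suc (as w)) ≡ᵇ k then n ∸ as w else 0) (perms n)))
  a-suc-split n k = begin
    a k (suc n)
      ≡⟨ a-suc n k ⟩
    sum (map (λ w → count (_≡ᵇ k) (profile (as w) (as w) (n ∸ as w))) (perms n))
      ≡⟨ cong sum (map-cong (λ w → count-profile (as w) (as w) (n ∸ as w) k) (perms n)) ⟩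
    sum (map (λ w → B₀ w + (B₁ w + B₂ w)) (perms n))
      ≡⟨ sum-map-+ B₀ _ (perms n) ⟩
    sum (map B₀ (perms n)) + sum (map (λ w → B₁ w + B₂ w) (perms n))
      ≡⟨ cong (sum (map B₀ (perms n)) +_) (sum-map-+ B₁ B₂ (perms n)) ⟩
    sum (map B₀ (perms n)) + (sum (map B₁ (perms n)) + sum (map B₂ (perms n))) ∎
    where
    open ≡-Reasoning
    B₀ B₁ B₂ : List ℕ → ℕ
    B₀ w = if as w ≡ᵇ k then as w else 0
    B₁ w = if suc (as w) ≡ᵇ k then 1 else 0
    B₂ w = if suc (suc (as w)) ≡ᵇ k then n ∸ as w else 0

  a-suc-zero : ∀ n → a 0 (suc n) ≡ 0
  a-suc-zero n rewrite a-suc-split n 0 | sum-if-≡ᵇ as (λ r → r) 0 (perms n) | sum-map-0 (perms n) = refl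

  a-suc-one : ∀ n → a 1 (suc n) ≡ a 1 n + a 0 n
  a-suc-one n rewrite a-suc-split n 1 | sum-if-≡ᵇ as (λ r → r) 1 (perms n)
    | sum-if-≡ᵇ as (λ _ → 1) 0 (perms n) | sum-map-0 (perms n) =
    cong₂ _+_ (*-identityˡ (a 1 n)) (trans (+-identityʳ _) (*-identityˡ (a 0 n)))

  a-suc-suc-suc : ∀ n k → a (suc (suc k)) (suc n) ≡
    suc (suc k) * a (suc (suc k)) n + (a (suc k) n + (n ∸ k) * a k n)
  a-suc-suc-suc n k rewrite a-suc-split n (suc (suc k)) | sum-if-≡ᵇ as (λ r → r) (suc (suc k)) (perms n)
    | sum-if-≡ᵇ as (λ _ → 1) (suc k) (perms n) | sum-if-≡ᵇ as (n ∸_) k (perms n) =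
    cong (λ m → suc (suc k) * a (suc (suc k)) n + (m + (n ∸ k) * a k n)) (*-identityˡ (a (suc k) n))

  a-above : ∀ n k → n < k → a k n ≡ 0
  a-above n k n<k = cong length (filter-none (T? ∘ (λ w → as w ≡ᵇ k)) (All.tabulate as≢k))
    where
    as≢k : ∀ {w} → w ∈ perms n → ¬ T (as w ≡ᵇ k)
    as≢k {w} w∈ t with ∈-perms⁻ n w∈
    ... | pw@(len , _ , _) = <⇒≢ (≤-<-trans as≤n n<k) (≡ᵇ⇒≡ (as w) k t)
      where
      as≤n : as w ≤ n
      as≤n = begin
        as w            ≡⟨ as≡fromValley0 w (IsPerm⇒Unique-0∷ pw) ⟩
        fromValley 0 w  ≤⟨ fromValley≤length 0 w ⟩
        length w        ≡⟨ len ⟩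
        n               ∎
        where open ≤-Reasoning

  tangent≡a : ∀ m → tangent m ≡ a (suc (2 * m)) (suc (2 * m))
  tangent≡a m = count-cong (All.tabulate (alternating⇔as≡N ∘ ∈-perms⁻ N))
    where
    N = suc (2 * m)
    alternating⇔as≡N : ∀ {w} → IsPerm N w → altDown w ≡ (as w ≡ᵇ N)
    alternating⇔as≡N {w} pw@(len , _ , _) = begin
      altDown w                          ≡⟨ altUp-0∷≡altDown (Unique-0∷⇒positive u0) ⟨
      altUp (0 ∷ w)                      ≡⟨ fromValley≡ᵇlength 0 w u0 ⟨
      (fromValley 0 w ≡ᵇ length w)       ≡⟨ cong₂ _≡ᵇ_ (sym (as≡fromValley0 w u0)) len ⟩
      (as w ≡ᵇ N)                        ∎
      where
      open ≡-Reasoning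
      u0 : Unique (0 ∷ w)
      u0 = IsPerm⇒Unique-0∷ pw
      altUp-0∷≡altDown : ∀ {s} → All (0 <_) s → altUp (0 ∷ s) ≡ altDown s
      altUp-0∷≡altDown []          = refl
      altUp-0∷≡altDown (0<y ∷ _) rewrite <ᵇ-true 0<y = refl

module Polynomials where

  open import Algebra.Bundles using (CommutativeRing; CommutativeSemigroup)
  open import Data.Nat as ℕ using (ℕ; zero; suc)
  import Data.Nat.Properties as ℕₚ
  open import Data.Integer using (ℤ; +_; -_; _+_; _*_; _^_)
  open import Data.Integer.Properties
  open import Algebra.Properties.CommutativeSemigroup +-commutativeSemigroup
    using () renaming (interchange to +-interchange)
  open import Algebra.Properties.CommutativeSemigroup *-commutativeSemigroup
    using () renaming (x∙yz≈y∙xz to *-exchange)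
  open import Data.List using ([]; _∷_; map; upTo; applyUpTo)
  open import Data.Bool using (true; if_then_else_)
  open import Data.Maybe using (Maybe; just; nothing)
  open import Data.Product using (_×_; _,_)
  open import Relation.Binary.Bundles using (Setoid)
  open import Relation.Binary.PropositionalEquality
  open import Relation.Nullary using (yes; no)
  open import Relation.Nullary.Reflects using (ofⁿ)
  open import Function using (_∘_)
  import Relation.Binary.Reasoning.Setoid as SetoidReasoning

  infixl 6 _+P_
  infixl 7 _*P_ _·_
  infix  4 _≈_

  -- Synonyms of _+ₚ_ and _*ₚ_, which are declared without fixity.
  _+P_ _*P_ : Poly → Poly → Poly
  _+P_ = _+ₚ_
  _*P_ = _*ₚ_

  _·_ : ℤ → Poly → Poly
  c · p = map (c *_) p

  -ₚ_ : Poly → Poly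
  -ₚ_ = map -_

  shift : Poly → Poly
  shift p = + 0 ∷ p

  0ₚ 1ₚ tₚ : Poly
  0ₚ = []
  1ₚ = + 1 ∷ []
  tₚ = shift 1ₚ

  const : ℤ → Poly
  const c = c ∷ []

  -- The relation _≈ₚ_ of Defs, wrapped in a record so that p and q can be inferred from a proof.
  record _≈_ (p q : Poly) : Set where
    constructor coeffwise
    field coeff≡ : ∀ k → coeff p k ≡ coeff q k
  open _≈_ public

  ≈-setoid : Setoid _ _
  ≈-setoid = record
    { Carrier       = Poly
    ; _≈_           = _≈_
    ; isEquivalence = record
      { refl  = coeffwise λ _ → refl
      ; sym   = λ p≈q → coeffwise λ k → sym (coeff≡ p≈q k)
      ; trans = λ p≈q q≈r → coeffwise λ k → trans (coeff≡ p≈q k) (coeff≡ q≈r k)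
      }
    }

  open Setoid ≈-setoid public using () renaming (refl to ≈-refl; sym to ≈-sym; trans to ≈-trans)
  module ≈-Reasoning = SetoidReasoning ≈-setoid

  coeff-+P : ∀ p q k → coeff (p +P q) k ≡ coeff p k + coeff q k
  coeff-+P []      q       k       = sym (+-identityˡ _)
  coeff-+P (c ∷ p) []      k       = sym (+-identityʳ _)
  coeff-+P (c ∷ p) (d ∷ q) zero    = refl
  coeff-+P (c ∷ p) (d ∷ q) (suc k) = coeff-+P p q k

  coeff-· : ∀ c p k → coeff (c · p) k ≡ c * coeff p k
  coeff-· c []      k       = sym (*-zeroʳ c)
  coeff-· c (d ∷ p) zero    = refl
  coeff-· c (d ∷ p) (suc k) = coeff-· c p k

  coeff--ₚ : ∀ p k → coeff (-ₚ p) k ≡ - coeff p k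
  coeff--ₚ []      k       = refl
  coeff--ₚ (d ∷ p) zero    = refl
  coeff--ₚ (d ∷ p) (suc k) = coeff--ₚ p k

  coeff-+P₃ : ∀ p q r k → coeff (p +P q +P r) k ≡ coeff p k + coeff q k + coeff r k
  coeff-+P₃ p q r k = trans (coeff-+P (p +P q) r k) (cong (_+ coeff r k) (coeff-+P p q k))

  +P-cong : ∀ {p p′ q q′} → p ≈ p′ → q ≈ q′ → p +P q ≈ p′ +P q′
  +P-cong {p} {p′} {q} {q′} p≈p′ q≈q′ = coeffwise λ k →
    trans (coeff-+P p q k)
          (trans (cong₂ _+_ (coeff≡ p≈p′ k) (coeff≡ q≈q′ k)) (sym (coeff-+P p′ q′ k)))

  +P-assoc : ∀ p q r → p +P q +P r ≈ p +P (q +P r)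
  +P-assoc p q r = coeffwise λ k →
    trans (coeff-+P₃ p q r k)
          (trans (+-assoc (coeff p k) (coeff q k) (coeff r k))
                 (sym (trans (coeff-+P p (q +P r) k) (cong (_+_ (coeff p k)) (coeff-+P q r k)))))

  +P-comm : ∀ p q → p +P q ≈ q +P p
  +P-comm p q = coeffwise λ k →
    trans (coeff-+P p q k) (trans (+-comm (coeff p k) (coeff q k)) (sym (coeff-+P q p k)))

  +P-identityˡ : ∀ p → 0ₚ +P p ≈ p
  +P-identityˡ p = ≈-refl

  +P-identityʳ : ∀ p → p +P 0ₚ ≈ p
  +P-identityʳ p = coeffwise λ k → trans (coeff-+P p 0ₚ k) (+-identityʳ _)

  -ₚ-cong : ∀ {p q} → p ≈ q → -ₚ p ≈ -ₚ q
  -ₚ-cong {p} {q} p≈q = coeffwise λ k →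
    trans (coeff--ₚ p k) (trans (cong -_ (coeff≡ p≈q k)) (sym (coeff--ₚ q k)))

  +P-inverseˡ : ∀ p → -ₚ p +P p ≈ 0ₚ
  +P-inverseˡ p = coeffwise λ k →
    trans (coeff-+P (-ₚ p) p k) (trans (cong (_+ coeff p k) (coeff--ₚ p k)) (+-inverseˡ (coeff p k)))

  +P-inverseʳ : ∀ p → p +P -ₚ p ≈ 0ₚ
  +P-inverseʳ p = ≈-trans (+P-comm p (-ₚ p)) (+P-inverseˡ p)

  +P-commutativeSemigroup : CommutativeSemigroup _ _
  +P-commutativeSemigroup = record
    { isCommutativeSemigroup = record
      { isSemigroup = record
        { isMagma = record { isEquivalence = Setoid.isEquivalence ≈-setoid ; ∙-cong = +P-cong }
        ; assoc   = +P-assoc }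
      ; comm = +P-comm } }

  open import Algebra.Properties.CommutativeSemigroup +P-commutativeSemigroup
    public using () renaming (interchange to +P-interchange; x∙yz≈y∙xz to +P-exchange)

  ·-cong : ∀ c {p q} → p ≈ q → c · p ≈ c · q
  ·-cong c {p} {q} p≈q = coeffwise λ k →
    trans (coeff-· c p k) (trans (cong (c *_) (coeff≡ p≈q k)) (sym (coeff-· c q k)))

  ·-congˡ : ∀ {c d} p → c ≡ d → c · p ≈ d · p
  ·-congˡ p refl = ≈-refl

  ·-distribˡ-+P : ∀ c p q → c · (p +P q) ≈ c · p +P c · q
  ·-distribˡ-+P c p q = coeffwise λ k → begin
    coeff (c · (p +P q)) k             ≡⟨ coeff-· c (p +P q) k ⟩
    c * coeff (p +P q) k               ≡⟨ cong (c *_) (coeff-+P p q k) ⟩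
    c * (coeff p k + coeff q k)        ≡⟨ *-distribˡ-+ c _ _ ⟩
    c * coeff p k + c * coeff q k      ≡⟨ cong₂ _+_ (coeff-· c p k) (coeff-· c q k) ⟨
    coeff (c · p) k + coeff (c · q) k  ≡⟨ coeff-+P (c · p) (c · q) k ⟨
    coeff (c · p +P c · q) k           ∎
    where open ≡-Reasoning

  ·-distribʳ-+ : ∀ c d p → (c + d) · p ≈ c · p +P d · p
  ·-distribʳ-+ c d p = coeffwise λ k →
    trans (coeff-· (c + d) p k)
          (trans (*-distribʳ-+ (coeff p k) c d)
                 (sym (trans (coeff-+P (c · p) (d · p) k) (cong₂ _+_ (coeff-· c p k) (coeff-· d p k)))))

  ·-assoc : ∀ c d p → c · (d · p) ≈ (c * d) · p
  ·-assoc c d p = coeffwise λ k →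
    trans (coeff-· c (d · p) k)
          (trans (cong (c *_) (coeff-· d p k)) (trans (sym (*-assoc c d _)) (sym (coeff-· (c * d) p k))))

  ·-commute : ∀ c d p → c · (d · p) ≈ d · (c · p)
  ·-commute c d p = ≈-trans (·-assoc c d p) (≈-trans (·-congˡ p (*-comm c d)) (≈-sym (·-assoc d c p)))

  ·-identity : ∀ p → + 1 · p ≈ p
  ·-identity p = coeffwise λ k → trans (coeff-· (+ 1) p k) (*-identityˡ _)

  ·-zero : ∀ p → + 0 · p ≈ 0ₚ
  ·-zero p = coeffwise (coeff-· (+ 0) p)

  ∷-cong : ∀ {c d p q} → c ≡ d → p ≈ q → c ∷ p ≈ d ∷ q
  ∷-cong c≡d p≈q = coeffwise λ { zero → c≡d ; (suc k) → coeff≡ p≈q k }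

  shift-cong : ∀ {p q} → p ≈ q → shift p ≈ shift q
  shift-cong = ∷-cong refl

  shift-+P : ∀ p q → shift (p +P q) ≈ shift p +P shift q
  shift-+P p q = ≈-refl

  ·-shift : ∀ c p → c · shift p ≈ shift (c · p)
  ·-shift c p = coeffwise λ { zero → *-zeroʳ c ; (suc k) → refl }

  shift-0ₚ : shift 0ₚ ≈ 0ₚ
  shift-0ₚ = coeffwise λ { zero → refl ; (suc k) → refl }

  *P-cons : ∀ c p q → (c ∷ p) *P q ≈ c · q +P shift (p *P q)
  *P-cons c p q = ≈-refl

  *P-zeroʳ : ∀ p → p *P 0ₚ ≈ 0ₚ
  *P-zeroʳ []      = ≈-refl
  *P-zeroʳ (c ∷ p) = ≈-trans (shift-cong (*P-zeroʳ p)) shift-0ₚ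

  *P-≈0 : ∀ {p} q → p ≈ 0ₚ → p *P q ≈ 0ₚ
  *P-≈0 {[]}    q _   = ≈-refl
  *P-≈0 {c ∷ p} q p≈0 = begin
    c · q +P shift (p *P q)    ≈⟨ +P-cong (·-congˡ q (coeff≡ p≈0 0)) (shift-cong (*P-≈0 {p} q tail≈0)) ⟩
    + 0 · q +P shift 0ₚ        ≈⟨ +P-cong (·-zero q) shift-0ₚ ⟩
    0ₚ                         ∎
    where
    open ≈-Reasoning
    tail≈0 : p ≈ 0ₚ
    tail≈0 = coeffwise λ k → coeff≡ p≈0 (suc k)

  *P-congʳ : ∀ p {q q′} → q ≈ q′ → p *P q ≈ p *P q′
  *P-congʳ []      q≈q′ = ≈-refl
  *P-congʳ (c ∷ p) q≈q′ = +P-cong (·-cong c q≈q′) (shift-cong (*P-congʳ p q≈q′))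

  *P-congˡ : ∀ {p p′} q → p ≈ p′ → p *P q ≈ p′ *P q
  *P-congˡ {[]}    {p′}     q p≈p′ = ≈-sym (*P-≈0 q (≈-sym p≈p′))
  *P-congˡ {c ∷ p} {[]}     q p≈p′ = *P-≈0 q p≈p′
  *P-congˡ {c ∷ p} {c′ ∷ p′} q p≈p′ =
    +P-cong (·-congˡ q (coeff≡ p≈p′ 0))
            (shift-cong (*P-congˡ {p} {p′} q (coeffwise λ k → coeff≡ p≈p′ (suc k))))

  *P-cong : ∀ {p p′ q q′} → p ≈ p′ → q ≈ q′ → p *P q ≈ p′ *P q′
  *P-cong {p′ = p′} {q = q} p≈p′ q≈q′ = ≈-trans (*P-congˡ q p≈p′) (*P-congʳ p′ q≈q′)

  *P-distribʳ : ∀ q p p′ → (p +P p′) *P q ≈ p *P q +P p′ *P q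
  *P-distribʳ q []      p′        = ≈-refl
  *P-distribʳ q (c ∷ p) []        = ≈-sym (+P-identityʳ _)
  *P-distribʳ q (c ∷ p) (c′ ∷ p′) = begin
    (c + c′) · q +P shift ((p +P p′) *P q)
      ≈⟨ +P-cong (·-distribʳ-+ c c′ q) (shift-cong (*P-distribʳ q p p′)) ⟩
    (c · q +P c′ · q) +P (shift (p *P q) +P shift (p′ *P q))
      ≈⟨ +P-interchange (c · q) (c′ · q) (shift (p *P q)) (shift (p′ *P q)) ⟩
    (c · q +P shift (p *P q)) +P (c′ · q +P shift (p′ *P q)) ∎
    where open ≈-Reasoning

  *P-distribˡ : ∀ p q q′ → p *P (q +P q′) ≈ p *P q +P p *P q′
  *P-distribˡ []      q q′ = ≈-refl
  *P-distribˡ (c ∷ p) q q′ = begin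
    c · (q +P q′) +P shift (p *P (q +P q′))
      ≈⟨ +P-cong (·-distribˡ-+P c q q′) (shift-cong (*P-distribˡ p q q′)) ⟩
    (c · q +P c · q′) +P (shift (p *P q) +P shift (p *P q′))
      ≈⟨ +P-interchange (c · q) (c · q′) (shift (p *P q)) (shift (p *P q′)) ⟩
    (c · q +P shift (p *P q)) +P (c · q′ +P shift (p *P q′)) ∎
    where open ≈-Reasoning

  *P-·ˡ : ∀ c p q → (c · p) *P q ≈ c · (p *P q)
  *P-·ˡ c []      q = ≈-refl
  *P-·ˡ c (d ∷ p) q = begin
    (c * d) · q +P shift ((c · p) *P q)  ≈⟨ +P-cong (≈-sym (·-assoc c d q)) (shift-cong (*P-·ˡ c p q)) ⟩
    c · (d · q) +P shift (c · (p *P q))  ≈⟨ +P-cong (≈-refl {c · (d · q)}) (·-shift c (p *P q)) ⟨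
    c · (d · q) +P c · shift (p *P q)    ≈⟨ ·-distribˡ-+P c (d · q) (shift (p *P q)) ⟨
    c · (d · q +P shift (p *P q))        ∎
    where open ≈-Reasoning

  *P-·ʳ : ∀ c p q → p *P (c · q) ≈ c · (p *P q)
  *P-·ʳ c []      q = ≈-refl
  *P-·ʳ c (d ∷ p) q = begin
    d · (c · q) +P shift (p *P (c · q))  ≈⟨ +P-cong (·-assoc d c q) (shift-cong (*P-·ʳ c p q)) ⟩
    (d * c) · q +P shift (c · (p *P q))  ≈⟨ +P-cong (·-congˡ q (*-comm c d)) (·-shift c (p *P q)) ⟨
    (c * d) · q +P c · shift (p *P q)    ≈⟨ +P-cong (·-assoc c d q) (≈-refl {c · shift (p *P q)}) ⟨
    c · (d · q) +P c · shift (p *P q)    ≈⟨ ·-distribˡ-+P c (d · q) (shift (p *P q)) ⟨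
    c · (d · q +P shift (p *P q))        ∎
    where open ≈-Reasoning

  shift-*Pˡ : ∀ p q → shift p *P q ≈ shift (p *P q)
  shift-*Pˡ p q = coeffwise λ k →
    trans (coeff-+P (+ 0 · q) (shift (p *P q)) k)
          (trans (cong (_+ coeff (shift (p *P q)) k) (trans (coeff-· (+ 0) q k) (*-zeroˡ (coeff q k))))
                 (+-identityˡ _))

  shift-*Pʳ : ∀ p q → p *P shift q ≈ shift (p *P q)
  shift-*Pʳ []      q = ≈-sym shift-0ₚ
  shift-*Pʳ (c ∷ p) q = ≈-trans (+P-cong (·-shift c q) (shift-cong (shift-*Pʳ p q))) (≈-sym (shift-+P (c · q) _))

  *P-identityˡ : ∀ p → 1ₚ *P p ≈ p
  *P-identityˡ p = ≈-trans (+P-cong (·-identity p) shift-0ₚ) (+P-identityʳ p)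

  *P-comm : ∀ p q → p *P q ≈ q *P p
  *P-comm []      q = ≈-sym (*P-zeroʳ q)
  *P-comm (c ∷ p) q = begin
    c · q +P shift (p *P q)  ≈⟨ +P-cong (≈-refl {c · q}) (shift-cong (*P-comm p q)) ⟩
    c · q +P shift (q *P p)  ≈⟨ *P-consʳ q ⟨
    q *P (c ∷ p)             ∎
    where
    open ≈-Reasoning
    *P-consʳ : ∀ q → q *P (c ∷ p) ≈ c · q +P shift (q *P p)
    *P-consʳ []      = coeffwise λ { zero → refl ; (suc k) → refl }
    *P-consʳ (d ∷ q) = ≈-trans (+P-cong (≈-refl {d · (c ∷ p)}) (shift-cong (*P-consʳ q)))
      (∷-cong (cong (_+ + 0) (*-comm d c)) (+P-exchange (d · p) (c · q) (shift (q *P p))))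

  *P-assoc : ∀ p q r → p *P q *P r ≈ p *P (q *P r)
  *P-assoc []      q r = ≈-refl
  *P-assoc (c ∷ p) q r = begin
    (c · q +P shift (p *P q)) *P r           ≈⟨ *P-distribʳ r (c · q) (shift (p *P q)) ⟩
    (c · q) *P r +P shift (p *P q) *P r      ≈⟨ +P-cong (*P-·ˡ c q r) (shift-*Pˡ (p *P q) r) ⟩
    c · (q *P r) +P shift (p *P q *P r)      ≈⟨ +P-cong (≈-refl {c · (q *P r)}) (shift-cong (*P-assoc p q r)) ⟩
    c · (q *P r) +P shift (p *P (q *P r))    ∎
    where open ≈-Reasoning

  *P-identityʳ : ∀ p → p *P 1ₚ ≈ p
  *P-identityʳ p = ≈-trans (*P-comm p 1ₚ) (*P-identityˡ p)

  polyRing : CommutativeRing _ _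
  polyRing = record
    { Carrier = Poly ; _≈_ = _≈_ ; _+_ = _+P_ ; _*_ = _*P_ ; -_ = -ₚ_ ; 0# = 0ₚ ; 1# = 1ₚ
    ; isCommutativeRing = record
      { isRing = record
        { +-isAbelianGroup = record
          { isGroup = record
            { isMonoid = record
              { isSemigroup = CommutativeSemigroup.isSemigroup +P-commutativeSemigroup
              ; identity    = +P-identityˡ , +P-identityʳ }
            ; inverse = +P-inverseˡ , +P-inverseʳ
            ; ⁻¹-cong = -ₚ-cong }
          ; comm = +P-comm }
        ; *-cong     = *P-cong
        ; *-assoc    = *P-assoc
        ; *-identity = *P-identityˡ , *P-identityʳ
        ; distrib    = *P-distribˡ , *P-distribʳ }
      ; *-comm = *P-comm } }

  const-* : ∀ c d → const (c * d) ≈ const c *P const d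
  const-* c d = coeffwise λ { zero → sym (+-identityʳ _) ; (suc k) → refl }

  const-≟ : ∀ c d → Maybe (const c ≈ const d)
  const-≟ c d with c ≟ d
  ... | yes refl = just ≈-refl
  ... | no _     = nothing

  module PolySolver where
    import Algebra.Solver.Ring.AlmostCommutativeRing as ACR
    open import Data.Integer.Properties using (+-*-commutativeRing)

    const-homomorphism : CommutativeRing.rawRing +-*-commutativeRing
                           ACR.-Raw-AlmostCommutative⟶ ACR.fromCommutativeRing polyRing
    const-homomorphism = record
      { ⟦_⟧    = const
      ; +-homo = λ _ _ → ≈-refl
      ; *-homo = const-*
      ; -‿homo = λ _ → ≈-refl
      ; 0-homo = coeffwise λ { zero → refl ; (suc k) → refl }
      ; 1-homo = ≈-refl }

    open import Algebra.Solver.Ring _ (ACR.fromCommutativeRing polyRing) const-homomorphism const-≟ public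
      using (solve; _:=_; _:+_; _:*_; con)

  shift≈tₚ* : ∀ p → shift p ≈ tₚ *P p
  shift≈tₚ* p = ≈-sym (≈-trans (shift-*Pˡ 1ₚ p) (shift-cong (*P-identityˡ p)))

  ·≈const* : ∀ c p → c · p ≈ const c *P p
  ·≈const* c p = ≈-sym (≈-trans (+P-cong (≈-refl {c · p}) shift-0ₚ) (+P-identityʳ (c · p)))

  ∷≈ : ∀ c p → c ∷ p ≈ const c +P tₚ *P p
  ∷≈ c p = ≈-trans (∷-cong (sym (+-identityʳ c)) ≈-refl) (+P-cong (≈-refl {const c}) (shift≈tₚ* p))

  eval-+P : ∀ p q x → eval (p +P q) x ≡ eval p x + eval q x
  eval-+P []      q       x = sym (+-identityˡ _)
  eval-+P (c ∷ p) []      x = sym (+-identityʳ _)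
  eval-+P (c ∷ p) (d ∷ q) x = begin
    c + d + x * eval (p +P q) x                 ≡⟨ cong (λ e → c + d + x * e) (eval-+P p q x) ⟩
    c + d + x * (eval p x + eval q x)           ≡⟨ cong (_+_ (c + d)) (*-distribˡ-+ x _ _) ⟩
    c + d + (x * eval p x + x * eval q x)       ≡⟨ +-interchange c d _ _ ⟩
    c + x * eval p x + (d + x * eval q x)       ∎
    where open ≡-Reasoning

  eval-· : ∀ c p x → eval (c · p) x ≡ c * eval p x
  eval-· c []      x = sym (*-zeroʳ c)
  eval-· c (d ∷ p) x = begin
    c * d + x * eval (c · p) x    ≡⟨ cong (λ e → c * d + x * e) (eval-· c p x) ⟩
    c * d + x * (c * eval p x)    ≡⟨ cong (_+_ (c * d)) (*-exchange x c (eval p x)) ⟩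
    c * d + c * (x * eval p x)    ≡⟨ *-distribˡ-+ c d _ ⟨
    c * (d + x * eval p x)        ∎
    where open ≡-Reasoning

  eval-shift : ∀ p x → eval (shift p) x ≡ x * eval p x
  eval-shift p x = +-identityˡ _

  eval-*P : ∀ p q x → eval (p *P q) x ≡ eval p x * eval q x
  eval-*P []      q x = refl
  eval-*P (c ∷ p) q x = begin
    eval (c · q +P shift (p *P q)) x            ≡⟨ eval-+P (c · q) (shift (p *P q)) x ⟩
    eval (c · q) x + eval (shift (p *P q)) x    ≡⟨ cong₂ _+_ (eval-· c q x) (eval-shift (p *P q) x) ⟩
    c * eval q x + x * eval (p *P q) x          ≡⟨ cong (λ e → c * eval q x + x * e) (eval-*P p q x) ⟩
    c * eval q x + x * (eval p x * eval q x)    ≡⟨ cong (_+_ (c * eval q x)) (*-assoc x _ _) ⟨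
    c * eval q x + x * eval p x * eval q x      ≡⟨ *-distribʳ-+ (eval q x) c _ ⟨
    (c + x * eval p x) * eval q x               ∎
    where open ≡-Reasoning

  eval-≈0 : ∀ {p} x → p ≈ 0ₚ → eval p x ≡ + 0
  eval-≈0 {[]}    x _   = refl
  eval-≈0 {c ∷ p} x p≈0 = begin
    c + x * eval p x    ≡⟨ cong₂ (λ c e → c + x * e) (coeff≡ p≈0 0)
                                 (eval-≈0 {p} x (coeffwise λ k → coeff≡ p≈0 (suc k))) ⟩
    + 0 + x * + 0       ≡⟨ trans (+-identityˡ _) (*-zeroʳ x) ⟩
    + 0                 ∎
    where open ≡-Reasoning

  eval-cong : ∀ {p q} x → p ≈ q → eval p x ≡ eval q x
  eval-cong {[]}    {q}     x p≈q = sym (eval-≈0 x (≈-sym p≈q))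
  eval-cong {c ∷ p} {[]}    x p≈q = eval-≈0 x p≈q
  eval-cong {c ∷ p} {d ∷ q} x p≈q =
    cong₂ (λ c e → c + x * e) (coeff≡ p≈q 0) (eval-cong {p} {q} x (coeffwise λ k → coeff≡ p≈q (suc k)))

  deriv : Poly → Poly
  deriv []      = []
  deriv (c ∷ p) = p +P shift (deriv p)

  coeff-deriv : ∀ p k → coeff (deriv p) k ≡ + suc k * coeff p (suc k)
  coeff-deriv []      k       = sym (*-zeroʳ (+ suc k))
  coeff-deriv (c ∷ p) zero    = trans (coeff-+P p (shift (deriv p)) 0)
                                      (trans (+-identityʳ _) (sym (*-identityˡ _)))
  coeff-deriv (c ∷ p) (suc k) = begin
    coeff (p +P shift (deriv p)) (suc k)        ≡⟨ coeff-+P p (shift (deriv p)) (suc k) ⟩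
    coeff p (suc k) + coeff (deriv p) k         ≡⟨ cong (_+_ (coeff p (suc k))) (coeff-deriv p k) ⟩
    coeff p (suc k) + + suc k * coeff p (suc k)
      ≡⟨ cong (_+ + suc k * coeff p (suc k)) (*-identityˡ (coeff p (suc k))) ⟨
    + 1 * coeff p (suc k) + + suc k * coeff p (suc k) ≡⟨ *-distribʳ-+ (coeff p (suc k)) (+ 1) (+ suc k) ⟨
    + suc (suc k) * coeff p (suc k)             ∎
    where open ≡-Reasoning

  deriv-cong : ∀ {p q} → p ≈ q → deriv p ≈ deriv q
  deriv-cong {p} {q} p≈q = coeffwise λ k →
    trans (coeff-deriv p k) (trans (cong (+ suc k *_) (coeff≡ p≈q (suc k))) (sym (coeff-deriv q k)))

  deriv-+P : ∀ p q → deriv (p +P q) ≈ deriv p +P deriv q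
  deriv-+P p q = coeffwise λ k → begin
    coeff (deriv (p +P q)) k                         ≡⟨ coeff-deriv (p +P q) k ⟩
    + suc k * coeff (p +P q) (suc k)                 ≡⟨ cong (+ suc k *_) (coeff-+P p q (suc k)) ⟩
    + suc k * (coeff p (suc k) + coeff q (suc k))    ≡⟨ *-distribˡ-+ (+ suc k) (coeff p (suc k)) (coeff q (suc k)) ⟩
    + suc k * coeff p (suc k) + + suc k * coeff q (suc k)
      ≡⟨ cong₂ _+_ (coeff-deriv p k) (coeff-deriv q k) ⟨
    coeff (deriv p) k + coeff (deriv q) k            ≡⟨ coeff-+P (deriv p) (deriv q) k ⟨
    coeff (deriv p +P deriv q) k                     ∎
    where open ≡-Reasoning

  deriv-· : ∀ c p → deriv (c · p) ≈ c · deriv p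
  deriv-· c p = coeffwise λ k → begin
    coeff (deriv (c · p)) k              ≡⟨ coeff-deriv (c · p) k ⟩
    + suc k * coeff (c · p) (suc k)      ≡⟨ cong (+ suc k *_) (coeff-· c p (suc k)) ⟩
    + suc k * (c * coeff p (suc k))      ≡⟨ *-exchange (+ suc k) c _ ⟩
    c * (+ suc k * coeff p (suc k))      ≡⟨ cong (c *_) (coeff-deriv p k) ⟨
    c * coeff (deriv p) k                ≡⟨ coeff-· c (deriv p) k ⟨
    coeff (c · deriv p) k                ∎
    where open ≡-Reasoning

  open PolySolver

  leibniz : ∀ p q → deriv (p *P q) ≈ deriv p *P q +P p *P deriv q
  leibniz []      q = ≈-refl
  leibniz (c ∷ p) q = begin
    deriv (c · q +P shift (p *P q))
      ≈⟨ deriv-+P (c · q) (shift (p *P q)) ⟩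
    deriv (c · q) +P (p *P q +P shift (deriv (p *P q)))
      ≈⟨ +P-cong (≈-trans (deriv-· c q) (·≈const* c (deriv q)))
                 (+P-cong (≈-refl {p *P q}) (≈-trans (shift-cong (leibniz p q)) (shift≈tₚ* _))) ⟩
    const c *P q′ +P (p *P q +P tₚ *P (p′ *P q +P p *P q′))
      ≈⟨ solve 6 (λ C Q Q′ P P′ T → C :* Q′ :+ (P :* Q :+ T :* (P′ :* Q :+ P :* Q′))
                                := (P :+ T :* P′) :* Q :+ (C :+ T :* P) :* Q′)
               ≈-refl (const c) q q′ p p′ tₚ ⟩
    (p +P tₚ *P p′) *P q +P (const c +P tₚ *P p) *P q′
      ≈⟨ +P-cong (*P-congˡ q (+P-cong (≈-refl {p}) (≈-sym (shift≈tₚ* p′))))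
                 (*P-congˡ q′ (≈-sym (∷≈ c p))) ⟩
    (p +P shift p′) *P q +P (c ∷ p) *P q′ ∎
    where
    open ≈-Reasoning
    p′ q′ : Poly
    p′ = deriv p
    q′ = deriv q

  Deg≤ : Poly → ℕ → Set
  Deg≤ p d = ∀ k → d ℕ.< k → coeff p k ≡ + 0

  Deg≤0⇒tail≈0 : ∀ {c p} → Deg≤ (c ∷ p) 0 → p ≈ 0ₚ
  Deg≤0⇒tail≈0 deg = coeffwise λ k → deg (suc k) (ℕ.s≤s ℕ.z≤n)

  coeff-*P-∷ : ∀ c p q k → coeff ((c ∷ p) *P q) k ≡ c * coeff q k + coeff (shift (p *P q)) k
  coeff-*P-∷ c p q k = trans (coeff-+P (c · q) (shift (p *P q)) k) (cong (_+ _) (coeff-· c q k))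

  coeff-*P-const : ∀ {c p} q k → Deg≤ (c ∷ p) 0 → coeff ((c ∷ p) *P q) k ≡ c * coeff q k
  coeff-*P-const {c} {p} q k deg = trans (coeff-*P-∷ c p q k)
    (trans (cong (_+_ (c * coeff q k))
                 (coeff≡ (≈-trans (shift-cong (*P-≈0 q (Deg≤0⇒tail≈0 deg))) shift-0ₚ) k))
           (+-identityʳ _))

  deg-*P : ∀ p q {a b} → Deg≤ p a → Deg≤ q b → Deg≤ (p *P q) (a ℕ.+ b)
  deg-*P []      q         _     _     k _   = refl
  deg-*P (c ∷ p) q {zero}  degp degq k b<k =
    trans (coeff-*P-const q k degp) (trans (cong (c *_) (degq k b<k)) (*-zeroʳ c))
  deg-*P (c ∷ p) q {suc a} degp degq (suc k) a+b<k = begin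
    coeff ((c ∷ p) *P q) (suc k)                  ≡⟨ coeff-*P-∷ c p q (suc k) ⟩
    c * coeff q (suc k) + coeff (p *P q) k        ≡⟨ cong₂ (λ x y → c * x + y)
         (degq (suc k) (ℕₚ.<-trans (ℕ.s≤s (ℕₚ.m≤n+m _ a)) a+b<k))
         (deg-*P p q (λ k a<k → degp (suc k) (ℕ.s≤s a<k)) degq k (ℕ.s≤s⁻¹ a+b<k)) ⟩
    c * + 0 + + 0                                 ≡⟨ trans (+-identityʳ _) (*-zeroʳ c) ⟩
    + 0                                           ∎
    where
    open ≡-Reasoning

  top-*P : ∀ p q {a b} → Deg≤ p a → Deg≤ q b → coeff (p *P q) (a ℕ.+ b) ≡ coeff p a * coeff q b
  top-*P []      q {a}     {b} _    _    = sym (*-zeroˡ (coeff q b))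
  top-*P (c ∷ p) q {zero}  {b} degp degq = coeff-*P-const q b degp
  top-*P (c ∷ p) q {suc a} {b} degp degq = begin
    coeff ((c ∷ p) *P q) (suc (a ℕ.+ b))           ≡⟨ coeff-*P-∷ c p q (suc (a ℕ.+ b)) ⟩
    c * coeff q (suc (a ℕ.+ b)) + coeff (p *P q) (a ℕ.+ b)
      ≡⟨ cong₂ (λ x y → c * x + y) (degq _ (ℕ.s≤s (ℕₚ.m≤n+m b a)))
                                   (top-*P p q (λ k a<k → degp (suc k) (ℕ.s≤s a<k)) degq) ⟩
    c * + 0 + coeff p a * coeff q b                 ≡⟨ trans (cong (_+ _) (*-zeroʳ c)) (+-identityˡ _) ⟩
    coeff p a * coeff q b                          ∎
    where
    open ≡-Reasoning

  onePlusT≈ : onePlusT ≈ 1ₚ +P tₚ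
  onePlusT≈ = ≈-refl

  monic-^ₚ : ∀ {p} → Deg≤ p 1 → coeff p 1 ≡ + 1 → ∀ m → Deg≤ (p ^ₚ m) m × coeff (p ^ₚ m) m ≡ + 1
  monic-^ₚ         deg top zero    = (λ { (suc k) _ → refl }) , refl
  monic-^ₚ {p} deg top (suc m) with monic-^ₚ deg top m
  ... | degᵐ , topᵐ = deg-*P p (p ^ₚ m) deg degᵐ ,
                      trans (top-*P p (p ^ₚ m) deg degᵐ) (cong₂ _*_ top topᵐ)

  eval-^ₚ : ∀ p m x → eval (p ^ₚ m) x ≡ eval p x ^ m
  eval-^ₚ p zero    x = trans (cong (_+_ (+ 1)) (*-zeroʳ x)) (+-identityʳ (+ 1))
  eval-^ₚ p (suc m) x = trans (eval-*P p (p ^ₚ m) x) (cong (eval p x *_) (eval-^ₚ p m x))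

  onePlusT*P : ∀ p → onePlusT *P p ≈ p +P shift p
  onePlusT*P p = +P-cong (·-identity p) (shift-cong (*P-identityˡ p))

  cancel-onePlusT : ∀ {p q} → onePlusT *P p ≈ onePlusT *P q → p ≈ q
  cancel-onePlusT {p} {q} eq = coeffwise go
    where
    open import Algebra.Properties.AbelianGroup +-0-abelianGroup using (∙-cancelʳ)
    eq′ : p +P shift p ≈ q +P shift q
    eq′ = ≈-trans (≈-sym (onePlusT*P p)) (≈-trans eq (onePlusT*P q))
    go : ∀ k → coeff p k ≡ coeff q k
    go zero    = begin
      coeff p 0                   ≡⟨ +-identityʳ _ ⟨
      coeff p 0 + + 0             ≡⟨ coeff-+P p (shift p) 0 ⟨
      coeff (p +P shift p) 0      ≡⟨ coeff≡ eq′ 0 ⟩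
      coeff (q +P shift q) 0      ≡⟨ trans (coeff-+P q (shift q) 0) (+-identityʳ _) ⟩
      coeff q 0                   ∎
      where open ≡-Reasoning
    go (suc k) = ∙-cancelʳ (coeff p k) _ _ (begin
      coeff p (suc k) + coeff p k           ≡⟨ coeff-+P p (shift p) (suc k) ⟨
      coeff (p +P shift p) (suc k)          ≡⟨ coeff≡ eq′ (suc k) ⟩
      coeff (q +P shift q) (suc k)          ≡⟨ coeff-+P q (shift q) (suc k) ⟩
      coeff q (suc k) + coeff q k           ≡⟨ cong (_+_ (coeff q (suc k))) (go k) ⟨
      coeff q (suc k) + coeff p k           ∎)
      where open ≡-Reasoning

  cancel-onePlusT^ : ∀ h {p q} → (onePlusT ^ₚ h) *P p ≈ (onePlusT ^ₚ h) *P q → p ≈ q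
  cancel-onePlusT^ zero    {p} {q} eq = ≈-trans (≈-sym (*P-identityˡ p)) (≈-trans eq (*P-identityˡ q))
  cancel-onePlusT^ (suc h) {p} {q} eq = cancel-onePlusT^ h (cancel-onePlusT (begin
    onePlusT *P (onePlusT ^ₚ h *P p)   ≈⟨ *P-assoc onePlusT (onePlusT ^ₚ h) p ⟨
    onePlusT ^ₚ suc h *P p             ≈⟨ eq ⟩
    onePlusT ^ₚ suc h *P q             ≈⟨ *P-assoc onePlusT (onePlusT ^ₚ h) q ⟩
    onePlusT *P (onePlusT ^ₚ h *P q)   ∎))
    where open ≈-Reasoning

  ΣP : ℕ → (ℕ → Poly) → Poly
  ΣP zero    f = 0ₚ
  ΣP (suc N) f = ΣP N f +P f N

  ΣZ : ℕ → (ℕ → ℤ) → ℤ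
  ΣZ zero    g = + 0
  ΣZ (suc N) g = ΣZ N g + g N

  ΣP-cong : ∀ N {f g} → (∀ j → j ℕ.< N → f j ≈ g j) → ΣP N f ≈ ΣP N g
  ΣP-cong zero    f≈g = ≈-refl
  ΣP-cong (suc N) f≈g = +P-cong (ΣP-cong N (λ j j<N → f≈g j (ℕₚ.m<n⇒m<1+n j<N))) (f≈g N (ℕₚ.n<1+n N))

  ΣP-+P : ∀ N f g → ΣP N (λ j → f j +P g j) ≈ ΣP N f +P ΣP N g
  ΣP-+P zero    f g = ≈-refl
  ΣP-+P (suc N) f g = ≈-trans (+P-cong (ΣP-+P N f g) (≈-refl {f N +P g N}))
                              (+P-interchange (ΣP N f) (ΣP N g) (f N) (g N))

  ΣP-suc : ∀ N f → ΣP (suc N) f ≈ f 0 +P ΣP N (λ j → f (suc j))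
  ΣP-suc zero    f = +P-comm 0ₚ (f 0)
  ΣP-suc (suc N) f = ≈-trans (+P-cong (ΣP-suc N f) (≈-refl {f (suc N)}))
                             (+P-assoc (f 0) (ΣP N (λ j → f (suc j))) (f (suc N)))

  ΣP-zeros : ∀ N d f → (∀ j → N ℕ.≤ j → f j ≈ 0ₚ) → ΣP N f ≈ ΣP (N ℕ.+ d) f
  ΣP-zeros N zero    f zeros rewrite ℕₚ.+-identityʳ N = ≈-refl
  ΣP-zeros N (suc d) f zeros rewrite ℕₚ.+-suc N d = begin
    ΣP N f                        ≈⟨ ΣP-zeros N d f zeros ⟩
    ΣP (N ℕ.+ d) f                ≈⟨ +P-identityʳ _ ⟨
    ΣP (N ℕ.+ d) f +P 0ₚ
      ≈⟨ +P-cong (≈-refl {ΣP (N ℕ.+ d) f}) (zeros (N ℕ.+ d) (ℕₚ.m≤m+n N d)) ⟨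
    ΣP (N ℕ.+ d) f +P f (N ℕ.+ d) ∎
    where
    open ≈-Reasoning

  *P-ΣP : ∀ q N f → q *P ΣP N f ≈ ΣP N (λ j → q *P f j)
  *P-ΣP q zero    f = *P-zeroʳ q
  *P-ΣP q (suc N) f = ≈-trans (*P-distribˡ q (ΣP N f) (f N)) (+P-cong (*P-ΣP q N f) (≈-refl {q *P f N}))

  coeff-ΣP : ∀ N f k → coeff (ΣP N f) k ≡ ΣZ N (λ j → coeff (f j) k)
  coeff-ΣP zero    f k = refl
  coeff-ΣP (suc N) f k = trans (coeff-+P (ΣP N f) (f N) k) (cong (_+ coeff (f N) k) (coeff-ΣP N f k))

  eval-ΣP : ∀ N f x → eval (ΣP N f) x ≡ ΣZ N (λ j → eval (f j) x)
  eval-ΣP zero    f x = refl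
  eval-ΣP (suc N) f x = trans (eval-+P (ΣP N f) (f N) x) (cong (_+ eval (f N) x) (eval-ΣP N f x))

  ΣZ-cong : ∀ N {f g} → (∀ j → j ℕ.< N → f j ≡ g j) → ΣZ N f ≡ ΣZ N g
  ΣZ-cong zero    f≡g = refl
  ΣZ-cong (suc N) f≡g =
    cong₂ _+_ (ΣZ-cong N (λ j j<N → f≡g j (ℕₚ.m<n⇒m<1+n j<N))) (f≡g N (ℕₚ.n<1+n N))

  ΣZ-suc : ∀ N f → ΣZ (suc N) f ≡ f 0 + ΣZ N (λ j → f (suc j))
  ΣZ-suc zero    f = +-comm (+ 0) (f 0)
  ΣZ-suc (suc N) f = trans (cong (_+ f (suc N)) (ΣZ-suc N f)) (+-assoc (f 0) _ (f (suc N)))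

  ΣZ-zeros : ∀ N → ΣZ N (λ _ → + 0) ≡ + 0
  ΣZ-zeros zero    = refl
  ΣZ-zeros (suc N) = trans (+-identityʳ _) (ΣZ-zeros N)

  table : (ℕ → ℤ) → ℕ → Poly
  table c n = map c (upTo (suc n))

  coeff-map-applyUpTo : ∀ (f : ℕ → ℤ) g N k →
    coeff (map f (applyUpTo g N)) k ≡ (if k ℕ.<ᵇ N then f (g k) else + 0)
  coeff-map-applyUpTo f g zero    k       = refl
  coeff-map-applyUpTo f g (suc N) zero    = refl
  coeff-map-applyUpTo f g (suc N) (suc k) = coeff-map-applyUpTo f (g ∘ suc) N k

  coeff-table : ∀ {c n} → (∀ k → n ℕ.< k → c k ≡ + 0) → ∀ k → coeff (table c n) k ≡ c k
  coeff-table {c} {n} vanish k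
    rewrite coeff-map-applyUpTo c (λ k → k) (suc n) k
    with k ℕ.<ᵇ suc n | ℕₚ.<ᵇ-reflects-< k (suc n)
  ... | true  | _          = refl
  ... | false | ofⁿ k≮1+n = sym (vanish k (ℕₚ.≰⇒> (k≮1+n ∘ ℕ.s≤s)))

  eval-map-applyUpTo-1 : ∀ (f : ℕ → ℤ) g N → eval (map f (applyUpTo g N)) (+ 1) ≡ ΣZ N (f ∘ g)
  eval-map-applyUpTo-1 f g zero    = refl
  eval-map-applyUpTo-1 f g (suc N) = begin
    f (g 0) + + 1 * eval (map f (applyUpTo (g ∘ suc) N)) (+ 1)
      ≡⟨ cong (_+_ (f (g 0))) (*-identityˡ _) ⟩
    f (g 0) + eval (map f (applyUpTo (g ∘ suc) N)) (+ 1)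
      ≡⟨ cong (_+_ (f (g 0))) (eval-map-applyUpTo-1 f (g ∘ suc) N) ⟩
    f (g 0) + ΣZ N (f ∘ g ∘ suc)
      ≡⟨ ΣZ-suc N (f ∘ g) ⟨
    ΣZ (suc N) (f ∘ g) ∎
    where open ≡-Reasoning

  eval-table-1 : ∀ c n → eval (table c n) (+ 1) ≡ ΣZ (suc n) c
  eval-table-1 c n = eval-map-applyUpTo-1 c (λ k → k) (suc n)

module LeibnizConvolution where

  open import Data.Nat as ℕ using (ℕ; zero; suc)
  import Data.Nat.Properties as ℕₚ
  open import Data.Integer using (ℤ; +_; -_; _+_; _*_)
  open import Data.Integer.Properties
  open import Algebra.Properties.CommutativeSemigroup +-commutativeSemigroup
    using () renaming (interchange to +-interchange)
  open import Algebra.Properties.CommutativeSemigroup *-commutativeSemigroup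
    using () renaming (interchange to *-interchange)
  open import Relation.Binary.PropositionalEquality

  -- Σ_{i+j=n} (n choose i) H i j, computed from the Leibniz rule for the
  -- (n+1)-st derivative, so that no binomial coefficient appears.
  leibnizSum : {A : Set} → (A → A → A) → (ℕ → ℕ → A) → ℕ → A
  leibnizSum _⊕_ H zero    = H 0 0
  leibnizSum _⊕_ H (suc n) = leibnizSum _⊕_ (λ i j → H (suc i) j) n ⊕ leibnizSum _⊕_ (λ i j → H i (suc j)) n

  leibnizSum-hom : ∀ {A B : Set} (_⊕_ : A → A → A) (_⊞_ : B → B → B) (φ : A → B) →
    (∀ x y → φ (x ⊕ y) ≡ φ x ⊞ φ y) →
    ∀ H n → φ (leibnizSum _⊕_ H n) ≡ leibnizSum _⊞_ (λ i j → φ (H i j)) n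
  leibnizSum-hom _⊕_ _⊞_ φ hom H zero    = refl
  leibnizSum-hom _⊕_ _⊞_ φ hom H (suc n) =
    trans (hom _ _) (cong₂ _⊞_ (leibnizSum-hom _⊕_ _⊞_ φ hom _ n) (leibnizSum-hom _⊕_ _⊞_ φ hom _ n))

  ΣL : (ℕ → ℕ → ℤ) → ℕ → ℤ
  ΣL = leibnizSum _+_

  ΣL-cong : ∀ {H K} n → (∀ i j → i ℕ.+ j ≡ n → H i j ≡ K i j) → ΣL H n ≡ ΣL K n
  ΣL-cong zero    H≡K = H≡K 0 0 refl
  ΣL-cong (suc n) H≡K =
    cong₂ _+_ (ΣL-cong n (λ i j i+j≡n → H≡K (suc i) j (cong suc i+j≡n)))
              (ΣL-cong n (λ i j i+j≡n → H≡K i (suc j) (trans (ℕₚ.+-suc i j) (cong suc i+j≡n))))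

  ΣL-+ : ∀ H K n → ΣL (λ i j → H i j + K i j) n ≡ ΣL H n + ΣL K n
  ΣL-+ H K zero    = refl
  ΣL-+ H K (suc n) rewrite ΣL-+ (λ i j → H (suc i) j) (λ i j → K (suc i) j) n
                         | ΣL-+ (λ i j → H i (suc j)) (λ i j → K i (suc j)) n =
    +-interchange (ΣL (λ i j → H (suc i) j) n) (ΣL (λ i j → K (suc i) j) n)
                  (ΣL (λ i j → H i (suc j)) n) (ΣL (λ i j → K i (suc j)) n)

  ΣL-scale : ∀ c H n → ΣL (λ i j → c * H i j) n ≡ c * ΣL H n
  ΣL-scale c H n = sym (leibnizSum-hom _+_ _+_ (c *_) (*-distribˡ-+ c) H n)

  ΣL-zero : ∀ {H} n → (∀ i j → i ℕ.+ j ≡ n → H i j ≡ + 0) → ΣL H n ≡ + 0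
  ΣL-zero n H≡0 = trans (ΣL-cong n H≡0) (zeros n)
    where
    zeros : ∀ n → ΣL (λ _ _ → + 0) n ≡ + 0
    zeros zero    = refl
    zeros (suc n) rewrite zeros n = refl

  Seq : Set
  Seq = ℕ → ℤ

  infixl 7 _⋆_

  -- The product of exponential generating functions.
  _⋆_ : Seq → Seq → Seq
  (F ⋆ G) = ΣL (λ i j → F i * G j)

  ∂ : Seq → Seq
  ∂ F n = F (suc n)

  δ : Seq
  δ zero    = + 1
  δ (suc _) = + 0

  ⋆-cong : ∀ {F F′ G G′} n → (∀ k → F k ≡ F′ k) → (∀ k → G k ≡ G′ k) →
           (F ⋆ G) n ≡ (F′ ⋆ G′) n
  ⋆-cong n F≡ G≡ = ΣL-cong n (λ i j _ → cong₂ _*_ (F≡ i) (G≡ j))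

  ⋆-distribʳ-+ : ∀ F F′ G n → ((λ k → F k + F′ k) ⋆ G) n ≡ (F ⋆ G) n + (F′ ⋆ G) n
  ⋆-distribʳ-+ F F′ G n = trans (ΣL-cong n (λ i j _ → *-distribʳ-+ (G j) (F i) (F′ i))) (ΣL-+ _ _ n)

  ⋆-distribˡ-+ : ∀ F G G′ n → (F ⋆ (λ k → G k + G′ k)) n ≡ (F ⋆ G) n + (F ⋆ G′) n
  ⋆-distribˡ-+ F G G′ n = trans (ΣL-cong n (λ i j _ → *-distribˡ-+ (F i) (G j) (G′ j))) (ΣL-+ _ _ n)

  ⋆-scaleˡ : ∀ c F G n → ((λ k → c * F k) ⋆ G) n ≡ c * (F ⋆ G) n
  ⋆-scaleˡ c F G n = trans (ΣL-cong n (λ i j _ → *-assoc c (F i) (G j))) (ΣL-scale c _ n)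

  ⋆-comm : ∀ F G n → (F ⋆ G) n ≡ (G ⋆ F) n
  ⋆-comm F G zero    = *-comm (F 0) (G 0)
  ⋆-comm F G (suc n) = trans (cong₂ _+_ (⋆-comm (∂ F) G n) (⋆-comm F (∂ G) n))
                             (+-comm ((G ⋆ ∂ F) n) ((∂ G ⋆ F) n))

  ⋆-scaleʳ : ∀ c F G n → (F ⋆ (λ k → c * G k)) n ≡ c * (F ⋆ G) n
  ⋆-scaleʳ c F G n = trans (⋆-comm F _ n) (trans (⋆-scaleˡ c G F n) (cong (c *_) (⋆-comm G F n)))

  ⋆-assoc : ∀ F G H n → ((F ⋆ G) ⋆ H) n ≡ (F ⋆ (G ⋆ H)) n
  ⋆-assoc F G H zero    = *-assoc (F 0) (G 0) (H 0)
  ⋆-assoc F G H (suc n) = begin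
    (∂ (F ⋆ G) ⋆ H) n + ((F ⋆ G) ⋆ ∂ H) n
      ≡⟨ cong (_+ ((F ⋆ G) ⋆ ∂ H) n) (⋆-distribʳ-+ (∂ F ⋆ G) (F ⋆ ∂ G) H n) ⟩
    ((∂ F ⋆ G) ⋆ H) n + ((F ⋆ ∂ G) ⋆ H) n + ((F ⋆ G) ⋆ ∂ H) n
      ≡⟨ cong₂ _+_ (cong₂ _+_ (⋆-assoc (∂ F) G H n) (⋆-assoc F (∂ G) H n)) (⋆-assoc F G (∂ H) n) ⟩
    (∂ F ⋆ (G ⋆ H)) n + (F ⋆ (∂ G ⋆ H)) n + (F ⋆ (G ⋆ ∂ H)) n
      ≡⟨ +-assoc ((∂ F ⋆ (G ⋆ H)) n) _ _ ⟩
    (∂ F ⋆ (G ⋆ H)) n + ((F ⋆ (∂ G ⋆ H)) n + (F ⋆ (G ⋆ ∂ H)) n)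
      ≡⟨ cong (_+_ ((∂ F ⋆ (G ⋆ H)) n)) (⋆-distribˡ-+ F (∂ G ⋆ H) (G ⋆ ∂ H) n) ⟨
    (∂ F ⋆ (G ⋆ H)) n + (F ⋆ ∂ (G ⋆ H)) n ∎
    where open ≡-Reasoning

  δ-⋆ : ∀ G n → (δ ⋆ G) n ≡ G n
  δ-⋆ G zero    = *-identityˡ (G 0)
  δ-⋆ G (suc n) = trans (cong (_+ (δ ⋆ ∂ G) n) (ΣL-zero n (λ i j _ → *-zeroˡ (G j))))
                        (trans (+-identityˡ _) (δ-⋆ (∂ G) n))

  ⋆-δ : ∀ G n → (G ⋆ δ) n ≡ G n
  ⋆-δ G n = trans (⋆-comm G δ n) (δ-⋆ G n)

  sign : ℕ → ℤ
  sign zero    = + 1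
  sign (suc n) = - sign n

  twist : Seq → Seq
  twist F n = sign n * F n

  sign-+ : ∀ i j → sign (i ℕ.+ j) ≡ sign i * sign j
  sign-+ zero    j = sym (*-identityˡ (sign j))
  sign-+ (suc i) j = trans (cong -_ (sign-+ i j)) (neg-distribˡ-* (sign i) (sign j))

  twist-⋆ : ∀ F G n → (twist F ⋆ twist G) n ≡ twist (F ⋆ G) n
  twist-⋆ F G n = trans (ΣL-cong n twisted) (ΣL-scale (sign n) _ n)
    where
    twisted : ∀ i j → i ℕ.+ j ≡ n → sign i * F i * (sign j * G j) ≡ sign n * (F i * G j)
    twisted i j refl rewrite sign-+ i j = *-interchange (sign i) (F i) (sign j) (G j)


  ⋆-congʳ-≤ : ∀ F {G G′} n → (∀ j → j ℕ.≤ n → G j ≡ G′ j) → (F ⋆ G) n ≡ (F ⋆ G′) n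
  ⋆-congʳ-≤ F n G≡ = ΣL-cong n λ i j i+j≡n →
    cong (F i *_) (G≡ j (subst (j ℕ.≤_) i+j≡n (ℕₚ.m≤n+m j i)))

  ⋆-congˡ-≤ : ∀ {F F′} G n → (∀ i → i ℕ.≤ n → F i ≡ F′ i) → (F ⋆ G) n ≡ (F′ ⋆ G) n
  ⋆-congˡ-≤ G n F≡ = ΣL-cong n λ i j i+j≡n →
    cong (_* G j) (F≡ i (subst (i ℕ.≤_) i+j≡n (ℕₚ.m≤m+n i j)))

module GammaTriangle where

  open Polynomials
  open LeibnizConvolution
  open import Data.Nat as ℕ using (ℕ; zero; suc)
  import Data.Nat.Properties as ℕₚ
  open import Data.Integer using (ℤ; +_; -_; _+_; _*_; _-_)
  open import Data.Integer.Properties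
  open import Data.Integer.Tactic.RingSolver using (solve-∀)
  open import Relation.Binary.PropositionalEquality
  open import Function using (_∘_)

  γ : ℕ → ℕ → ℤ
  γ zero    zero    = + 1
  γ zero    (suc j) = + 0
  γ (suc n) zero    = + 0
  γ (suc n) (suc j) = + suc j * γ n (suc j) + (+ suc n - + (j ℕ.+ j)) * γ n j

  γ-above : ∀ n j → n ℕ.< j → γ n j ≡ + 0
  γ-above zero    (suc j) _   = refl
  γ-above (suc n) (suc j) n<j
    rewrite γ-above n (suc j) (ℕₚ.m<n⇒m<1+n (ℕ.s≤s⁻¹ n<j)) | γ-above n j (ℕ.s≤s⁻¹ n<j) =
    cong₂ _+_ (*-zeroʳ (+ suc j)) (*-zeroʳ (+ suc n - + (j ℕ.+ j)))

  Γ : ℕ → Poly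
  Γ n = table (γ n) n

  coeff-Γ : ∀ n k → coeff (Γ n) k ≡ γ n k
  coeff-Γ n = coeff-table (γ-above n)

  open PolySolver

  shift²≈ : ∀ p → shift (shift p) ≈ tₚ *P (tₚ *P p)
  shift²≈ p = ≈-trans (shift≈tₚ* (shift p)) (*P-congʳ tₚ (shift≈tₚ* p))

  D : Poly → Poly
  D p = (tₚ +P const (- + 2) *P (tₚ *P tₚ)) *P deriv p

  D≈ : ∀ p → D p ≈ shift (deriv p) +P (- + 2) · shift (shift (deriv p))
  D≈ p = begin
    D p
      ≈⟨ solve 3 (λ T C P′ → (T :+ C :* (T :* T)) :* P′ := T :* P′ :+ C :* (T :* (T :* P′)))
               ≈-refl tₚ (const (- + 2)) (deriv p) ⟩
    tₚ *P deriv p +P const (- + 2) *P (tₚ *P (tₚ *P deriv p))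
      ≈⟨ +P-cong (≈-sym (shift≈tₚ* (deriv p)))
                 (≈-trans (*P-congʳ (const (- + 2)) (≈-sym (shift²≈ (deriv p))))
                          (≈-sym (·≈const* (- + 2) (shift (shift (deriv p)))))) ⟩
    shift (deriv p) +P (- + 2) · shift (shift (deriv p)) ∎
    where open ≈-Reasoning

  coeff-shift-deriv : ∀ p k → coeff (shift (deriv p)) k ≡ + k * coeff p k
  coeff-shift-deriv p zero    = sym (*-zeroˡ (coeff p 0))
  coeff-shift-deriv p (suc k) = coeff-deriv p k

  coeff-D-zero : ∀ p → coeff (D p) 0 ≡ + 0
  coeff-D-zero p = trans (coeff≡ (D≈ p) 0)
    (trans (coeff-+P (shift (deriv p)) ((- + 2) · shift (shift (deriv p))) 0)
           (cong (_+_ (+ 0)) (coeff-· (- + 2) (shift (shift (deriv p))) 0)))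

  coeff-D-suc : ∀ p k → coeff (D p) (suc k) ≡ + suc k * coeff p (suc k) + (- + 2) * (+ k * coeff p k)
  coeff-D-suc p k = begin
    coeff (D p) (suc k)
      ≡⟨ coeff≡ (D≈ p) (suc k) ⟩
    coeff (shift (deriv p) +P (- + 2) · shift (shift (deriv p))) (suc k)
      ≡⟨ coeff-+P (shift (deriv p)) ((- + 2) · shift (shift (deriv p))) (suc k) ⟩
    coeff (deriv p) k + coeff ((- + 2) · shift (shift (deriv p))) (suc k)
      ≡⟨ cong₂ _+_ (coeff-deriv p k) (coeff-· (- + 2) (shift (shift (deriv p))) (suc k)) ⟩
    + suc k * coeff p (suc k) + (- + 2) * coeff (shift (deriv p)) k
      ≡⟨ cong (λ c → + suc k * coeff p (suc k) + (- + 2) * c) (coeff-shift-deriv p k) ⟩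
    + suc k * coeff p (suc k) + (- + 2) * (+ k * coeff p k) ∎
    where open ≡-Reasoning

  Γ-suc : ∀ n → Γ (suc n) ≈ (+ suc n) · shift (Γ n) +P D (Γ n)
  Γ-suc n = coeffwise λ k → trans (coeff-Γ (suc n) k) (sym (rhs k))
    where
    open ≡-Reasoning
    rhs : ∀ k → coeff ((+ suc n) · shift (Γ n) +P D (Γ n)) k ≡ γ (suc n) k
    rhs zero = begin
      coeff ((+ suc n) · shift (Γ n) +P D (Γ n)) 0
        ≡⟨ coeff-+P ((+ suc n) · shift (Γ n)) (D (Γ n)) 0 ⟩
      coeff ((+ suc n) · shift (Γ n)) 0 + coeff (D (Γ n)) 0
        ≡⟨ cong₂ _+_ (coeff-· (+ suc n) (shift (Γ n)) 0) (coeff-D-zero (Γ n)) ⟩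
      + suc n * + 0 + + 0
        ≡⟨ trans (+-identityʳ _) (*-zeroʳ (+ suc n)) ⟩
      + 0 ∎
    rhs (suc k) = begin
      coeff ((+ suc n) · shift (Γ n) +P D (Γ n)) (suc k)
        ≡⟨ coeff-+P ((+ suc n) · shift (Γ n)) (D (Γ n)) (suc k) ⟩
      coeff ((+ suc n) · shift (Γ n)) (suc k) + coeff (D (Γ n)) (suc k)
        ≡⟨ cong₂ _+_ (coeff-· (+ suc n) (shift (Γ n)) (suc k)) (coeff-D-suc (Γ n) k) ⟩
      + suc n * coeff (Γ n) k + (+ suc k * coeff (Γ n) (suc k) + (- + 2) * (+ k * coeff (Γ n) k))
        ≡⟨ cong₂ (λ x y → + suc n * x + (+ suc k * y + (- + 2) * (+ k * x)))
                 (coeff-Γ n k) (coeff-Γ n (suc k)) ⟩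
      + suc n * γ n k + (+ suc k * γ n (suc k) + (- + 2) * (+ k * γ n k))
        ≡⟨ rearrange (+ suc n) (+ suc k) (+ k) (γ n (suc k)) (γ n k) ⟩
      + suc k * γ n (suc k) + (+ suc n - (+ k + + k)) * γ n k
        ≡⟨ cong (λ k+k → + suc k * γ n (suc k) + (+ suc n - k+k) * γ n k) (pos-+ k k) ⟨
      γ (suc n) (suc k) ∎
      where
      rearrange : ∀ N K k A B → N * B + (K * A + (- + 2) * (k * B)) ≡ K * A + (N - (k + k)) * B
      rearrange = solve-∀

  w : Poly
  w = tₚ +P const (- + 2) *P (tₚ *P tₚ)

  D-cong : ∀ {p q} → p ≈ q → D p ≈ D q
  D-cong p≈q = *P-congʳ w (deriv-cong p≈q)

  D-+P : ∀ p q → D (p +P q) ≈ D p +P D q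
  D-+P p q = ≈-trans (*P-congʳ w (deriv-+P p q)) (*P-distribˡ w (deriv p) (deriv q))

  D-· : ∀ c p → D (c · p) ≈ c · D p
  D-· c p = ≈-trans (*P-congʳ w (deriv-· c p)) (*P-·ʳ c w (deriv p))

  D-*P : ∀ p q → D (p *P q) ≈ D p *P q +P p *P D q
  D-*P p q = ≈-trans (*P-congʳ w (leibniz p q))
    (solve 5 (λ W P P′ Q Q′ → W :* (P′ :* Q :+ P :* Q′) := W :* P′ :* Q :+ P :* (W :* Q′))
           ≈-refl w p (deriv p) q (deriv q))

  ΓRecurrence : ℕ → (ℕ → Poly) → Set
  ΓRecurrence a F = ∀ k → F (suc k) ≈ (+ (k ℕ.+ a)) · shift (F k) +P D (F k)

  Γ-ΓRecurrence : ΓRecurrence 1 Γ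
  Γ-ΓRecurrence k rewrite ℕₚ.+-comm k 1 = Γ-suc k

  conv : (ℕ → Poly) → (ℕ → Poly) → ℕ → Poly
  conv F G = leibnizSum _+P_ (λ i j → F i *P G j)

  ΓRecurrence-suc : ∀ {a F} → ΓRecurrence a F → ΓRecurrence (suc a) (F ∘ suc)
  ΓRecurrence-suc {a} rec k rewrite ℕₚ.+-suc k a = rec (suc k)

  ·shift≈ : ∀ c p → c · shift p ≈ const c *P (tₚ *P p)
  ·shift≈ c p = ≈-trans (·≈const* c (shift p)) (*P-congʳ (const c) (shift≈tₚ* p))

  conv-ΓRecurrence : ∀ {a b F G} → ΓRecurrence a F → ΓRecurrence b G → ΓRecurrence (a ℕ.+ b) (conv F G)
  conv-ΓRecurrence {a} {b} {F} {G} recF recG zero = begin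
    F 1 *P G 0 +P F 0 *P G 1
      ≈⟨ +P-cong (*P-congˡ (G 0) (≈-trans (recF 0) (+P-cong (·shift≈ (+ a) (F 0)) (≈-refl {D (F 0)}))))
                 (*P-congʳ (F 0) (≈-trans (recG 0) (+P-cong (·shift≈ (+ b) (G 0)) (≈-refl {D (G 0)})))) ⟩
    (const (+ a) *P (tₚ *P F 0) +P D (F 0)) *P G 0 +P F 0 *P (const (+ b) *P (tₚ *P G 0) +P D (G 0))
      ≈⟨ solve 7 (λ A B T F₀ G₀ DF DG →
                    (A :* (T :* F₀) :+ DF) :* G₀ :+ F₀ :* (B :* (T :* G₀) :+ DG)
                 := (A :+ B) :* (T :* (F₀ :* G₀)) :+ (DF :* G₀ :+ F₀ :* DG))
               ≈-refl (const (+ a)) (const (+ b)) tₚ (F 0) (G 0) (D (F 0)) (D (G 0)) ⟩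
    (const (+ a) +P const (+ b)) *P (tₚ *P (F 0 *P G 0)) +P (D (F 0) *P G 0 +P F 0 *P D (G 0))
      ≈⟨ +P-cong (≈-sym (≈-trans (·shift≈ (+ (a ℕ.+ b)) (F 0 *P G 0))
                                 (*P-congˡ {const (+ (a ℕ.+ b))} {const (+ a) +P const (+ b)}
                                           (tₚ *P (F 0 *P G 0)) (∷-cong (pos-+ a b) ≈-refl))))
                 (≈-sym (D-*P (F 0) (G 0))) ⟩
    (+ (a ℕ.+ b)) · shift (F 0 *P G 0) +P D (F 0 *P G 0) ∎
    where open ≈-Reasoning
  conv-ΓRecurrence {a} {b} {F} {G} recF recG (suc k) = begin
    P₁′ +P P₂′
      ≈⟨ +P-cong (conv-ΓRecurrence {F = F ∘ suc} {G} (ΓRecurrence-suc {F = F} recF) recG k)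
                 (conv-ΓRecurrence {F = F} {G ∘ suc} recF (ΓRecurrence-suc {F = G} recG) k) ⟩
    ((+ (k ℕ.+ (suc a ℕ.+ b))) · shift P₁ +P D P₁) +P ((+ (k ℕ.+ (a ℕ.+ suc b))) · shift P₂ +P D P₂)
      ≈⟨ +P-cong (+P-cong (·-congˡ (shift P₁) (cong +_ (ℕₚ.+-suc k (a ℕ.+ b)))) (≈-refl {D P₁}))
                 (+P-cong (·-congˡ (shift P₂) (cong +_ (trans (cong (k ℕ.+_) (ℕₚ.+-suc a b))
                                                                  (ℕₚ.+-suc k (a ℕ.+ b))))) (≈-refl {D P₂})) ⟩
    (C · shift P₁ +P D P₁) +P (C · shift P₂ +P D P₂)
      ≈⟨ +P-interchange (C · shift P₁) (D P₁) (C · shift P₂) (D P₂) ⟩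
    (C · shift P₁ +P C · shift P₂) +P (D P₁ +P D P₂)
      ≈⟨ +P-cong (≈-sym (·-distribˡ-+P C (shift P₁) (shift P₂))) (≈-sym (D-+P P₁ P₂)) ⟩
    C · shift (P₁ +P P₂) +P D (P₁ +P P₂) ∎
    where
    open ≈-Reasoning
    P₁ P₂ P₁′ P₂′ : Poly
    P₁ = conv (F ∘ suc) G k
    P₂ = conv F (G ∘ suc) k
    P₁′ = conv (F ∘ suc) G (suc k)
    P₂′ = conv F (G ∘ suc) (suc k)
    C : ℤ
    C = + (suc k ℕ.+ (a ℕ.+ b))

  riccati : ∀ n → (+ 2) · Γ (suc (suc n)) ≈ conv Γ Γ (suc n)
  riccati zero    = coeffwise λ { 0 → refl ; 1 → refl ; 2 → refl ; (suc (suc (suc k))) → refl }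
  riccati (suc n) = begin
    (+ 2) · Γ (3 ℕ.+ n)
      ≈⟨ ·-cong (+ 2) (Γ-suc (2 ℕ.+ n)) ⟩
    (+ 2) · (C · shift (Γ (2 ℕ.+ n)) +P D (Γ (2 ℕ.+ n)))
      ≈⟨ ·-distribˡ-+P (+ 2) (C · shift (Γ (2 ℕ.+ n))) (D (Γ (2 ℕ.+ n))) ⟩
    (+ 2) · (C · shift (Γ (2 ℕ.+ n))) +P (+ 2) · D (Γ (2 ℕ.+ n))
      ≈⟨ +P-cong (·-commute (+ 2) C (shift (Γ (2 ℕ.+ n)))) (≈-sym (D-· (+ 2) (Γ (2 ℕ.+ n)))) ⟩
    C · ((+ 2) · shift (Γ (2 ℕ.+ n))) +P D ((+ 2) · Γ (2 ℕ.+ n))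
      ≈⟨ +P-cong (·-cong C (·-shift (+ 2) (Γ (2 ℕ.+ n)))) (≈-refl {D ((+ 2) · Γ (2 ℕ.+ n))}) ⟩
    C · shift ((+ 2) · Γ (2 ℕ.+ n)) +P D ((+ 2) · Γ (2 ℕ.+ n))
      ≈⟨ +P-cong (·-cong C (shift-cong (riccati n))) (D-cong (riccati n)) ⟩
    C · shift (conv Γ Γ (suc n)) +P D (conv Γ Γ (suc n))
      ≈⟨ +P-cong (·-congˡ (shift (conv Γ Γ (suc n))) (cong +_ (cong suc (ℕₚ.+-comm 2 n))))
                 (≈-refl {D (conv Γ Γ (suc n))}) ⟩
    (+ (suc n ℕ.+ 2)) · shift (conv Γ Γ (suc n)) +P D (conv Γ Γ (suc n))
      ≈⟨ conv-ΓRecurrence {F = Γ} {G = Γ} Γ-ΓRecurrence Γ-ΓRecurrence (suc n) ⟨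
    conv Γ Γ (2 ℕ.+ n) ∎
    where
    open ≈-Reasoning
    C : ℤ
    C = + (3 ℕ.+ n)

module Parity where

  open import Data.Empty using (⊥-elim)
  open import Data.Nat as ℕ using (ℕ; zero; suc)
  import Data.Nat.Properties as ℕₚ
  open import Data.Integer using (ℤ; +_)
  open import Relation.Binary.PropositionalEquality
  open import Function using (_∘_)

  dbl : ℕ → ℕ
  dbl zero    = zero
  dbl (suc m) = suc (suc (dbl m))

  dbl≡m+m : ∀ m → dbl m ≡ m ℕ.+ m
  dbl≡m+m zero    = refl
  dbl≡m+m (suc m) = cong suc (trans (cong suc (dbl≡m+m m)) (sym (ℕₚ.+-suc m m)))

  2*≡dbl : ∀ n → 2 ℕ.* n ≡ dbl n
  2*≡dbl n = trans (cong (n ℕ.+_) (ℕₚ.+-identityʳ n)) (sym (dbl≡m+m n))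

  dbl-+ : ∀ a b → dbl a ℕ.+ dbl b ≡ dbl (a ℕ.+ b)
  dbl-+ zero    b = refl
  dbl-+ (suc a) b = cong (suc ∘ suc) (dbl-+ a b)

  dbl-injective : ∀ {a b} → dbl a ≡ dbl b → a ≡ b
  dbl-injective {zero}  {zero}  _ = refl
  dbl-injective {suc a} {suc b} e = cong suc (dbl-injective (ℕₚ.suc-injective (ℕₚ.suc-injective e)))

  dbl≢1+dbl : ∀ a b → dbl a ≢ suc (dbl b)
  dbl≢1+dbl (suc a) (suc b) e = dbl≢1+dbl a b (ℕₚ.suc-injective (ℕₚ.suc-injective e))
  dbl≢1+dbl (suc a) zero    e = ℕₚ.0≢1+n (sym (ℕₚ.suc-injective e))

  data Parity : ℕ → Set where
    even : ∀ a → Parity (dbl a)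
    odd  : ∀ a → Parity (suc (dbl a))

  parity : ∀ n → Parity n
  parity zero = even 0
  parity (suc n) with parity n
  ... | even a = odd a
  ... | odd  a = even (suc a)

  data EvenSplit (m : ℕ) : ℕ → ℕ → Set where
    even+even : ∀ a b → a ℕ.+ b ≡ m → EvenSplit m (dbl a) (dbl b)
    odd+odd   : ∀ a b → suc (a ℕ.+ b) ≡ m → EvenSplit m (suc (dbl a)) (suc (dbl b))

  evenSplit : ∀ {m} i j → i ℕ.+ j ≡ dbl m → EvenSplit m i j
  evenSplit i j i+j≡ with parity i | parity j
  ... | even a | even b = even+even a b (dbl-injective (trans (sym (dbl-+ a b)) i+j≡))
  ... | odd a  | odd b  = odd+odd a b (dbl-injective (begin
    suc (suc (dbl (a ℕ.+ b)))       ≡⟨ cong (suc ∘ suc) (dbl-+ a b) ⟨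
    suc (suc (dbl a ℕ.+ dbl b))     ≡⟨ cong suc (ℕₚ.+-suc (dbl a) (dbl b)) ⟨
    suc (dbl a) ℕ.+ suc (dbl b)     ≡⟨ i+j≡ ⟩
    dbl _                           ∎))
    where open ≡-Reasoning
  ... | even a | odd b  =
    ⊥-elim (dbl≢1+dbl _ (a ℕ.+ b) (trans (sym i+j≡) (trans (ℕₚ.+-suc (dbl a) (dbl b)) (cong suc (dbl-+ a b)))))
  ... | odd a  | even b = ⊥-elim (dbl≢1+dbl _ (a ℕ.+ b) (trans (sym i+j≡) (cong suc (dbl-+ a b))))

  parity-even : ∀ a → parity (dbl a) ≡ even a
  parity-even zero    = refl
  parity-even (suc a) rewrite parity-even a = refl

  parity-odd : ∀ a → parity (suc (dbl a)) ≡ odd a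
  parity-odd a rewrite parity-even a = refl

  atOdd : (ℕ → ℤ) → ℕ → ℤ
  atOdd f k with parity k
  ... | even _ = + 0
  ... | odd  a = f a

  atOdd-even : ∀ f a → atOdd f (dbl a) ≡ + 0
  atOdd-even f a rewrite parity-even a = refl

  atOdd-odd : ∀ f a → atOdd f (suc (dbl a)) ≡ f a
  atOdd-odd f a rewrite parity-odd a = refl

module GammaDegrees where

  open Parity
  open Polynomials
  open GammaTriangle
  open import Data.Nat as ℕ using (zero; suc)
  import Data.Nat.Properties as ℕₚ
  open import Data.Integer using (ℤ; +_; _+_; _*_; _-_)
  open import Data.Integer.Properties
  open import Data.Integer.Tactic.RingSolver using (solve-∀)
  open import Data.Sum using (inj₁; inj₂)
  open import Relation.Binary.PropositionalEquality

  γ-suc-≡0 : ∀ n j → γ n (suc j) ≡ + 0 → (+ suc n - + (j ℕ.+ j)) * γ n j ≡ + 0 →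
             γ (suc n) (suc j) ≡ + 0
  γ-suc-≡0 n j γ≡0 term≡0 rewrite γ≡0 | term≡0 = cong (_+ + 0) (*-zeroʳ (+ suc j))

  mutual
    γ-even-above : ∀ m j → m ℕ.< j → γ (dbl m) j ≡ + 0
    γ-even-above zero    (suc j) _   = refl
    γ-even-above (suc m) (suc j) m<j = γ-suc-≡0 (suc (dbl m)) j (γ-odd-above m (suc j) m<j) last
      where
      last : (+ suc (suc (dbl m)) - + (j ℕ.+ j)) * γ (suc (dbl m)) j ≡ + 0
      last with ℕₚ.m≤n⇒m<n∨m≡n (ℕ.s≤s⁻¹ m<j)
      ... | inj₁ m+1<j  = trans (cong (c *_) (γ-odd-above m j m+1<j)) (*-zeroʳ c)
        where
        c : ℤ
        c = + suc (suc (dbl m)) - + (j ℕ.+ j)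
      ... | inj₂ refl   = trans (cong (_* γ (suc (dbl m)) (suc m)) coefficient≡0) (*-zeroˡ (γ (suc (dbl m)) (suc m)))
        where
        coefficient≡0 : + suc (suc (dbl m)) - + (suc m ℕ.+ suc m) ≡ + 0
        coefficient≡0 rewrite dbl≡m+m m | ℕₚ.+-suc m m = +-inverseʳ (+ suc (suc (m ℕ.+ m)))

    γ-odd-above : ∀ m j → suc m ℕ.< j → γ (suc (dbl m)) j ≡ + 0
    γ-odd-above m (suc j) m+1<j+1 = γ-suc-≡0 (dbl m) j (γ-even-above m (suc j) (ℕₚ.m<n⇒m<1+n m<j))
      (trans (cong (c *_) (γ-even-above m j m<j)) (*-zeroʳ c))
      where
      m<j : m ℕ.< j
      m<j = ℕ.s≤s⁻¹ m+1<j+1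
      c : ℤ
      c = + suc (dbl m) - + (j ℕ.+ j)

  γ-odd-top : ∀ m → γ (suc (dbl m)) (suc m) ≡ γ (dbl m) m
  γ-odd-top m rewrite γ-even-above m (suc m) (ℕₚ.n<1+n m) = begin
    + suc m * + 0 + (+ suc (dbl m) - + (m ℕ.+ m)) * γ (dbl m) m
      ≡⟨ cong₂ (λ x c → x + c * γ (dbl m) m) (*-zeroʳ (+ suc m)) coefficient≡1 ⟩
    + 0 + + 1 * γ (dbl m) m
      ≡⟨ trans (+-identityˡ _) (*-identityˡ _) ⟩
    γ (dbl m) m ∎
    where
    open ≡-Reasoning
    coefficient≡1 : + suc (dbl m) - + (m ℕ.+ m) ≡ + 1
    coefficient≡1 rewrite dbl≡m+m m = trans (cong (_- + (m ℕ.+ m)) (pos-+ 1 (m ℕ.+ m))) (1+x-x (+ (m ℕ.+ m)))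
      where
      1+x-x : ∀ x → + 1 + x - x ≡ + 1
      1+x-x = solve-∀

  Γ-even-deg : ∀ m → Deg≤ (Γ (dbl m)) m
  Γ-even-deg m k m<k = trans (coeff-Γ (dbl m) k) (γ-even-above m k m<k)

  Γ-odd-deg : ∀ m → Deg≤ (Γ (suc (dbl m))) (suc m)
  Γ-odd-deg m k m<k = trans (coeff-Γ (suc (dbl m)) k) (γ-odd-above m k m<k)

module EulerNumbers where

  open Parity
  open GammaDegrees
  open Polynomials
  open LeibnizConvolution
  open GammaTriangle
  open import Data.Nat as ℕ using (ℕ; zero; suc)
  import Data.Nat.Properties as ℕₚ
  open import Data.Integer using (ℤ; +_; -_; _+_; _*_; _^_)
  open import Data.Integer.Properties
  open import Data.Integer.Tactic.RingSolver using (solve-∀)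
  open import Data.Nat.Induction using (<-rec)
  open import Relation.Binary.PropositionalEquality
  open import Function using (_∘_)

  leading : ℕ → ℤ
  leading a = γ (suc (dbl a)) (suc a)

  coeff-conv : ∀ F G n k → coeff (conv F G n) k ≡ ΣL (λ i j → coeff (F i *P G j) k) n
  coeff-conv F G n k = leibnizSum-hom _+P_ _+_ (λ p → coeff p k) (λ p q → coeff-+P p q k) _ n

  -- The coefficient of t^(m+2) in the Riccati equation for Γ (2m+3).
  leading-riccati : ∀ m → + 2 * leading (suc m) ≡ (atOdd leading ⋆ atOdd leading) (dbl (suc m))
  leading-riccati m = begin
    + 2 * γ (suc N) (suc (suc m))                      ≡⟨ cong (+ 2 *_) (coeff-Γ (suc N) (suc (suc m))) ⟨
    + 2 * coeff (Γ (suc N)) (suc (suc m))              ≡⟨ coeff-· (+ 2) (Γ (suc N)) (suc (suc m)) ⟨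
    coeff ((+ 2) · Γ (suc N)) (suc (suc m))            ≡⟨ coeff≡ (riccati (suc (dbl m))) (suc (suc m)) ⟩
    coeff (conv Γ Γ N) (suc (suc m))                   ≡⟨ coeff-conv Γ Γ N (suc (suc m)) ⟩
    ΣL (λ i j → coeff (Γ i *P Γ j) (suc (suc m))) N    ≡⟨ ΣL-cong N term ⟩
    (atOdd leading ⋆ atOdd leading) N                  ∎
    where
    open ≡-Reasoning
    N = dbl (suc m)
    term : ∀ i j → i ℕ.+ j ≡ N → coeff (Γ i *P Γ j) (suc (suc m)) ≡ atOdd leading i * atOdd leading j
    term i j i+j≡N with evenSplit i j i+j≡N
    ... | even+even a b a+b≡ rewrite atOdd-even leading a | atOdd-even leading b =
      deg-*P (Γ (dbl a)) (Γ (dbl b)) (Γ-even-deg a) (Γ-even-deg b) _ (ℕ.s≤s (ℕₚ.≤-reflexive a+b≡))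
    ... | odd+odd a b refl rewrite atOdd-odd leading a | atOdd-odd leading b = begin
      coeff (Γ (suc (dbl a)) *P Γ (suc (dbl b))) (suc (suc (a ℕ.+ b)))
        ≡⟨ cong (coeff (Γ (suc (dbl a)) *P Γ (suc (dbl b))) ∘ suc) (ℕₚ.+-suc a b) ⟨
      coeff (Γ (suc (dbl a)) *P Γ (suc (dbl b))) (suc a ℕ.+ suc b)
        ≡⟨ top-*P (Γ (suc (dbl a))) (Γ (suc (dbl b))) (Γ-odd-deg a) (Γ-odd-deg b) ⟩
      coeff (Γ (suc (dbl a))) (suc a) * coeff (Γ (suc (dbl b))) (suc b)
        ≡⟨ cong₂ _*_ (coeff-Γ (suc (dbl a)) (suc a)) (coeff-Γ (suc (dbl b)) (suc b)) ⟩
      leading a * leading b ∎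

  E : ℕ → ℤ
  E n = eval (Γ n) (+ 1)

  eval-conv : ∀ F G n x → eval (conv F G n) x ≡ ((λ i → eval (F i) x) ⋆ (λ j → eval (G j) x)) n
  eval-conv F G n x = trans (leibnizSum-hom _+P_ _+_ (λ p → eval p x) (λ p q → eval-+P p q x) _ n)
                            (ΣL-cong n (λ i j _ → eval-*P (F i) (G j) x))

  E-riccati : ∀ n → + 2 * E (suc n) ≡ (E ⋆ E) n + δ n
  E-riccati zero    = refl
  E-riccati (suc n) = begin
    + 2 * E (suc (suc n))                ≡⟨ eval-· (+ 2) (Γ (suc (suc n))) (+ 1) ⟨
    eval ((+ 2) · Γ (suc (suc n))) (+ 1) ≡⟨ eval-cong (+ 1) (riccati n) ⟩
    eval (conv Γ Γ (suc n)) (+ 1)        ≡⟨ eval-conv Γ Γ (suc n) (+ 1) ⟩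
    (E ⋆ E) (suc n)                      ≡⟨ +-identityʳ _ ⟨
    (E ⋆ E) (suc n) + + 0                ∎
    where open ≡-Reasoning

  twistE-riccati : ∀ n → + 2 * twist E (suc n) ≡ - ((twist E ⋆ twist E) n + δ n)
  twistE-riccati n = begin
    + 2 * (- sign n * E (suc n))                 ≡⟨ 2*[-s*e]≡-[s*[2*e]] (sign n) (E (suc n)) ⟩
    - (sign n * (+ 2 * E (suc n)))               ≡⟨ cong (λ e → - (sign n * e)) (E-riccati n) ⟩
    - (sign n * ((E ⋆ E) n + δ n))               ≡⟨ cong -_ (*-distribˡ-+ (sign n) _ (δ n)) ⟩
    - (twist (E ⋆ E) n + sign n * δ n)           ≡⟨ cong -_ (cong₂ _+_ (twist-⋆ E E n) (sym (sign-δ n))) ⟨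
    - ((twist E ⋆ twist E) n + δ n)              ∎
    where
    open ≡-Reasoning
    2*[-s*e]≡-[s*[2*e]] : ∀ s e → + 2 * (- s * e) ≡ - (s * (+ 2 * e))
    2*[-s*e]≡-[s*[2*e]] = solve-∀
    sign-δ : ∀ n → sign n * δ n ≡ δ n
    sign-δ zero    = refl
    sign-δ (suc n) = *-zeroʳ (sign (suc n))

  -- E(x) E(-x) = 1 for the exponential generating function E(x) of E.
  E⋆twistE≡δ : ∀ n → (E ⋆ twist E) n ≡ δ n
  E⋆twistE≡δ = <-rec _ step
    where
    step : ∀ n → (∀ {j} → j ℕ.< n → (E ⋆ twist E) j ≡ δ j) → (E ⋆ twist E) n ≡ δ n
    step zero    _  = refl
    step (suc k) IH = *-cancelˡ-≡ (+ 2) _ (+ 0) (begin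
      + 2 * ((∂ E ⋆ twist E) k + (E ⋆ ∂ (twist E)) k)
        ≡⟨ *-distribˡ-+ (+ 2) ((∂ E ⋆ twist E) k) ((E ⋆ ∂ (twist E)) k) ⟩
      + 2 * (∂ E ⋆ twist E) k + + 2 * (E ⋆ ∂ (twist E)) k
        ≡⟨ cong₂ _+_ left right ⟩
      E k + twist E k + - (twist E k + E k)
        ≡⟨ x+y-[y+x]≡0 (E k) (twist E k) ⟩
      + 0 ∎)
      where
      open ≡-Reasoning
      IH≤ : ∀ j → j ℕ.≤ k → (E ⋆ twist E) j ≡ δ j
      IH≤ j j≤k = IH (ℕ.s≤s j≤k)
      x+y-[y+x]≡0 : ∀ x y → x + y + - (y + x) ≡ + 0
      x+y-[y+x]≡0 = solve-∀
      left : + 2 * (∂ E ⋆ twist E) k ≡ E k + twist E k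
      left = begin
        + 2 * (∂ E ⋆ twist E) k                      ≡⟨ ⋆-scaleˡ (+ 2) (∂ E) (twist E) k ⟨
        ((λ i → + 2 * E (suc i)) ⋆ twist E) k        ≡⟨ ⋆-cong {G = twist E} k E-riccati (λ _ → refl) ⟩
        ((λ i → (E ⋆ E) i + δ i) ⋆ twist E) k        ≡⟨ ⋆-distribʳ-+ (E ⋆ E) δ (twist E) k ⟩
        ((E ⋆ E) ⋆ twist E) k + (δ ⋆ twist E) k
          ≡⟨ cong₂ _+_ (⋆-assoc E E (twist E) k) (δ-⋆ (twist E) k) ⟩
        (E ⋆ (E ⋆ twist E)) k + twist E k
          ≡⟨ cong (_+ twist E k) (trans (⋆-congʳ-≤ E k IH≤) (⋆-δ E k)) ⟩
        E k + twist E k                              ∎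
      right : + 2 * (E ⋆ ∂ (twist E)) k ≡ - (twist E k + E k)
      right = begin
        + 2 * (E ⋆ ∂ (twist E)) k                    ≡⟨ ⋆-scaleʳ (+ 2) E (∂ (twist E)) k ⟨
        (E ⋆ (λ i → + 2 * twist E (suc i))) k        ≡⟨ ⋆-cong {F = E} k (λ _ → refl) twistE-riccati ⟩
        (E ⋆ (λ i → - ((twist E ⋆ twist E) i + δ i))) k
          ≡⟨ ⋆-cong {F = E} k (λ _ → refl) (λ i → sym (-1*i≡-i ((twist E ⋆ twist E) i + δ i))) ⟩
        (E ⋆ (λ i → - + 1 * ((twist E ⋆ twist E) i + δ i))) k
          ≡⟨ trans (⋆-scaleʳ (- + 1) E _ k) (-1*i≡-i _) ⟩
        - (E ⋆ (λ i → (twist E ⋆ twist E) i + δ i)) k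
          ≡⟨ cong -_ (⋆-distribˡ-+ E (twist E ⋆ twist E) δ k) ⟩
        - ((E ⋆ (twist E ⋆ twist E)) k + (E ⋆ δ) k)
          ≡⟨ cong -_ (cong₂ _+_ (sym (⋆-assoc E (twist E) (twist E) k)) (⋆-δ E k)) ⟩
        - (((E ⋆ twist E) ⋆ twist E) k + E k)
          ≡⟨ cong (λ x → - (x + E k)) (trans (⋆-congˡ-≤ (twist E) k IH≤) (δ-⋆ (twist E) k)) ⟩
        - (twist E k + E k)                          ∎

  oddE : Seq
  oddE = atOdd (λ a → E (suc (dbl a)))

  sign-dbl : ∀ a → sign (dbl a) ≡ + 1
  sign-dbl zero    = refl
  sign-dbl (suc a) rewrite sign-dbl a = refl

  E≡twistE+2oddE : ∀ k → E k ≡ twist E k + + 2 * oddE k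
  E≡twistE+2oddE k with parity k
  ... | even a rewrite sign-dbl a | atOdd-even (λ a → E (suc (dbl a))) a =
    sym (trans (+-identityʳ _) (*-identityˡ _))
  ... | odd a rewrite sign-dbl a | atOdd-odd (λ a → E (suc (dbl a))) a = x≡-1*x+2*x (E (suc (dbl a)))
    where
    x≡-1*x+2*x : ∀ x → x ≡ - (+ 1) * x + + 2 * x
    x≡-1*x+2*x = solve-∀

  E⋆oddE≡oddE⋆oddE : ∀ m → (E ⋆ oddE) (dbl m) ≡ (oddE ⋆ oddE) (dbl m)
  E⋆oddE≡oddE⋆oddE m = ΣL-cong (dbl m) term
    where
    term : ∀ i j → i ℕ.+ j ≡ dbl m → E i * oddE j ≡ oddE i * oddE j
    term i j i+j≡ with evenSplit i j i+j≡
    ... | even+even a b _ rewrite atOdd-even (λ a → E (suc (dbl a))) a | atOdd-even (λ a → E (suc (dbl a))) b =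
      *-zeroʳ (E (dbl a))
    ... | odd+odd a b _ rewrite atOdd-odd (λ a → E (suc (dbl a))) a = refl

  -- tan′ = 1 + tan², read off the odd part of 2E′ = E² + 1.
  E-odd-riccati : ∀ m → E (suc (dbl m)) ≡ (oddE ⋆ oddE) (dbl m) + δ (dbl m)
  E-odd-riccati m = *-cancelˡ-≡ (+ 2) _ _ (begin
    + 2 * E (suc (dbl m))                                   ≡⟨ E-riccati (dbl m) ⟩
    (E ⋆ E) (dbl m) + δ (dbl m)                              ≡⟨ cong (_+ δ (dbl m)) E⋆E ⟩
    δ (dbl m) + + 2 * (oddE ⋆ oddE) (dbl m) + δ (dbl m)      ≡⟨ d+2x+d≡2[x+d] (δ (dbl m)) _ ⟩
    + 2 * ((oddE ⋆ oddE) (dbl m) + δ (dbl m))                ∎)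
    where
    open ≡-Reasoning
    d+2x+d≡2[x+d] : ∀ d x → d + + 2 * x + d ≡ + 2 * (x + d)
    d+2x+d≡2[x+d] = solve-∀
    E⋆E : (E ⋆ E) (dbl m) ≡ δ (dbl m) + + 2 * (oddE ⋆ oddE) (dbl m)
    E⋆E = begin
      (E ⋆ E) (dbl m)
        ≡⟨ ⋆-cong {F = E} (dbl m) (λ _ → refl) E≡twistE+2oddE ⟩
      (E ⋆ (λ k → twist E k + + 2 * oddE k)) (dbl m)          ≡⟨ ⋆-distribˡ-+ E (twist E) _ (dbl m) ⟩
      (E ⋆ twist E) (dbl m) + (E ⋆ (λ k → + 2 * oddE k)) (dbl m)
        ≡⟨ cong₂ _+_ (E⋆twistE≡δ (dbl m)) (⋆-scaleʳ (+ 2) E oddE (dbl m)) ⟩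
      δ (dbl m) + + 2 * (E ⋆ oddE) (dbl m)
        ≡⟨ cong (λ x → δ (dbl m) + + 2 * x) (E⋆oddE≡oddE⋆oddE m) ⟩
      δ (dbl m) + + 2 * (oddE ⋆ oddE) (dbl m)                 ∎

  E-odd≡2^*leading : ∀ m → E (suc (dbl m)) ≡ (+ 2) ^ m * leading m
  E-odd≡2^*leading = <-rec _ step
    where
    step : ∀ m → (∀ {a} → a ℕ.< m → E (suc (dbl a)) ≡ (+ 2) ^ a * leading a) →
           E (suc (dbl m)) ≡ (+ 2) ^ m * leading m
    step zero    _  = refl
    step (suc m) IH = begin
      E (suc (dbl (suc m)))                                  ≡⟨ E-odd-riccati (suc m) ⟩
      (oddE ⋆ oddE) N + + 0                                  ≡⟨ +-identityʳ _ ⟩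
      (oddE ⋆ oddE) N                                        ≡⟨ ΣL-cong N term ⟩
      ΣL (λ i j → (+ 2) ^ m * (atOdd leading i * atOdd leading j)) N
        ≡⟨ ΣL-scale ((+ 2) ^ m) (λ i j → atOdd leading i * atOdd leading j) N ⟩
      (+ 2) ^ m * (atOdd leading ⋆ atOdd leading) N          ≡⟨ cong ((+ 2) ^ m *_) (leading-riccati m) ⟨
      (+ 2) ^ m * (+ 2 * leading (suc m))                    ≡⟨ p*[2*x]≡2*p*x ((+ 2) ^ m) (leading (suc m)) ⟩
      (+ 2) ^ suc m * leading (suc m)                        ∎
      where
      open ≡-Reasoning
      N = dbl (suc m)
      p*[2*x]≡2*p*x : ∀ p x → p * (+ 2 * x) ≡ + 2 * p * x
      p*[2*x]≡2*p*x = solve-∀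
      x*u*[y*v]≡x*y*[u*v] : ∀ x y u v → x * u * (y * v) ≡ x * y * (u * v)
      x*u*[y*v]≡x*y*[u*v] = solve-∀
      term : ∀ i j → i ℕ.+ j ≡ N → oddE i * oddE j ≡ (+ 2) ^ m * (atOdd leading i * atOdd leading j)
      term i j i+j≡ with evenSplit i j i+j≡
      ... | even+even a b _ rewrite atOdd-even (λ a → E (suc (dbl a))) a | atOdd-even leading a =
        sym (*-zeroʳ ((+ 2) ^ m))
      ... | odd+odd a b 1+a+b≡1+m
        with a+b≡m ← ℕₚ.suc-injective 1+a+b≡1+m
        rewrite atOdd-odd (λ a → E (suc (dbl a))) a | atOdd-odd (λ a → E (suc (dbl a))) b
              | atOdd-odd leading a | atOdd-odd leading b = begin
        E (suc (dbl a)) * E (suc (dbl b))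
          ≡⟨ cong₂ _*_ (IH (ℕ.s≤s (subst (a ℕ.≤_) a+b≡m (ℕₚ.m≤m+n a b))))
                       (IH (ℕ.s≤s (subst (b ℕ.≤_) a+b≡m (ℕₚ.m≤n+m b a)))) ⟩
        (+ 2) ^ a * leading a * ((+ 2) ^ b * leading b)
          ≡⟨ x*u*[y*v]≡x*y*[u*v] ((+ 2) ^ a) ((+ 2) ^ b) (leading a) (leading b) ⟩
        (+ 2) ^ a * (+ 2) ^ b * (leading a * leading b)
          ≡⟨ cong (_* (leading a * leading b)) (trans (sym (^-distribˡ-+-* (+ 2) a b)) (cong ((+ 2) ^_) a+b≡m)) ⟩
        (+ 2) ^ m * (leading a * leading b) ∎

module Expansion where

  open Recurrence using (a-suc-zero; a-suc-one; a-suc-suc-suc; a-above)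
  open Polynomials
  open GammaTriangle
  open import Data.Nat as ℕ using (ℕ; zero; suc; _∸_)
  import Data.Nat.Properties as ℕₚ
  open import Data.Integer using (ℤ; +_; -_; _+_; _*_; _-_)
  open import Data.Integer.Properties
  open import Data.Integer.Tactic.RingSolver using (solve-∀)
  open import Relation.Binary.PropositionalEquality
  open import Relation.Nullary using (yes; no)
  open import Data.Product using (_,_)
  open PolySolver

  t-t³ : Poly
  t-t³ = tₚ +P const (- + 1) *P (tₚ *P (tₚ *P tₚ))

  t+nt² : ℕ → Poly
  t+nt² n = tₚ +P const (+ n) *P (tₚ *P tₚ)

  L : ℕ → Poly → Poly
  L n f = t-t³ *P deriv f +P t+nt² n *P f

  L≈ : ∀ n f → L n f ≈
    shift (deriv f) +P (- + 1) · shift (shift (shift (deriv f))) +P shift f +P (+ n) · shift (shift f)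
  L≈ n f = begin
    L n f
      ≈⟨ solve 5 (λ T C₁ Cₙ F′ F → (T :+ C₁ :* (T :* (T :* T))) :* F′ :+ (T :+ Cₙ :* (T :* T)) :* F
                               := T :* F′ :+ C₁ :* (T :* (T :* (T :* F′))) :+ T :* F :+ Cₙ :* (T :* (T :* F)))
               ≈-refl tₚ (const (- + 1)) (const (+ n)) (deriv f) f ⟩
    tₚ *P deriv f +P const (- + 1) *P (tₚ *P (tₚ *P (tₚ *P deriv f))) +P tₚ *P f
      +P const (+ n) *P (tₚ *P (tₚ *P f))
      ≈⟨ +P-cong (+P-cong (+P-cong (≈-sym (shift≈tₚ* (deriv f)))
                                    (≈-trans (*P-congʳ (const (- + 1)) (≈-sym (shift³≈ (deriv f))))
                                             (≈-sym (·≈const* (- + 1) (shift (shift (shift (deriv f))))))))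
                          (≈-sym (shift≈tₚ* f)))
                 (≈-trans (*P-congʳ (const (+ n)) (≈-sym (shift²≈ f)))
                          (≈-sym (·≈const* (+ n) (shift (shift f))))) ⟩
    shift (deriv f) +P (- + 1) · shift (shift (shift (deriv f))) +P shift f +P (+ n) · shift (shift f) ∎
    where
    open ≈-Reasoning
    shift³≈ : ∀ p → shift (shift (shift p)) ≈ tₚ *P (tₚ *P (tₚ *P p))
    shift³≈ p = ≈-trans (shift≈tₚ* _) (*P-congʳ tₚ (shift²≈ p))

  coeff-L : ∀ n f k → coeff (L n f) k ≡
    coeff (shift (deriv f)) k + (- + 1) * coeff (shift (shift (shift (deriv f)))) k
      + coeff (shift f) k + + n * coeff (shift (shift f)) k
  coeff-L n f k = begin
    coeff (L n f) k
      ≡⟨ coeff≡ (L≈ n f) k ⟩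
    coeff (S₁ +P (- + 1) · S₃ +P shift f +P (+ n) · shift (shift f)) k
      ≡⟨ coeff-+P (S₁ +P (- + 1) · S₃ +P shift f) ((+ n) · shift (shift f)) k ⟩
    coeff (S₁ +P (- + 1) · S₃ +P shift f) k + coeff ((+ n) · shift (shift f)) k
      ≡⟨ cong₂ _+_ (coeff-+P₃ S₁ ((- + 1) · S₃) (shift f) k) (coeff-· (+ n) (shift (shift f)) k) ⟩
    coeff S₁ k + coeff ((- + 1) · S₃) k + coeff (shift f) k + + n * coeff (shift (shift f)) k
      ≡⟨ cong (λ x → coeff S₁ k + x + coeff (shift f) k + + n * coeff (shift (shift f)) k)
              (coeff-· (- + 1) S₃ k) ⟩
    coeff S₁ k + (- + 1) * coeff S₃ k + coeff (shift f) k + + n * coeff (shift (shift f)) k ∎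
    where
    open ≡-Reasoning
    S₁ S₃ : Poly
    S₁ = shift (deriv f)
    S₃ = shift (shift (shift (deriv f)))

  coeff-T : ∀ n k → coeff (Tpoly n) k ≡ + a k n
  coeff-T n = coeff-table (λ k n<k → cong +_ (a-above n k n<k))

  T-suc : ∀ n → Tpoly (suc n) ≈ L n (Tpoly n)
  T-suc n = coeffwise λ k → trans (coeff-T (suc n) k) (sym (trans (coeff-L n T k) (rhs k)))
    where
    T : Poly
    T = Tpoly n
    t : ℕ → ℤ
    t k = + a k n
    rhs : ∀ k → coeff (shift (deriv T)) k + (- + 1) * coeff (shift (shift (shift (deriv T)))) k
                  + coeff (shift T) k + + n * coeff (shift (shift T)) k ≡ + a k (suc n)
    rhs zero = begin
      + 0 * coeff T 0 + - + 1 * + 0 + + 0 + + n * + 0   ≡⟨ simplify (+ n) (coeff T 0) ⟩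
      + 0                                                ≡⟨ cong +_ (a-suc-zero n) ⟨
      + a 0 (suc n)                                      ∎
      where
      open ≡-Reasoning
      simplify : ∀ N x → + 0 * x + - + 1 * + 0 + + 0 + N * + 0 ≡ + 0
      simplify = solve-∀
    rhs (suc zero) = begin
      coeff (deriv T) 0 + - + 1 * + 0 + coeff T 0 + + n * + 0
        ≡⟨ cong₂ (λ x y → x + - + 1 * + 0 + y + + n * + 0)
                 (trans (coeff-deriv T 0) (cong (+ 1 *_) (coeff-T n 1))) (coeff-T n 0) ⟩
      + 1 * t 1 + - + 1 * + 0 + t 0 + + n * + 0
        ≡⟨ simplify (+ n) (t 1) (t 0) ⟩
      t 1 + t 0
        ≡⟨ cong +_ (a-suc-one n) ⟨
      + a 1 (suc n) ∎
      where
      open ≡-Reasoning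
      simplify : ∀ N x y → + 1 * x + - + 1 * + 0 + y + N * + 0 ≡ x + y
      simplify = solve-∀
    rhs (suc (suc k)) = begin
      coeff (deriv T) (suc k) + - + 1 * coeff (shift (deriv T)) k + coeff T (suc k) + + n * coeff T k
        ≡⟨ cong₂ (λ x y → x + - + 1 * y + coeff T (suc k) + + n * coeff T k)
                 (coeff-deriv T (suc k)) (coeff-shift-deriv T k) ⟩
      + suc (suc k) * coeff T (suc (suc k)) + - + 1 * (+ k * coeff T k) + coeff T (suc k) + + n * coeff T k
        ≡⟨ cong₃ (λ x y z → + suc (suc k) * x + - + 1 * (+ k * z) + y + + n * z)
                 (coeff-T n (suc (suc k))) (coeff-T n (suc k)) (coeff-T n k) ⟩
      + suc (suc k) * t (suc (suc k)) + - + 1 * (+ k * t k) + t (suc k) + + n * t k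
        ≡⟨ simplify (+ n) (+ k) (+ suc (suc k)) (t (suc (suc k))) (t (suc k)) (t k) ⟩
      + suc (suc k) * t (suc (suc k)) + (t (suc k) + (+ n - + k) * t k)
        ≡⟨ cong (λ x → + suc (suc k) * t (suc (suc k)) + (t (suc k) + x)) (weight k) ⟨
      + suc (suc k) * t (suc (suc k)) + (t (suc k) + + ((n ∸ k) ℕ.* a k n))
        ≡⟨ cong₂ _+_ (pos-* (suc (suc k)) (a (suc (suc k)) n)) (pos-+ (a (suc k) n) ((n ∸ k) ℕ.* a k n)) ⟨
      + (suc (suc k) ℕ.* a (suc (suc k)) n) + + (a (suc k) n ℕ.+ (n ∸ k) ℕ.* a k n)
        ≡⟨ pos-+ (suc (suc k) ℕ.* a (suc (suc k)) n) (a (suc k) n ℕ.+ (n ∸ k) ℕ.* a k n) ⟨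
      + (suc (suc k) ℕ.* a (suc (suc k)) n ℕ.+ (a (suc k) n ℕ.+ (n ∸ k) ℕ.* a k n))
        ≡⟨ cong +_ (a-suc-suc-suc n k) ⟨
      + a (suc (suc k)) (suc n) ∎
      where
      open ≡-Reasoning
      cong₃ : ∀ {A B C D : Set} (f : A → B → C → D) {x x′ y y′ z z′} →
              x ≡ x′ → y ≡ y′ → z ≡ z′ → f x y z ≡ f x′ y′ z′
      cong₃ f refl refl refl = refl
      simplify : ∀ N K K₂ x y z → K₂ * x + - + 1 * (K * z) + y + N * z ≡ K₂ * x + (y + (N - K) * z)
      simplify = solve-∀
      -- truncated subtraction is harmless: a k n = 0 when k > n
      weight : ∀ k → + ((n ∸ k) ℕ.* a k n) ≡ (+ n - + k) * t k
      weight k with k ℕ.≤? n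
      ... | yes k≤n = trans (pos-* (n ∸ k) (a k n)) (cong (_* t k) (sym (trans (m-n≡m⊖n n k) (⊖-≥ k≤n))))
      ... | no  k≰n rewrite a-above n k (ℕₚ.≰⇒> k≰n) =
        trans (cong +_ (ℕₚ.*-zeroʳ (n ∸ k))) (sym (*-zeroʳ (+ n - + k)))

  L-cong : ∀ n {p q} → p ≈ q → L n p ≈ L n q
  L-cong n p≈q = +P-cong (*P-congʳ t-t³ (deriv-cong p≈q)) (*P-congʳ (t+nt² n) p≈q)

  L-+P : ∀ n p q → L n (p +P q) ≈ L n p +P L n q
  L-+P n p q = begin
    t-t³ *P deriv (p +P q) +P t+nt² n *P (p +P q)
      ≈⟨ +P-cong (≈-trans (*P-congʳ t-t³ (deriv-+P p q)) (*P-distribˡ t-t³ (deriv p) (deriv q)))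
                 (*P-distribˡ (t+nt² n) p q) ⟩
    (t-t³ *P deriv p +P t-t³ *P deriv q) +P (t+nt² n *P p +P t+nt² n *P q)
      ≈⟨ +P-interchange (t-t³ *P deriv p) (t-t³ *P deriv q) (t+nt² n *P p) (t+nt² n *P q) ⟩
    L n p +P L n q ∎
    where open ≈-Reasoning

  L-· : ∀ n c p → L n (c · p) ≈ c · L n p
  L-· n c p = begin
    t-t³ *P deriv (c · p) +P t+nt² n *P (c · p)
      ≈⟨ +P-cong (≈-trans (*P-congʳ t-t³ (deriv-· c p)) (*P-·ʳ c t-t³ (deriv p))) (*P-·ʳ c (t+nt² n) p) ⟩
    c · (t-t³ *P deriv p) +P c · (t+nt² n *P p)
      ≈⟨ ·-distribˡ-+P c (t-t³ *P deriv p) (t+nt² n *P p) ⟨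
    c · L n p ∎
    where open ≈-Reasoning

  L-ΣP : ∀ n N f → L n (ΣP N f) ≈ ΣP N (λ j → L n (f j))
  L-ΣP n zero    f = +P-cong (*P-zeroʳ t-t³) (*P-zeroʳ (t+nt² n))
  L-ΣP n (suc N) f = ≈-trans (L-+P n (ΣP N f) (f N)) (+P-cong (L-ΣP n N f) (≈-refl {L n (f N)}))

  deriv-^ₚ : ∀ {W p q} → W *P deriv p ≈ q *P p → ∀ m → W *P deriv (p ^ₚ m) ≈ (+ m) · (q *P p ^ₚ m)
  deriv-^ₚ {W} {p} {q} _ zero = begin
    W *P deriv 1ₚ          ≈⟨ *P-congʳ W (coeffwise λ { zero → refl ; (suc k) → refl }) ⟩
    W *P 0ₚ                ≈⟨ *P-zeroʳ W ⟩
    0ₚ                     ≈⟨ ·-zero (q *P 1ₚ) ⟨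
    (+ 0) · (q *P 1ₚ)      ∎
    where open ≈-Reasoning
  deriv-^ₚ {W} {p} {q} Wp′≈qp (suc m) = begin
    W *P deriv (p *P pᵐ)
      ≈⟨ *P-congʳ W (leibniz p pᵐ) ⟩
    W *P (deriv p *P pᵐ +P p *P deriv pᵐ)
      ≈⟨ solve 5 (λ W P′ Q P Q′ → W :* (P′ :* Q :+ P :* Q′) := (W :* P′) :* Q :+ P :* (W :* Q′))
               ≈-refl W (deriv p) pᵐ p (deriv pᵐ) ⟩
    (W *P deriv p) *P pᵐ +P p *P (W *P deriv pᵐ)
      ≈⟨ +P-cong (*P-congˡ pᵐ Wp′≈qp)
                 (*P-congʳ p (≈-trans (deriv-^ₚ {W} {p} {q} Wp′≈qp m) (·≈const* (+ m) (q *P pᵐ)))) ⟩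
    (q *P p) *P pᵐ +P p *P (const (+ m) *P (q *P pᵐ))
      ≈⟨ solve 4 (λ Q P R M → Q :* P :* R :+ P :* (M :* (Q :* R)) := (con (+ 1) :+ M) :* (Q :* (P :* R)))
               ≈-refl q p pᵐ (const (+ m)) ⟩
    const (+ suc m) *P (q *P (p *P pᵐ))
      ≈⟨ ·≈const* (+ suc m) (q *P (p *P pᵐ)) ⟨
    (+ suc m) · (q *P (p *P pᵐ)) ∎
    where
    open ≈-Reasoning
    pᵐ : Poly
    pᵐ = p ^ₚ m

  1-t² t-t² : Poly
  1-t² = 1ₚ +P const (- + 1) *P (tₚ *P tₚ)
  t-t² = tₚ +P const (- + 1) *P (tₚ *P tₚ)

  deriv-tₚ : deriv tₚ ≈ 1ₚ
  deriv-tₚ = coeffwise λ { 0 → refl ; 1 → refl ; (suc (suc k)) → refl }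

  deriv-onePlusT : deriv onePlusT ≈ 1ₚ
  deriv-onePlusT = coeffwise λ { 0 → refl ; 1 → refl ; (suc (suc k)) → refl }

  deriv-tₚ^ : ∀ j → t-t³ *P deriv (tₚ ^ₚ j) ≈ (+ j) · (1-t² *P tₚ ^ₚ j)
  deriv-tₚ^ = deriv-^ₚ {t-t³} {tₚ} {1-t²} (≈-trans (*P-congʳ t-t³ deriv-tₚ)
    (solve 1 (λ T → (T :+ con (- + 1) :* (T :* (T :* T))) :* con (+ 1)
                  := (con (+ 1) :+ con (- + 1) :* (T :* T)) :* T) ≈-refl tₚ))

  deriv-onePlusT^ : ∀ m → t-t³ *P deriv (onePlusT ^ₚ m) ≈ (+ m) · (t-t² *P onePlusT ^ₚ m)
  deriv-onePlusT^ = deriv-^ₚ {t-t³} {onePlusT} {t-t²} (≈-trans (*P-congʳ t-t³ deriv-onePlusT)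
    (solve 1 (λ T → (T :+ con (- + 1) :* (T :* (T :* T))) :* con (+ 1)
                  := (T :+ con (- + 1) :* (T :* T)) :* (con (+ 1) :+ T)) ≈-refl tₚ))

  basis : ℕ → ℕ → Poly
  basis n j = tₚ ^ₚ j *P onePlusT ^ₚ (n ∸ j)

  1+m+j-2j≡1+m-j : ∀ m j → + suc (m ℕ.+ j) - + (j ℕ.+ j) ≡ + 1 + + m + - + 1 * + j
  1+m+j-2j≡1+m-j m j = begin
    + suc (m ℕ.+ j) - + (j ℕ.+ j)    ≡⟨ cong₂ _-_ (pos-+ 1 (m ℕ.+ j)) (pos-+ j j) ⟩
    + 1 + + (m ℕ.+ j) - (+ j + + j)  ≡⟨ cong (λ x → + 1 + x - (+ j + + j)) (pos-+ m j) ⟩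
    + 1 + (+ m + + j) - (+ j + + j)  ≡⟨ simplify (+ m) (+ j) ⟩
    + 1 + + m + - + 1 * + j          ∎
    where
    open ≡-Reasoning
    simplify : ∀ M J → + 1 + (M + J) - (J + J) ≡ + 1 + M + - + 1 * J
    simplify = solve-∀

  L-basis : ∀ n j → j ℕ.≤ n →
    L n (basis n j) ≈ (+ j) · basis (suc n) j +P (+ suc n - + (j ℕ.+ j)) · basis (suc n) (suc j)
  L-basis n j j≤n = begin
    t-t³ *P deriv (P *P O) +P t+nt² n *P (P *P O)
      ≈⟨ +P-cong (≈-trans (*P-congʳ t-t³ (leibniz P O))
                   (solve 5 (λ W P P′ O O′ → W :* (P′ :* O :+ P :* O′) := (W :* P′) :* O :+ P :* (W :* O′))
                          ≈-refl t-t³ P (deriv P) O (deriv O)))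
                 (*P-congˡ (P *P O) (+P-cong (≈-refl {tₚ}) (*P-congˡ (tₚ *P tₚ) n≈m+j))) ⟩
    (t-t³ *P deriv P) *P O +P P *P (t-t³ *P deriv O) +P t+m+jt² *P (P *P O)
      ≈⟨ +P-cong (+P-cong (*P-congˡ O (≈-trans (deriv-tₚ^ j) (·≈const* (+ j) _)))
                          (*P-congʳ P (≈-trans (deriv-onePlusT^ m) (·≈const* (+ m) _))))
                 (≈-refl {t+m+jt² *P (P *P O)}) ⟩
    (Jₚ *P (1-t² *P P)) *P O +P P *P (Mₚ *P (t-t² *P O)) +P t+m+jt² *P (P *P O)
      ≈⟨ solve 5 (λ T P O J M →
              (J :* ((con (+ 1) :+ con (- + 1) :* (T :* T)) :* P)) :* O
           :+ P :* (M :* ((T :+ con (- + 1) :* (T :* T)) :* O))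
           :+ (T :+ (M :+ J) :* (T :* T)) :* (P :* O)
           := J :* (P :* ((con (+ 1) :+ T) :* O)) :+ (con (+ 1) :+ M :+ con (- + 1) :* J) :* ((T :* P) :* O))
               ≈-refl tₚ P O Jₚ Mₚ ⟩
    Jₚ *P (P *P (onePlusT *P O)) +P (1ₚ +P Mₚ +P const (- + 1) *P Jₚ) *P ((tₚ *P P) *P O)
      ≈⟨ +P-cong (≈-sym (≈-trans (·≈const* (+ j) (basis (suc n) j)) (*P-congʳ Jₚ (*P-congʳ P O′≈))))
                 (≈-sym (≈-trans (·≈const* (+ suc n - + (j ℕ.+ j)) _) (*P-congˡ _ coefficient≈))) ⟩
    (+ j) · basis (suc n) j +P (+ suc n - + (j ℕ.+ j)) · basis (suc n) (suc j) ∎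
    where
    open ≈-Reasoning
    m : ℕ
    m = n ∸ j
    P O Jₚ Mₚ t+m+jt² : Poly
    P = tₚ ^ₚ j
    O = onePlusT ^ₚ m
    Jₚ = const (+ j)
    Mₚ = const (+ m)
    t+m+jt² = tₚ +P (Mₚ +P Jₚ) *P (tₚ *P tₚ)
    n≡m+j : n ≡ m ℕ.+ j
    n≡m+j = sym (ℕₚ.m∸n+n≡m j≤n)
    n≈m+j : const (+ n) ≈ Mₚ +P Jₚ
    n≈m+j = ∷-cong (trans (cong +_ n≡m+j) (pos-+ m j)) ≈-refl
    O′≈ : onePlusT ^ₚ (suc n ∸ j) ≈ onePlusT *P O
    O′≈ rewrite ℕₚ.+-∸-assoc 1 j≤n = ≈-refl
    coefficient≈ : const (+ suc n - + (j ℕ.+ j)) ≈ 1ₚ +P Mₚ +P const (- + 1) *P Jₚ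
    coefficient≈ = ≈-trans (∷-cong coefficient≡ ≈-refl)
                           (+P-cong (≈-refl {1ₚ +P Mₚ}) (const-* (- + 1) (+ j)))
      where
      coefficient≡ : + suc n - + (j ℕ.+ j) ≡ + 1 + + m + - + 1 * + j
      coefficient≡ = trans (cong (λ x → + suc x - + (j ℕ.+ j)) n≡m+j) (1+m+j-2j≡1+m-j m j)

  B : ℕ → Poly
  B n = ΣP (suc n) (λ j → γ n j · basis n j)

  B-suc : ∀ n → B (suc n) ≈ L n (B n)
  B-suc n = begin
    B (suc n)
      ≈⟨ ΣP-suc (suc n) (λ j → γ (suc n) j · basis′ j) ⟩
    (+ 0) · basis′ 0 +P ΣP (suc n) (λ j → γ (suc n) (suc j) · basis′ (suc j))
      ≈⟨ +P-cong (·-zero (basis′ 0)) (ΣP-cong (suc n) λ j _ →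
           ·-distribʳ-+ (+ suc j * γ n (suc j)) (K j * γ n j) (basis′ (suc j))) ⟩
    ΣP (suc n) (λ j → (+ suc j * γ n (suc j)) · basis′ (suc j) +P (K j * γ n j) · basis′ (suc j))
      ≈⟨ ΣP-+P (suc n) _ _ ⟩
    ΣP (suc n) (λ j → (+ suc j * γ n (suc j)) · basis′ (suc j)) +P
    ΣP (suc n) (λ j → (K j * γ n j) · basis′ (suc j))
      ≈⟨ +P-cong reindex (ΣP-cong (suc n) λ j _ → ·-congˡ (basis′ (suc j)) (*-comm (γ n j) (K j))) ⟨
    ΣP (suc n) (λ j → (γ n j * + j) · basis′ j) +P ΣP (suc n) (λ j → (γ n j * K j) · basis′ (suc j))
      ≈⟨ ΣP-+P (suc n) _ _ ⟨
    ΣP (suc n) (λ j → (γ n j * + j) · basis′ j +P (γ n j * K j) · basis′ (suc j))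
      ≈⟨ ΣP-cong (suc n) L-term ⟨
    ΣP (suc n) (λ j → L n (γ n j · basis n j))
      ≈⟨ L-ΣP n (suc n) (λ j → γ n j · basis n j) ⟨
    L n (B n) ∎
    where
    open ≈-Reasoning
    basis′ : ℕ → Poly
    basis′ = basis (suc n)
    K : ℕ → ℤ
    K j = + suc n - + (j ℕ.+ j)
    L-term : ∀ j → j ℕ.< suc n →
             L n (γ n j · basis n j) ≈ (γ n j * + j) · basis′ j +P (γ n j * K j) · basis′ (suc j)
    L-term j j<1+n = begin
      L n (γ n j · basis n j)
        ≈⟨ L-· n (γ n j) (basis n j) ⟩
      γ n j · L n (basis n j)
        ≈⟨ ·-cong (γ n j) (L-basis n j (ℕ.s≤s⁻¹ j<1+n)) ⟩
      γ n j · ((+ j) · basis′ j +P K j · basis′ (suc j))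
        ≈⟨ ·-distribˡ-+P (γ n j) ((+ j) · basis′ j) (K j · basis′ (suc j)) ⟩
      γ n j · ((+ j) · basis′ j) +P γ n j · (K j · basis′ (suc j))
        ≈⟨ +P-cong (·-assoc (γ n j) (+ j) (basis′ j)) (·-assoc (γ n j) (K j) (basis′ (suc j))) ⟩
      (γ n j * + j) · basis′ j +P (γ n j * K j) · basis′ (suc j) ∎
    -- the term j = 0 on the left and the term j = n on the right vanish
    reindex : ΣP (suc n) (λ j → (γ n j * + j) · basis′ j) ≈
              ΣP (suc n) (λ j → (+ suc j * γ n (suc j)) · basis′ (suc j))
    reindex = begin
      ΣP (suc n) (λ j → (γ n j * + j) · basis′ j)
        ≈⟨ ΣP-suc n (λ j → (γ n j * + j) · basis′ j) ⟩
      (γ n 0 * + 0) · basis′ 0 +P ΣP n (λ j → (γ n (suc j) * + suc j) · basis′ (suc j))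
        ≈⟨ +P-cong (≈-trans (·-congˡ (basis′ 0) (*-zeroʳ (γ n 0))) (·-zero (basis′ 0)))
                   (ΣP-cong n (λ j _ → ·-congˡ (basis′ (suc j)) (*-comm (γ n (suc j)) (+ suc j)))) ⟩
      ΣP n (λ j → (+ suc j * γ n (suc j)) · basis′ (suc j))
        ≈⟨ +P-identityʳ _ ⟨
      ΣP n (λ j → (+ suc j * γ n (suc j)) · basis′ (suc j)) +P 0ₚ
        ≈⟨ +P-cong (≈-refl {ΣP n (λ j → (+ suc j * γ n (suc j)) · basis′ (suc j))}) last≈0 ⟨
      ΣP (suc n) (λ j → (+ suc j * γ n (suc j)) · basis′ (suc j)) ∎
      where
      last≈0 : (+ suc n * γ n (suc n)) · basis′ (suc n) ≈ 0ₚ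
      last≈0 = ≈-trans (·-congˡ (basis′ (suc n)) (trans (cong (+ suc n *_) (γ-above n (suc n) (ℕₚ.n<1+n n)))
                                                         (*-zeroʳ (+ suc n))))
                       (·-zero (basis′ (suc n)))

  B≈T : ∀ n → B n ≈ Tpoly n
  B≈T zero    = coeffwise λ { zero → refl ; (suc k) → refl }
  B≈T (suc n) = ≈-trans (B-suc n) (≈-trans (L-cong n (B≈T n)) (≈-sym (T-suc n)))

  Deg≤1-tₚ : Deg≤ tₚ 1
  Deg≤1-tₚ (suc (suc k)) _ = refl
  Deg≤1-tₚ (suc zero) (ℕ.s≤s ())

  Deg≤1-onePlusT : Deg≤ onePlusT 1
  Deg≤1-onePlusT (suc (suc k)) _ = refl
  Deg≤1-onePlusT (suc zero) (ℕ.s≤s ())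

  coeff-basis-top : ∀ n j → j ℕ.≤ n → coeff (basis n j) n ≡ + 1
  coeff-basis-top n j j≤n
    with degᵗ , topᵗ ← monic-^ₚ Deg≤1-tₚ refl j
    with degᵒ , topᵒ ← monic-^ₚ Deg≤1-onePlusT refl (n ∸ j) = begin
    coeff (basis n j) n                 ≡⟨ cong (coeff (basis n j)) (ℕₚ.m+[n∸m]≡n j≤n) ⟨
    coeff (basis n j) (j ℕ.+ (n ∸ j))   ≡⟨ top-*P (tₚ ^ₚ j) (onePlusT ^ₚ (n ∸ j)) degᵗ degᵒ ⟩
    coeff (tₚ ^ₚ j) j * coeff (onePlusT ^ₚ (n ∸ j)) (n ∸ j) ≡⟨ cong₂ _*_ topᵗ topᵒ ⟩
    + 1                                 ∎
    where open ≡-Reasoning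

  coeff-B-top : ∀ n → coeff (B n) n ≡ eval (Γ n) (+ 1)
  coeff-B-top n = begin
    coeff (B n) n                                ≡⟨ coeff-ΣP (suc n) (λ j → γ n j · basis n j) n ⟩
    ΣZ (suc n) (λ j → coeff (γ n j · basis n j) n) ≡⟨ ΣZ-cong (suc n) term ⟩
    ΣZ (suc n) (γ n)                             ≡⟨ eval-table-1 (γ n) n ⟨
    eval (Γ n) (+ 1)                             ∎
    where
    open ≡-Reasoning
    term : ∀ j → j ℕ.< suc n → coeff (γ n j · basis n j) n ≡ γ n j
    term j j<1+n = trans (coeff-· (γ n j) (basis n j) n)
                         (trans (cong (γ n j *_) (coeff-basis-top n j (ℕ.s≤s⁻¹ j<1+n))) (*-identityʳ (γ n j)))

module Quotient where

  open Recurrence using (tangent≡a)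
  open Polynomials
  open GammaTriangle
  open Parity
  open GammaDegrees
  open EulerNumbers
  open Expansion
  open import Data.Nat as ℕ using (ℕ; zero; suc; _∸_)
  import Data.Nat.Properties as ℕₚ
  open import Data.Nat.DivMod using (m*n/n≡m; +-distrib-/-∣ʳ)
  open import Data.Nat.Divisibility using (divides)
  open import Data.Integer using (+_; -_; _+_; _*_; _^_)
  open import Data.Integer.Properties
  open import Data.Integer.Tactic.RingSolver using (solve-∀)
  open import Relation.Binary.PropositionalEquality
  open import Data.Empty using (⊥-elim)

  onePlusT^-+ : ∀ a b → onePlusT ^ₚ (a ℕ.+ b) ≈ onePlusT ^ₚ a *P onePlusT ^ₚ b
  onePlusT^-+ zero    b = ≈-sym (*P-identityˡ (onePlusT ^ₚ b))
  onePlusT^-+ (suc a) b = ≈-trans (*P-congʳ onePlusT (onePlusT^-+ a b))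
                                  (≈-sym (*P-assoc onePlusT (onePlusT ^ₚ a) (onePlusT ^ₚ b)))

  -- The quotient of B n by (1 + t)ʰ when γ(n, j) = 0 for j > c = n - h.
  U : ℕ → ℕ → Poly
  U n c = ΣP (suc c) (λ j → γ n j · basis c j)

  onePlusT^*U≈B : ∀ n h c → h ℕ.+ c ≡ n → (∀ j → c ℕ.< j → γ n j ≡ + 0) →
                  onePlusT ^ₚ h *P U n c ≈ B n
  onePlusT^*U≈B n h c h+c≡n vanish = begin
    onePlusT ^ₚ h *P U n c
      ≈⟨ *P-ΣP (onePlusT ^ₚ h) (suc c) (λ j → γ n j · basis c j) ⟩
    ΣP (suc c) (λ j → onePlusT ^ₚ h *P (γ n j · basis c j))
      ≈⟨ ΣP-cong (suc c) term ⟩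
    ΣP (suc c) (λ j → γ n j · basis n j)
      ≈⟨ ΣP-zeros (suc c) h _ (λ j c<j → ≈-trans (·-congˡ (basis n j) (vanish j c<j)) (·-zero (basis n j))) ⟩
    ΣP (suc c ℕ.+ h) (λ j → γ n j · basis n j)
      ≡⟨ cong (λ N → ΣP (suc N) (λ j → γ n j · basis n j)) (trans (ℕₚ.+-comm c h) h+c≡n) ⟩
    B n ∎
    where
    open ≈-Reasoning
    term : ∀ j → j ℕ.< suc c → onePlusT ^ₚ h *P (γ n j · basis c j) ≈ γ n j · basis n j
    term j j<1+c = ≈-trans (*P-·ʳ (γ n j) (onePlusT ^ₚ h) (basis c j)) (·-cong (γ n j) (begin
      O h *P (tₚ ^ₚ j *P O (c ∸ j))      ≈⟨ *P-assoc (O h) (tₚ ^ₚ j) (O (c ∸ j)) ⟨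
      O h *P tₚ ^ₚ j *P O (c ∸ j)        ≈⟨ *P-congˡ (O (c ∸ j)) (*P-comm (O h) (tₚ ^ₚ j)) ⟩
      tₚ ^ₚ j *P O h *P O (c ∸ j)        ≈⟨ *P-assoc (tₚ ^ₚ j) (O h) (O (c ∸ j)) ⟩
      tₚ ^ₚ j *P (O h *P O (c ∸ j))      ≈⟨ *P-congʳ (tₚ ^ₚ j) (onePlusT^-+ h (c ∸ j)) ⟨
      tₚ ^ₚ j *P O (h ℕ.+ (c ∸ j))       ≡⟨ cong (λ e → tₚ ^ₚ j *P O e) h+[c∸j]≡n∸j ⟩
      basis n j                          ∎))
      where
      O : ℕ → Poly
      O = onePlusT ^ₚ_
      h+[c∸j]≡n∸j : h ℕ.+ (c ∸ j) ≡ n ∸ j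
      h+[c∸j]≡n∸j = trans (sym (ℕₚ.+-∸-assoc h (ℕ.s≤s⁻¹ j<1+c))) (cong (_∸ j) h+c≡n)

  eval-basis-at-−1 : ∀ c j → j ℕ.< c → eval (basis c j) (- + 1) ≡ + 0
  eval-basis-at-−1 c j j<c with c ∸ j | ℕₚ.m>n⇒m∸n≢0 j<c
  ... | zero  | c∸j≢0 = ⊥-elim (c∸j≢0 refl)
  ... | suc e | _     = begin
    eval (tₚ ^ₚ j *P onePlusT ^ₚ suc e) (- + 1)
      ≡⟨ eval-*P (tₚ ^ₚ j) (onePlusT ^ₚ suc e) (- + 1) ⟩
    eval (tₚ ^ₚ j) (- + 1) * eval (onePlusT ^ₚ suc e) (- + 1)
      ≡⟨ cong (eval (tₚ ^ₚ j) (- + 1) *_) (eval-^ₚ onePlusT (suc e) (- + 1)) ⟩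
    eval (tₚ ^ₚ j) (- + 1) * eval onePlusT (- + 1) ^ suc e
      ≡⟨⟩
    eval (tₚ ^ₚ j) (- + 1) * + 0
      ≡⟨ *-zeroʳ (eval (tₚ ^ₚ j) (- + 1)) ⟩
    + 0 ∎
    where open ≡-Reasoning

  eval-U-at-−1 : ∀ n c → eval (U n c) (- + 1) ≡ γ n c * (- + 1) ^ c
  eval-U-at-−1 n c = begin
    eval (U n c) (- + 1)
      ≡⟨ eval-ΣP (suc c) (λ j → γ n j · basis c j) (- + 1) ⟩
    ΣZ c (λ j → eval (γ n j · basis c j) (- + 1)) + eval (γ n c · basis c c) (- + 1)
      ≡⟨ cong₂ _+_ (trans (ΣZ-cong c lower) (ΣZ-zeros c)) (eval-· (γ n c) (basis c c) (- + 1)) ⟩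
    + 0 + γ n c * eval (basis c c) (- + 1)
      ≡⟨ +-identityˡ _ ⟩
    γ n c * eval (tₚ ^ₚ c *P onePlusT ^ₚ (c ∸ c)) (- + 1)
      ≡⟨ cong (λ e → γ n c * eval (tₚ ^ₚ c *P onePlusT ^ₚ e) (- + 1)) (ℕₚ.n∸n≡0 c) ⟩
    γ n c * eval (tₚ ^ₚ c *P 1ₚ) (- + 1)
      ≡⟨ cong (γ n c *_) (trans (eval-cong (- + 1) (*P-identityʳ (tₚ ^ₚ c))) (eval-^ₚ tₚ c (- + 1))) ⟩
    γ n c * (- + 1) ^ c ∎
    where
    open ≡-Reasoning
    lower : ∀ j → j ℕ.< c → eval (γ n j · basis c j) (- + 1) ≡ + 0
    lower j j<c = trans (eval-· (γ n j) (basis c j) (- + 1))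
                        (trans (cong (γ n j *_) (eval-basis-at-−1 c j j<c)) (*-zeroʳ (γ n j)))

  dbl≡m*2 : ∀ m → dbl m ≡ m ℕ.* 2
  dbl≡m*2 m = trans (sym (2*≡dbl m)) (ℕₚ.*-comm 2 m)

  dbl/2 : ∀ m → dbl m ℕ./ 2 ≡ m
  dbl/2 m = trans (cong (ℕ._/ 2) (dbl≡m*2 m)) (m*n/n≡m m 2)

  1+dbl/2 : ∀ m → suc (dbl m) ℕ./ 2 ≡ m
  1+dbl/2 m = trans (cong (λ x → suc x ℕ./ 2) (dbl≡m*2 m))
                    (trans (+-distrib-/-∣ʳ 1 {m ℕ.* 2} (divides m refl)) (m*n/n≡m m 2))

  IsQuotient-U : ∀ n h c → h ℕ.+ c ≡ n → n ℕ./ 2 ≡ h → (∀ j → c ℕ.< j → γ n j ≡ + 0) →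
                 IsQuotient n (U n c)
  IsQuotient-U n h c h+c≡n n/2≡h vanish rewrite n/2≡h =
    coeff≡ (≈-sym (≈-trans (onePlusT^*U≈B n h c h+c≡n vanish) (B≈T n)))

  IsQuotient-unique : ∀ {n P Q} → IsQuotient n P → IsQuotient n Q → P ≈ Q
  IsQuotient-unique {n} qP qQ = cancel-onePlusT^ (n ℕ./ 2) (coeffwise λ k → trans (sym (qP k)) (qQ k))

  IsQuotient-even : ∀ m → IsQuotient (dbl m) (U (dbl m) m)
  IsQuotient-even m = IsQuotient-U (dbl m) m m (sym (dbl≡m+m m)) (dbl/2 m) (γ-even-above m)

  IsQuotient-odd : ∀ m → IsQuotient (suc (dbl m)) (U (suc (dbl m)) (suc m))
  IsQuotient-odd m = IsQuotient-U (suc (dbl m)) m (suc m) (trans (ℕₚ.+-suc m m) (cong suc (sym (dbl≡m+m m))))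
                                  (1+dbl/2 m) (γ-odd-above m)

  eval-quotient-even : ∀ {n P} → IsQuotient (dbl n) P → eval P (- + 1) ≡ γ (dbl n) n * (- + 1) ^ n
  eval-quotient-even {n} qP =
    trans (eval-cong (- + 1) (IsQuotient-unique qP (IsQuotient-even n))) (eval-U-at-−1 (dbl n) n)

  eval-quotient-odd : ∀ {n Q} → IsQuotient (suc (dbl n)) Q → eval Q (- + 1) ≡ - (γ (dbl n) n * (- + 1) ^ n)
  eval-quotient-odd {n} {Q} qQ = begin
    eval Q (- + 1)                                ≡⟨ eval-cong (- + 1) (IsQuotient-unique qQ (IsQuotient-odd n)) ⟩
    eval (U (suc (dbl n)) (suc n)) (- + 1)        ≡⟨ eval-U-at-−1 (suc (dbl n)) (suc n) ⟩
    γ (suc (dbl n)) (suc n) * (- + 1 * s)         ≡⟨ cong (_* (- + 1 * s)) (γ-odd-top n) ⟩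
    γ (dbl n) n * (- + 1 * s)                     ≡⟨ g*[-1*s]≡-[g*s] (γ (dbl n) n) s ⟩
    - (γ (dbl n) n * s)                           ∎
    where
    open ≡-Reasoning
    s = (- + 1) ^ n
    g*[-1*s]≡-[g*s] : ∀ g s → g * (- + 1 * s) ≡ - (g * s)
    g*[-1*s]≡-[g*s] = solve-∀

  tangent≡E : ∀ m → + tangent m ≡ E (suc (dbl m))
  tangent≡E m = begin
    + tangent m                ≡⟨ cong +_ (tangent≡a m) ⟩
    + a N′ N′                  ≡⟨ cong (λ k → + a (suc k) (suc k)) (2*≡dbl m) ⟩
    + a N N                    ≡⟨ coeff-T N N ⟨
    coeff (Tpoly N) N          ≡⟨ coeff≡ (B≈T N) N ⟨
    coeff (B N) N              ≡⟨ coeff-B-top N ⟩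
    E N                        ∎
    where
    open ≡-Reasoning
    N N′ : ℕ
    N  = suc (dbl m)
    N′ = suc (2 ℕ.* m)

  tangent≡2^*γ : ∀ n → + tangent n ≡ (+ 2) ^ n * γ (dbl n) n
  tangent≡2^*γ n = trans (tangent≡E n) (trans (E-odd≡2^*leading n) (cong ((+ 2) ^ n *_) (γ-odd-top n)))

open import Data.Nat using (ℕ; suc; _*_)
open import Data.Integer using (ℤ; +_; -_) renaming (_*_ to _*ℤ_; _^_ to _^ℤ_)
open import Data.Integer.Properties using (*-assoc; *-comm; neg-involutive)
open import Data.Product using (Σ; _×_; _,_)
open import Relation.Binary.PropositionalEquality using (_≡_; cong; subst; sym; trans)
open GammaTriangle using (γ)
open Parity using (dbl; 2*≡dbl; parity; even; odd)
open Quotient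

corollary3p2 : ((n : ℕ) → Σ Poly (λ U → IsQuotient n U))
    × ((n : ℕ) → (U V : Poly) → IsQuotient (2 * n) U → IsQuotient (suc (2 * n)) V →
        (eval U (- + 1) ≡ - eval V (- + 1))
        × (((+ 2) ^ℤ n) *ℤ eval U (- + 1) ≡ ((- + 1) ^ℤ n) *ℤ (+ tangent n)))
corollary3p2 = quotient , values
  where
  quotient : (n : ℕ) → Σ Poly (λ U → IsQuotient n U)
  quotient n with parity n
  ... | even m = U (dbl m) m , IsQuotient-even m
  ... | odd  m = U (suc (dbl m)) (suc m) , IsQuotient-odd m

  values : (n : ℕ) → (P Q : Poly) → IsQuotient (2 * n) P → IsQuotient (suc (2 * n)) Q →
           (eval P (- + 1) ≡ - eval Q (- + 1))
           × (((+ 2) ^ℤ n) *ℤ eval P (- + 1) ≡ ((- + 1) ^ℤ n) *ℤ (+ tangent n))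
  values n P Q qP qQ =
    trans evalP (trans (sym (neg-involutive (g *ℤ s))) (sym (cong -_ evalQ))) ,
    trans (cong (2ⁿ *ℤ_) evalP)
          (trans (sym (*-assoc 2ⁿ g s)) (trans (*-comm (2ⁿ *ℤ g) s) (cong (s *ℤ_) (sym (tangent≡2^*γ n)))))
    where
    g s 2ⁿ : ℤ
    g = γ (dbl n) n
    s = (- + 1) ^ℤ n
    2ⁿ = (+ 2) ^ℤ n
    evalP : eval P (- + 1) ≡ g *ℤ s
    evalP = eval-quotient-even (subst (λ k → IsQuotient k P) (2*≡dbl n) qP)
    evalQ : eval Q (- + 1) ≡ - (g *ℤ s)
    evalQ = eval-quotient-odd (subst (λ k → IsQuotient (suc k) Q) (2*≡dbl n) qQ)
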